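{- Let NQUEENS be the definite program consisting of the four clauses $pqs(0,X_1,X_2,X_3).$ $pqs(s(I),Cs,Us,[Y|Ds]) \gets pqs(I,Cs,[Z|Us],Ds),\ pq(s(I),Cs,Us,Ds).$ $pq(I,[I|X_1],[I|X_2],[I|X_3]).$ $pq(I,[Y_1|Cs],[Y_2|Us],[Y_3|Ds]) \gets pq(I,Cs,Us,Ds).$ (all capitalized identifiers are variables). Then $S^0 \subseteq \mathcal{O}(\mathrm{NQUEENS})$, where $S^0 = S^0_{pqs} \cup S_{pqs2} \cup S_{pq}$ and $S_{pq}$ is the set of atoms $pq(v,[c_1,\dots,c_k,v|c_0],[u_1,\dots,u_k,v|u_0],[d_1,\dots,d_k,v|d_0])$ with $k \ge 0$ and $v,c_0,\dots,c_k,u_0,\dots,u_k,d_0,\dots,d_k$ distinct variables; $S_{pqs2}$ is the set of atoms $pqs(0,cs,us,ds)$ with $cs,us,ds$ distinct variables; $S^0_{pqs}$ is the set of atoms $pqs(i,cs,us,[w|ds])$ such that: $i>0$; $w$ is a variable not occurring in $cs,us,ds$; $cs$ is correct up to $i$; the pair $(us,ds)$ is correct up to $i$ w.r.t. $i$ and $cs$; the terms $cs,us,ds$ are variable disjoint; $cs,us,ds$ are short g.v.d.'s; every ground member $j$ of $us$ or of $ds$ satisfies $j\in\{1,\dots,i\}$; and every ground member of $us$ has a positive up diagonal number in $cs$ w.r.t. $i$.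
   Context: Natural number $n$ is represented by the term $s^n(0)$, and we write $n$ for this term. The s-semantics $\mathcal{O}(P)$ of a definite program $P$ is the set of all atoms $p(V_1,\dots,V_n)\theta$ where $p$ is an $n$-ary predicate symbol, $V_1,\dots,V_n$ are distinct variables and $\theta$ is an SLD-computed answer substitution for the query $p(V_1,\dots,V_n)$. Prolog list notation is used. An open list of length $n\ge 0$ is a term $[t_1,\dots,t_n|v]$ with $v$ a variable (for $n=0$ it is just the variable $v$); $t_i$ is its $i$-th member. More generally, a term $s$ is the $k$-th member ($k>0$) of a term $t$ if $t = [t_1,\dots,t_{k-1},s|t_0]$ for some terms. A term is linear if no variable occurs in it twice. A term $t$ is a g.v.d. if it is linear, is an open list with pairwise distinct members, and each member is either a ground term or a variable. A g.v.d. $[t_1,\dots,t_n|v]$ is short if $n=0$ or $t_n$ is a ground term. If the queen $j$ (a positive natural number) is the $k$-th member of an open list $cs$, then for a natural number $i$ the up diagonal number of $j$ in $cs$ w.r.t. $i$ is $k+j-i$ and its down diagonal number is $k+i-j$. An open list $cs$ is correct up to $m$ (where $m\ge 0$) if $cs$ is a g.v.d., the set of its ground members is exactly $\{1,\dots,m\}$, the up diagonal numbers of these members in $cs$ are pairwise distinct, and their down diagonal numbers in $cs$ are pairwise distinct. A pair of terms $(us,ds)$ is correct up to $m$ w.r.t. $i\in\mathbb{N}$ and an open list $cs$ if for each $j\in\{1,\dots,m\}$: $j$ is a member of $cs$, and if the up (resp. down) diagonal number of $j$ in $cs$ w.r.t. $i$ is $l>0$ then the $l$-th member of $us$ (resp.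 $ds$) is $j$. -}

module Defs where

open import Data.Nat using (ℕ; zero; suc; _≤_; _<_; _≟_)
open import Data.Integer as ℤ using (ℤ; +_)
open import Data.List using (List; []; _∷_; _++_; map; length)
open import Data.List.Membership.Propositional using (_∈_)
open import Data.List.Relation.Unary.Any using (Any)
open import Data.List.Relation.Unary.Unique.Propositional using (Unique)
open import Data.Product using (Σ; _×_; _,_)
open import Data.Sum using (_⊎_)
open import Data.Empty using (⊥)
open import Relation.Nullary using (¬_; yes; no)
open import Relation.Binary.PropositionalEquality using (_≡_; _≢_)
open import Level using () renaming (suc to lsuc; zero to lzero)

Var : Set
Var = ℕ

data Term : Set where
  var  : Var → Term
  zro  : Term
  suc' : Term → Term
  nil  : Term
  cons : Term → Term → Term

num : ℕ → Term
num zero    = zro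
num (suc n) = suc' (num n)

data _∈v_ (x : Var) : Term → Set where
  here : x ∈v var x
  inS  : ∀ {t} → x ∈v t → x ∈v suc' t
  inH  : ∀ {h t} → x ∈v h → x ∈v cons h t
  inT  : ∀ {h t} → x ∈v t → x ∈v cons h t

occ : Var → Term → ℕ
occ x (var y) with x ≟ y
... | yes _ = 1
... | no  _ = 0
occ x zro        = 0
occ x (suc' t)   = occ x t
occ x nil        = 0
occ x (cons h t) = occ x h Data.Nat.+ occ x t

Ground : Term → Set
Ground t = ∀ x → ¬ (x ∈v t)

Linear : Term → Set
Linear t = ∀ x → occ x t ≤ 1

Subst : Set
Subst = Var → Term

sub : Subst → Term → Term
sub θ (var x)    = θ x
sub θ zro        = zro
sub θ (suc' t)   = suc' (sub θ t)
sub θ nil        = nil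
sub θ (cons h t) = cons (sub θ h) (sub θ t)

_⨾_ : Subst → Subst → Subst
(θ ⨾ σ) x = sub σ (θ x)

data Pred : Set where
  pqs pq : Pred

data Atom : Set where
  atom : Pred → Term → Term → Term → Term → Atom

subA : Subst → Atom → Atom
subA θ (atom p a b c d) = atom p (sub θ a) (sub θ b) (sub θ c) (sub θ d)

_∈vA_ : Var → Atom → Set
x ∈vA atom p a b c d = x ∈v a ⊎ x ∈v b ⊎ x ∈v c ⊎ x ∈v d

record Clause : Set where
  constructor _⇐_
  field
    head : Atom
    body : List Atom
open Clause public

_∈vC_ : Var → Clause → Set
x ∈vC (h ⇐ b) = x ∈vA h ⊎ Any (x ∈vA_) b

renC : (Var → Var) → Clause → Clause
renC ρ (h ⇐ b) = subA (λ x → var (ρ x)) h ⇐ map (subA (λ x → var (ρ x))) b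

Unifier : Subst → Atom → Atom → Set
Unifier θ A B = subA θ A ≡ subA θ B

MGU : Subst → Atom → Atom → Set
MGU θ A B = Unifier θ A B ×
            (∀ σ → Unifier σ A B → Σ Subst λ η → ∀ x → sub η (θ x) ≡ σ x)

Relevant : Subst → Atom → Atom → Set
Relevant θ A B =
  (∀ x → θ x ≢ var x → x ∈vA A ⊎ x ∈vA B) ×
  (∀ x y → θ x ≢ var x → y ∈v θ x → y ∈vA A ⊎ y ∈vA B)

-- SLD P U G τ : there is a successful SLD-derivation of the goal G
-- w.r.t. program P (any selection rule), whose composed mgus equal τ;
-- U is the set of variables used so far (standardisation apart).

data SLD (P : List Clause) : (Var → Set) → List Atom → Subst → Set₁ where
  done : ∀ {U} → SLD P U [] var
  step : ∀ {U} (L R : List Atom) (A : Atom) (c : Clause) (ρ : Var → Var)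
           (θ σ : Subst)
       → c ∈ P
       → (∀ x y → ρ x ≡ ρ y → x ≡ y)
       → (∀ x → x ∈vC c → ¬ U (ρ x))
       → MGU θ A (head (renC ρ c))
       → Relevant θ A (head (renC ρ c))
       → SLD P (λ x → U x ⊎ x ∈vC renC ρ c)
               (map (subA θ) (L ++ body (renC ρ c) ++ R)) σ
       → SLD P U (L ++ A ∷ R) (θ ⨾ σ)

-- s-semantics: atoms p(V1,..,V4)θ with θ an SLD-computed answer
-- for p(V1,..,V4), V1..V4 distinct variables.
O : List Clause → Atom → Set₁
O P B = Σ Pred λ p → Σ Var λ a → Σ Var λ b → Σ Var λ c → Σ Var λ d →
        Unique (a ∷ b ∷ c ∷ d ∷ []) ×
        Σ Subst λ θ →
          SLD P (λ x → x ∈vA atom p (var a) (var b) (var c) (var d))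
                (atom p (var a) (var b) (var c) (var d) ∷ []) θ ×
          B ≡ subA θ (atom p (var a) (var b) (var c) (var d))

NQUEENS : List Clause
NQUEENS =
  (atom pqs zro (var 0) (var 1) (var 2) ⇐ []) ∷
  -- pqs(s(I),Cs,Us,[Y|Ds]) <- pqs(I,Cs,[Z|Us],Ds), pq(s(I),Cs,Us,Ds).
  -- I=0, Cs=1, Us=2, Y=3, Ds=4, Z=5
  (atom pqs (suc' (var 0)) (var 1) (var 2) (cons (var 3) (var 4)) ⇐
     (atom pqs (var 0) (var 1) (cons (var 5) (var 2)) (var 4) ∷
      atom pq (suc' (var 0)) (var 1) (var 2) (var 4) ∷ [])) ∷
  (atom pq (var 0) (cons (var 0) (var 1)) (cons (var 0) (var 2))
           (cons (var 0) (var 3)) ⇐ []) ∷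
  -- pq(I,[Y1|Cs],[Y2|Us],[Y3|Ds]) <- pq(I,Cs,Us,Ds).
  -- I=0, Y1=1, Cs=2, Y2=3, Us=4, Y3=5, Ds=6
  (atom pq (var 0) (cons (var 1) (var 2)) (cons (var 3) (var 4))
           (cons (var 5) (var 6)) ⇐
     (atom pq (var 0) (var 2) (var 4) (var 6) ∷ [])) ∷
  []

-- Kth k s t : s is the k-th member (k > 0) of t, i.e. t = [t1,..,t(k-1),s|t0]
data Kth : ℕ → Term → Term → Set where
  kh : ∀ {s t} → Kth 1 s (cons s t)
  kt : ∀ {k s h t} → Kth k s t → Kth (suc k) s (cons h t)

data OpenList : Term → Set where
  ol-var  : ∀ {x} → OpenList (var x)
  ol-cons : ∀ {h t} → OpenList t → OpenList (cons h t)

data LastMem : Term → Term → Set where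
  lm-here  : ∀ {s x} → LastMem s (cons s (var x))
  lm-there : ∀ {s h t} → LastMem s t → LastMem s (cons h t)

GVD : Term → Set
GVD t = Linear t × OpenList t ×
        (∀ k₁ k₂ s → Kth k₁ s t → Kth k₂ s t → k₁ ≡ k₂) ×
        (∀ k s → Kth k s t → Ground s ⊎ Σ Var (λ x → s ≡ var x))

Short : Term → Set
Short t = Σ Var (λ x → t ≡ var x) ⊎ Σ Term (λ s → LastMem s t × Ground s)

ShortGVD : Term → Set
ShortGVD t = GVD t × Short t

-- Diagonal numbers: queen j is the k-th member; w.r.t. i
updiag : ℕ → ℕ → ℕ → ℤ
updiag k j i = (+ k ℤ.+ + j) ℤ.- + i

downdiag : ℕ → ℕ → ℕ → ℤ
downdiag k j i = (+ k ℤ.+ + i) ℤ.- + j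

-- cs is correct up to m.  (Pairwise distinctness of diagonal numbers
-- does not depend on i; it is stated w.r.t. i = 0.)
CorrectUpTo : ℕ → Term → Set
CorrectUpTo m cs =
  GVD cs ×
  (∀ k s → Kth k s cs → Ground s → Σ ℕ λ j → s ≡ num j × 1 ≤ j × j ≤ m) ×
  (∀ j → 1 ≤ j → j ≤ m → Σ ℕ λ k → Kth k (num j) cs) ×
  (∀ j₁ j₂ k₁ k₂ → Kth k₁ (num j₁) cs → Kth k₂ (num j₂) cs → j₁ ≢ j₂ →
     updiag k₁ j₁ 0 ≢ updiag k₂ j₂ 0 × downdiag k₁ j₁ 0 ≢ downdiag k₂ j₂ 0)

PairCorrect : ℕ → ℕ → Term → Term → Term → Set
PairCorrect m i cs us ds =
  ∀ j → 1 ≤ j → j ≤ m →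
    Σ ℕ (λ k → Kth k (num j) cs) ×
    (∀ k l → Kth k (num j) cs → 0 < l → + l ≡ updiag k j i → Kth l (num j) us) ×
    (∀ k l → Kth k (num j) cs → 0 < l → + l ≡ downdiag k j i → Kth l (num j) ds)

VarDisjoint : Term → Term → Set
VarDisjoint a b = ∀ x → x ∈v a → x ∈v b → ⊥

GroundMembersIn : Term → ℕ → Set
GroundMembersIn t i =
  ∀ k s → Kth k s t → Ground s → Σ ℕ λ j → s ≡ num j × 1 ≤ j × j ≤ i

UpPositive : ℕ → Term → Term → Set
UpPositive i cs us =
  ∀ k s → Kth k s us → Ground s → ∀ j → s ≡ num j →
    Σ ℕ λ k' → Kth k' (num j) cs × ℤ.0ℤ ℤ.< updiag k' j i

openL : List Term → Var → Term
openL []       x = var x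
openL (t ∷ ts) x = cons t (openL ts x)

Spq : Atom → Set
Spq B = Σ Var λ v → Σ Var λ c₀ → Σ Var λ u₀ → Σ Var λ d₀ →
        Σ (List Var) λ cs → Σ (List Var) λ us → Σ (List Var) λ ds →
        length cs ≡ length us × length us ≡ length ds ×
        Unique (v ∷ c₀ ∷ u₀ ∷ d₀ ∷ cs ++ us ++ ds) ×
        B ≡ atom pq (var v)
                    (openL (map var cs ++ var v ∷ []) c₀)
                    (openL (map var us ++ var v ∷ []) u₀)
                    (openL (map var ds ++ var v ∷ []) d₀)

Spqs2 : Atom → Set
Spqs2 B = Σ Var λ a → Σ Var λ b → Σ Var λ c →
          Unique (a ∷ b ∷ c ∷ []) × B ≡ atom pqs zro (var a) (var b) (var c)

S0pqs : Atom → Set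
S0pqs B = Σ ℕ λ i → Σ Term λ cs → Σ Term λ us → Σ Term λ ds → Σ Var λ w →
  B ≡ atom pqs (num i) cs us (cons (var w) ds) ×
  0 < i ×
  ¬ (w ∈v cs) × ¬ (w ∈v us) × ¬ (w ∈v ds) ×
  CorrectUpTo i cs ×
  PairCorrect i i cs us ds ×
  VarDisjoint cs us × VarDisjoint cs ds × VarDisjoint us ds ×
  ShortGVD cs × ShortGVD us × ShortGVD ds ×
  GroundMembersIn us i × GroundMembersIn ds i ×
  UpPositive i cs us

S0 : Atom → Set
S0 B = S0pqs B ⊎ Spqs2 B ⊎ Spq B

module Submission where

open import Defs
open import Data.Nat as ℕ using (ℕ; zero; suc; _+_; _*_; _∸_; _⊔_; _≤_; _<_; _≟_; _≤?_; z≤n; s≤s)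
open import Data.Nat.Properties
import Data.Integer as ℤ
import Data.Integer.Properties as ℤP
open import Data.Maybe using (Maybe; just; nothing)
open import Data.Maybe.Properties using (just-injective)
open import Data.List using (List; []; _∷_; _++_; map; length; foldr)
open import Data.List.Properties using (map-++)
open import Data.List.Membership.Propositional using (_∈_)
open import Data.List.Membership.Propositional.Properties using (∈-++⁻; ∈-map⁺)
open import Data.List.Relation.Unary.All as All using (All; []; _∷_)
import Data.List.Relation.Unary.All.Properties as AllP
open AllP using (++⁺)
open import Data.List.Relation.Unary.Any using (Any; here; there)
open import Data.List.Relation.Unary.AllPairs using ([]; _∷_)
open import Data.List.Relation.Unary.Unique.Propositional using (Unique)
import Data.List.Relation.Unary.Unique.Propositional.Properties as UP
open import Data.Product using (Σ; _×_; _,_; proj₁; proj₂)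
open import Data.Sum using (_⊎_; inj₁; inj₂)
open import Data.Empty using (⊥; ⊥-elim)
open import Data.Unit using (tt)
open import Relation.Nullary using (¬_; yes; no; Dec)
open import Relation.Nullary.Decidable using (toWitness)
open import Relation.Binary.Definitions using (tri<; tri≈; tri>)
open import Relation.Binary.PropositionalEquality

-- The proof builds these derivations explicitly.  Every variable occurring in
-- them is named by a symbolic kind (a counter, a cell or the tail of one of the
-- three lists, or a clause variable of the M-th step) through an injective
-- naming Name; a stamp records which kinds may already be in use, so that the
-- clause variants renamed to new kinds are fresh.
--
-- Clause 4
-- walks one cell along the three lists (walkStep), clause 3 places a queen
-- (finalStep), and pqWalk combines them to solve one pq goal.  For the most
-- general pqs atom, phase 1 unfolds clause 2 i times and closes with clause 1,
-- leaving one pending pq goal per queen; phase 2 solves these goals, queen j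
-- after r j walks.  The computed answer is pqs(i, finalList LC, finalList LU,
-- finalList LD) for every naming (pqsO).  For an atom of S^0_pqs a naming is
-- chosen that turns the final lists into the given cs, us and [w|ds]
-- (S0pqsCase); S_pq needs a single walk (SpqCase) and S_pqs2 a single step
-- with clause 1 (Spqs2Case).  mainTheorem4 combines the three cases.

cons-inj₁ : ∀ {a b c d} → cons a b ≡ cons c d → a ≡ c
cons-inj₁ refl = refl
cons-inj₂ : ∀ {a b c d} → cons a b ≡ cons c d → b ≡ d
cons-inj₂ refl = refl
suc'-inj : ∀ {a b} → suc' a ≡ suc' b → a ≡ b
suc'-inj refl = refl
atomArgs : ∀ {p q a b c d a' b' c' d'} → atom p a b c d ≡ atom q a' b' c' d' →
  (p ≡ q) × (a ≡ a') × (b ≡ b') × (c ≡ c') × (d ≡ d')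
atomArgs refl = refl , refl , refl , refl , refl

arg1 : ∀ {p q a b c d a' b' c' d'} → atom p a b c d ≡ atom q a' b' c' d' → a ≡ a'
arg1 h = proj₁ (proj₂ (atomArgs h))
arg2 : ∀ {p q a b c d a' b' c' d'} → atom p a b c d ≡ atom q a' b' c' d' → b ≡ b'
arg2 h = proj₁ (proj₂ (proj₂ (atomArgs h)))
arg3 : ∀ {p q a b c d a' b' c' d'} → atom p a b c d ≡ atom q a' b' c' d' → c ≡ c'
arg3 h = proj₁ (proj₂ (proj₂ (proj₂ (atomArgs h))))
arg4 : ∀ {p q a b c d a' b' c' d'} → atom p a b c d ≡ atom q a' b' c' d' → d ≡ d'
arg4 h = proj₂ (proj₂ (proj₂ (proj₂ (atomArgs h))))

sub-ext : ∀ (θ θ' : Subst) t → (∀ x → x ∈v t → θ x ≡ θ' x) → sub θ t ≡ sub θ' t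
sub-ext θ θ' (var x) h = h x here
sub-ext θ θ' zro h = refl
sub-ext θ θ' (suc' t) h = cong suc' (sub-ext θ θ' t (λ x p → h x (inS p)))
sub-ext θ θ' nil h = refl
sub-ext θ θ' (cons a b) h = cong₂ cons (sub-ext θ θ' a (λ x p → h x (inH p))) (sub-ext θ θ' b (λ x p → h x (inT p)))

sub-id : ∀ t → sub var t ≡ t
sub-id (var x) = refl
sub-id zro = refl
sub-id (suc' t) = cong suc' (sub-id t)
sub-id nil = refl
sub-id (cons a b) = cong₂ cons (sub-id a) (sub-id b)

sub-fix : ∀ (θ : Subst) t → (∀ x → x ∈v t → θ x ≡ var x) → sub θ t ≡ t
sub-fix θ t h = trans (sub-ext θ var t h) (sub-id t)

sub-comp : ∀ (θ σ : Subst) t → sub σ (sub θ t) ≡ sub (θ ⨾ σ) t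
sub-comp θ σ (var x) = refl
sub-comp θ σ zro = refl
sub-comp θ σ (suc' t) = cong suc' (sub-comp θ σ t)
sub-comp θ σ nil = refl
sub-comp θ σ (cons a b) = cong₂ cons (sub-comp θ σ a) (sub-comp θ σ b)

sub-num : ∀ (θ : Subst) n → sub θ (num n) ≡ num n
sub-num θ zero = refl
sub-num θ (suc n) = cong suc' (sub-num θ n)

num-ground : ∀ n x → ¬ (x ∈v num n)
num-ground zero x ()
num-ground (suc n) x (inS p) = num-ground n x p

ren-var : ∀ (ρ : Var → Var) t x → x ∈v sub (λ y → var (ρ y)) t → Σ Var λ y → y ∈v t × x ≡ ρ y
ren-var ρ (var y) x here = y , here , refl
ren-var ρ (suc' t) x (inS p) with ren-var ρ t x p
... | y , q , e = y , inS q , e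
ren-var ρ (cons a b) x (inH p) with ren-var ρ a x p
... | y , q , e = y , inH q , e
ren-var ρ (cons a b) x (inT p) with ren-var ρ b x p
... | y , q , e = y , inT q , e

atomEq : ∀ {p a b c d a' b' c' d'} → a ≡ a' → b ≡ b' → c ≡ c' → d ≡ d' → atom p a b c d ≡ atom p a' b' c' d'
atomEq refl refl refl refl = refl

-- sucs n t = s^n(t); the counter argument of pqs during the unfolding of clause 2.
sucs : ℕ → Term → Term
sucs zero t = t
sucs (suc n) t = suc' (sucs n t)

sucs-suc : ∀ n t → sucs n (suc' t) ≡ sucs (suc n) t
sucs-suc zero t = refl
sucs-suc (suc n) t = cong suc' (sucs-suc n t)

sucs-sub : ∀ θ n t → sub θ (sucs n t) ≡ sucs n (sub θ t)
sucs-sub θ zero t = refl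
sucs-sub θ (suc n) t = cong suc' (sucs-sub θ n t)

sucs-zro : ∀ n → sucs n zro ≡ num n
sucs-zro zero = refl
sucs-zro (suc n) = cong suc' (sucs-zro n)

-- Finite substitutions presented as binding lists; the first binding of a
-- variable wins.  All mgus in this development are of this form.
Bind : Set
Bind = List (Var × Term)

look : Bind → Subst
look [] x = var x
look ((y , t) ∷ bs) x with x ≟ y
... | yes _ = t
... | no _ = look bs x

BP : (Var → Term → Set) → Bind → Set
BP P bs = All (λ e → P (proj₁ e) (proj₂ e)) bs

look-cases : ∀ (P : Var → Term → Set) bs → BP P bs → ∀ x → look bs x ≡ var x ⊎ P x (look bs x)
look-cases P [] [] x = inj₁ refl
look-cases P ((y , t) ∷ bs) (p ∷ ps) x with x ≟ y
... | yes refl = inj₂ p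
... | no _ = look-cases P bs ps x

look-hit : ∀ x t bs → look ((x , t) ∷ bs) x ≡ t
look-hit x t bs with x ≟ x
... | yes _ = refl
... | no n = ⊥-elim (n refl)

look-miss : ∀ x y t bs → x ≢ y → look ((y , t) ∷ bs) x ≡ look bs x
look-miss x y t bs n with x ≟ y
... | yes e = ⊥-elim (n e)
... | no _ = refl

NotDom : Var → Bind → Set
NotDom x bs = All (λ e → x ≢ proj₁ e) bs

look-notdom : ∀ x bs → NotDom x bs → look bs x ≡ var x
look-notdom x [] [] = refl
look-notdom x ((y , t) ∷ bs) (n ∷ ns) = trans (look-miss x y t bs n) (look-notdom x bs ns)

look-++ˡ : ∀ x b1 b2 → NotDom x b1 → look (b1 ++ b2) x ≡ look b2 x
look-++ˡ x [] b2 [] = refl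
look-++ˡ x ((y , t) ∷ b1) b2 (n ∷ ns) = trans (look-miss x y t (b1 ++ b2) n) (look-++ˡ x b1 b2 ns)

look-++ʳ : ∀ x b1 b2 → NotDom x b2 → look (b1 ++ b2) x ≡ look b1 x
look-++ʳ x [] b2 ns = look-notdom x b2 ns
look-++ʳ x ((y , t) ∷ b1) b2 ns with x ≟ y
... | yes _ = refl
... | no _ = look-++ʳ x b1 b2 ns

mguL : ∀ A H bs → Unifier (look bs) A H →
       BP (λ x t → ∀ σ → Unifier σ A H → σ x ≡ sub σ t) bs →
       MGU (look bs) A H
mguL A H bs u ps = u , λ σ uσ → σ , λ x → lem σ uσ x
  where
  lem : ∀ σ → Unifier σ A H → ∀ x → sub σ (look bs x) ≡ σ x
  lem σ uσ x with look-cases (λ x t → ∀ σ → Unifier σ A H → σ x ≡ sub σ t) bs ps x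
  ... | inj₁ e rewrite e = refl
  ... | inj₂ p = sym (p σ uσ)

relL : ∀ A H bs →
       BP (λ x t → (x ∈vA A ⊎ x ∈vA H) × (∀ y → y ∈v t → y ∈vA A ⊎ y ∈vA H)) bs →
       Relevant (look bs) A H
relL A H bs ps = (λ x ne → f x ne) , (λ x y ne yin → g x y ne yin)
  where
  P = λ x t → (x ∈vA A ⊎ x ∈vA H) × (∀ y → y ∈v t → y ∈vA A ⊎ y ∈vA H)
  f : ∀ x → look bs x ≢ var x → x ∈vA A ⊎ x ∈vA H
  f x ne with look-cases P bs ps x
  ... | inj₁ e = ⊥-elim (ne e)
  ... | inj₂ p = proj₁ p
  g : ∀ x y → look bs x ≢ var x → y ∈v look bs x → y ∈vA A ⊎ y ∈vA H
  g x y ne yin with look-cases P bs ps x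
  ... | inj₁ e = ⊥-elim (ne e)
  ... | inj₂ p = proj₂ p y yin

-- The three list arguments of pq and pqs: the column list cs (LC), the up
-- diagonal list us (LU) and the down diagonal list ds (LD).
data LI : Set where
  LC LU LD : LI

-- Symbolic names of all variables occurring in the derivations:
--   ik n      the counter variable of pqs after n unfoldings of clause 2,
--   pos X q   the (still unknown) q-th cell of list X,
--   tl X q    the tail variable of list X when it has q cells,
--   jk M s    clause variable s of the M-th resolution step,
--   jx n      clause variables outside the range used by NQUEENS (never needed).
data Kind : Set where
  ik  : ℕ → Kind
  pos : LI → ℕ → Kind
  tl  : LI → ℕ → Kind
  jk  : ℕ → ℕ → Kind
  jx  : ℕ → Kind

upd : (ℕ → Term) → ℕ → Term → ℕ → Term
upd f p t q with q ≟ p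
... | yes _ = t
... | no _ = f q

upd-hit : ∀ f p t → upd f p t p ≡ t
upd-hit f p t with p ≟ p
... | yes _ = refl
... | no n = ⊥-elim (n refl)

upd-miss : ∀ f p t q → q ≢ p → upd f p t q ≡ f q
upd-miss f p t q n with q ≟ p
... | yes e = ⊥-elim (n e)
... | no _ = refl

ik-inj : ∀ {a b} → ik a ≡ ik b → a ≡ b
ik-inj refl = refl

-- An injective encoding of kinds into ℕ (Cantor pairing and a tag mod 5);
-- it supplies the default names of variables not prescribed by the target.
tri : ℕ → ℕ
tri zero = 0
tri (suc n) = suc n + tri n

pair : ℕ → ℕ → ℕ
pair a b = tri (a + b) + b

tri-mono : ∀ s s' → s < s' → tri s + s < tri s'
tri-mono s (suc s') (s≤s le) with m≤n⇒m<n∨m≡n le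
... | inj₂ refl = subst (_≤ suc s + tri s) (sym (cong suc (+-comm (tri s) s))) ≤-refl
... | inj₁ lt = <-≤-trans (tri-mono s s' lt) (m≤n+m (tri s') (suc s'))

pair-lt : ∀ a b a' b' → a + b < a' + b' → pair a b < pair a' b'
pair-lt a b a' b' lt = ≤-<-trans (+-monoʳ-≤ (tri (a + b)) (m≤n+m b a)) (<-≤-trans (tri-mono (a + b) (a' + b') lt) (m≤m+n _ b'))

pair-inj : ∀ a b a' b' → pair a b ≡ pair a' b' → a ≡ a' × b ≡ b'
pair-inj a b a' b' e with <-cmp (a + b) (a' + b')
... | tri< lt _ _ = ⊥-elim (<-irrefl e (pair-lt a b a' b' lt))
... | tri> _ _ gt = ⊥-elim (<-irrefl (sym e) (pair-lt a' b' a b gt))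
... | tri≈ _ s≡ _ = a≡ , b≡
  where
  b≡ : b ≡ b'
  b≡ = +-cancelˡ-≡ (tri (a + b)) b b' (trans e (cong (λ z → tri z + b') (sym s≡)))
  a≡ : a ≡ a'
  a≡ = +-cancelʳ-≡ b a a' (trans s≡ (cong (a' +_) (sym b≡)))

liN : LI → ℕ
liN LC = 0
liN LU = 1
liN LD = 2

liN-inj : ∀ X Y → liN X ≡ liN Y → X ≡ Y
liN-inj LC LC e = refl
liN-inj LU LU e = refl
liN-inj LD LD e = refl

tag : Kind → ℕ
tag (ik _) = 0
tag (pos _ _) = 1
tag (tl _ _) = 2
tag (jk _ _) = 3
tag (jx _) = 4

arg : Kind → ℕ
arg (ik n) = n
arg (pos X q) = pair (liN X) q
arg (tl X q) = pair (liN X) q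
arg (jk a b) = pair a b
arg (jx n) = n

enc : Kind → ℕ
enc k = tag k + 5 * arg k

five≤ : ∀ a → 5 ≤ 5 * suc a
five≤ a = ≤-trans (≤-reflexive (sym (*-identityʳ 5))) (*-monoʳ-≤ 5 (s≤s (z≤n {a})))

enc-lem : ∀ t t' a a' → t < 5 → t' < 5 → t + 5 * a ≡ t' + 5 * a' → t ≡ t' × a ≡ a'
enc-lem t t' zero zero lt lt' e = trans (sym (t+0 t)) (trans e (t+0 t')) , refl
  where
  t+0 : ∀ t → t + 5 * 0 ≡ t
  t+0 t = +-identityʳ t
enc-lem t t' zero (suc a') lt lt' e = ⊥-elim (<-irrefl refl (<-≤-trans (subst (_< 5) (sym (+-identityʳ t)) lt) (subst (5 ≤_) (sym e) (≤-trans (five≤ a') (m≤n+m _ t')))))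
enc-lem t t' (suc a) zero lt lt' e = ⊥-elim (<-irrefl refl (<-≤-trans (subst (_< 5) (sym (+-identityʳ t')) lt') (subst (5 ≤_) e (≤-trans (five≤ a) (m≤n+m _ t)))))
enc-lem t t' (suc a) (suc a') lt lt' e with enc-lem t t' a a' lt lt' (+-cancelˡ-≡ 5 _ _ (trans (sym (lem t a)) (trans e (lem t' a'))))
  where
  lem : ∀ t a → t + 5 * suc a ≡ 5 + (t + 5 * a)
  lem t a = trans (cong (t +_) (*-suc 5 a)) (trans (sym (+-assoc t 5 (5 * a))) (trans (cong (_+ 5 * a) (+-comm t 5)) (+-assoc 5 t (5 * a))))
... | e1 , e2 = e1 , cong suc e2

tag<5 : ∀ k → tag k < 5
tag<5 (ik _) = s≤s z≤n
tag<5 (pos _ _) = s≤s (s≤s z≤n)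
tag<5 (tl _ _) = s≤s (s≤s (s≤s z≤n))
tag<5 (jk _ _) = s≤s (s≤s (s≤s (s≤s z≤n)))
tag<5 (jx _) = s≤s (s≤s (s≤s (s≤s (s≤s z≤n))))

enc-inj : ∀ k k' → enc k ≡ enc k' → k ≡ k'
enc-inj k k' e with enc-lem (tag k) (tag k') (arg k) (arg k') (tag<5 k) (tag<5 k') e
enc-inj (ik n) (ik n') e | _ , a = cong ik a
enc-inj (pos X q) (pos Y q') e | _ , a = let (x , y) = pair-inj _ _ _ _ a in cong₂ pos (liN-inj X Y x) y
enc-inj (tl X q) (tl Y q') e | _ , a = let (x , y) = pair-inj _ _ _ _ a in cong₂ tl (liN-inj X Y x) y
enc-inj (jk m s) (jk m' s') e | _ , a = let (x , y) = pair-inj _ _ _ _ a in cong₂ jk x y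
enc-inj (jx n) (jx n') e | _ , a = cong jx a
enc-inj (ik _) (pos _ _) e | () , _
enc-inj (ik _) (tl _ _) e | () , _
enc-inj (ik _) (jk _ _) e | () , _
enc-inj (ik _) (jx _) e | () , _
enc-inj (pos _ _) (ik _) e | () , _
enc-inj (pos _ _) (tl _ _) e | () , _
enc-inj (pos _ _) (jk _ _) e | () , _
enc-inj (pos _ _) (jx _) e | () , _
enc-inj (tl _ _) (ik _) e | () , _
enc-inj (tl _ _) (pos _ _) e | () , _
enc-inj (tl _ _) (jk _ _) e | () , _
enc-inj (tl _ _) (jx _) e | () , _
enc-inj (jk _ _) (ik _) e | () , _
enc-inj (jk _ _) (pos _ _) e | () , _
enc-inj (jk _ _) (tl _ _) e | () , _
enc-inj (jk _ _) (jx _) e | () , _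
enc-inj (jx _) (ik _) e | () , _
enc-inj (jx _) (pos _ _) e | () , _
enc-inj (jx _) (tl _ _) e | () , _
enc-inj (jx _) (jk _ _) e | () , _

-- Given partial target names tgt, injective and bounded by N, Name extends
-- them to an injective naming of all kinds (unprescribed kinds go above N).
module MkName (tgt : Kind → Maybe Var) (N : ℕ)
              (tgt-bnd : ∀ k x → tgt k ≡ just x → x < N)
              (tgt-inj : ∀ k k' x → tgt k ≡ just x → tgt k' ≡ just x → k ≡ k') where

  nameM : Maybe Var → Kind → Var
  nameM (just x) k = x
  nameM nothing k = N + enc k

  Name : Kind → Var
  Name k = nameM (tgt k) k

  Name-tgt : ∀ k x → tgt k ≡ just x → Name k ≡ x
  Name-tgt k x e rewrite e = refl

  Name-inj : ∀ {k k'} → Name k ≡ Name k' → k ≡ k'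
  Name-inj {k} {k'} e = go (tgt k) (tgt k') refl refl e
    where
    go : ∀ m m' → tgt k ≡ m → tgt k' ≡ m' → nameM m k ≡ nameM m' k' → k ≡ k'
    go (just x) (just x') h h' e = tgt-inj k k' x h (trans h' (cong just (sym e)))
    go (just x) nothing h h' e = ⊥-elim (<-irrefl refl (<-≤-trans (tgt-bnd k x h) (subst (N ≤_) (sym e) (m≤m+n N _))))
    go nothing (just x') h h' e = ⊥-elim (<-irrefl refl (<-≤-trans (tgt-bnd k' x' h') (subst (N ≤_) e (m≤m+n N _))))
    go nothing nothing h h' e = enc-inj k k' (+-cancelˡ-≡ N _ _ e)

_≟K_ : (k k' : Kind) → Dec (k ≡ k')
k ≟K k' with enc k ≟ enc k'
... | yes e = yes (enc-inj k k' e)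
... | no n = no (λ e → n (cong enc e))

lookupK : Kind → List (Kind × Var) → Maybe Var
lookupK k [] = nothing
lookupK k ((k' , x) ∷ as) with k ≟K k'
... | yes _ = just x
... | no _ = lookupK k as

lookupK-sound : ∀ k x as → lookupK k as ≡ just x → (k , x) ∈ as
lookupK-sound k x [] ()
lookupK-sound k x ((k' , y) ∷ as) e with k ≟K k'
lookupK-sound k x ((k' , y) ∷ as) refl | yes refl = here refl
... | no _ = there (lookupK-sound k x as e)

uniq-keys : ∀ (as : List (Kind × Var)) (k k' : Kind) (x : Var) → Unique (map proj₂ as) → (k , x) ∈ as → (k' , x) ∈ as → k ≡ k'
uniq-keys (_ ∷ as) k k' x u (here refl) (here refl) = refl
uniq-keys (_ ∷ as) k k' x (h ∷ u) (here refl) (there p) = ⊥-elim (AllP.All¬⇒¬Any h (∈-map⁺ proj₂ p))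
uniq-keys (_ ∷ as) k k' x (h ∷ u) (there p) (here refl) = ⊥-elim (AllP.All¬⇒¬Any h (∈-map⁺ proj₂ p))
uniq-keys (_ ∷ as) k k' x (h ∷ u) (there p) (there q) = uniq-keys as k k' x u p q

maximum : List ℕ → ℕ
maximum = foldr _⊔_ 0

maximum-ok : ∀ (xs : List ℕ) (x : ℕ) → x ∈ xs → x ≤ maximum xs
maximum-ok (y ∷ xs) x (here refl) = m≤m⊔n y _
maximum-ok (y ∷ xs) x (there p) = ≤-trans (maximum-ok xs x p) (m≤n⊔m y _)

module AssocName (as : List (Kind × Var)) (uq : Unique (map proj₂ as)) where
  N : ℕ
  N = suc (maximum (map proj₂ as))
  tgt : Kind → Maybe Var
  tgt k = lookupK k as
  tgt-bnd : ∀ k x → tgt k ≡ just x → x < N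
  tgt-bnd k x e = s≤s (maximum-ok _ x (∈-map⁺ proj₂ (lookupK-sound k x as e)))
  tgt-inj : ∀ k k' x → tgt k ≡ just x → tgt k' ≡ just x → k ≡ k'
  tgt-inj k k' x e e' = uniq-keys as k k' x uq (lookupK-sound k x as e) (lookupK-sound k' x as e')
  open MkName tgt N tgt-bnd tgt-inj public

lookupK-hit : ∀ k x as → lookupK k ((k , x) ∷ as) ≡ just x
lookupK-hit k x as with k ≟K k
... | yes _ = refl
... | no n = ⊥-elim (n refl)

lookup-all : ∀ (as : List (Kind × Var)) k x → Unique (map proj₁ as) → (k , x) ∈ as → lookupK k as ≡ just x
lookup-all ((k' , y) ∷ as) k x u (here refl) = lookupK-hit k x as
lookup-all ((k' , y) ∷ as) k x (h ∷ u) (there p) with k ≟K k'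
... | yes refl = ⊥-elim (AllP.All¬⇒¬Any h (∈-map⁺ proj₁ p))
... | no _ = lookup-all as k x u p

-- A strict upper bound for the variables of a term, atom, atom list and
-- clause; all clauses of NQUEENS use only the variables 0,...,6.
bnd : Term → ℕ
bnd (var x) = suc x
bnd zro = 0
bnd (suc' t) = bnd t
bnd nil = 0
bnd (cons a b) = bnd a ⊔ bnd b

bnd-ok : ∀ t x → x ∈v t → x < bnd t
bnd-ok (var x) x here = ≤-refl
bnd-ok (suc' t) x (inS p) = bnd-ok t x p
bnd-ok (cons a b) x (inH p) = m<n⇒m<n⊔o (bnd b) (bnd-ok a x p)
bnd-ok (cons a b) x (inT p) = m<n⇒m<o⊔n (bnd a) (bnd-ok b x p)

bndA : Atom → ℕ
bndA (atom p a b c d) = bnd a ⊔ bnd b ⊔ bnd c ⊔ bnd d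

bndA-ok : ∀ A x → x ∈vA A → x < bndA A
bndA-ok (atom p a b c d) x (inj₁ q) = m<n⇒m<n⊔o (bnd d) (m<n⇒m<n⊔o (bnd c) (m<n⇒m<n⊔o (bnd b) (bnd-ok a x q)))
bndA-ok (atom p a b c d) x (inj₂ (inj₁ q)) = m<n⇒m<n⊔o (bnd d) (m<n⇒m<n⊔o (bnd c) (m<n⇒m<o⊔n (bnd a) (bnd-ok b x q)))
bndA-ok (atom p a b c d) x (inj₂ (inj₂ (inj₁ q))) = m<n⇒m<n⊔o (bnd d) (m<n⇒m<o⊔n (bnd a ⊔ bnd b) (bnd-ok c x q))
bndA-ok (atom p a b c d) x (inj₂ (inj₂ (inj₂ q))) = m<n⇒m<o⊔n (bnd a ⊔ bnd b ⊔ bnd c) (bnd-ok d x q)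

bndL : List Atom → ℕ
bndL [] = 0
bndL (A ∷ as) = bndA A ⊔ bndL as

bndL-ok : ∀ as x → Any (x ∈vA_) as → x < bndL as
bndL-ok (A ∷ as) x (here p) = m<n⇒m<n⊔o (bndL as) (bndA-ok A x p)
bndL-ok (A ∷ as) x (there p) = m<n⇒m<o⊔n (bndA A) (bndL-ok as x p)

bndC-ok : ∀ c x → x ∈vC c → x < bndA (head c) ⊔ bndL (body c)
bndC-ok (h ⇐ b) x (inj₁ p) = m<n⇒m<n⊔o (bndL b) (bndA-ok h x p)
bndC-ok (h ⇐ b) x (inj₂ p) = m<n⇒m<o⊔n (bndA h) (bndL-ok b x p)

NQ-bnd : ∀ c → c ∈ NQUEENS → ∀ x → x ∈vC c → x < 7
NQ-bnd c (here refl) x p = ≤-trans (bndC-ok c x p) (toWitness {a? = _ ≤? 7} tt)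
NQ-bnd c (there (here refl)) x p = ≤-trans (bndC-ok c x p) (toWitness {a? = _ ≤? 7} tt)
NQ-bnd c (there (there (here refl))) x p = ≤-trans (bndC-ok c x p) (toWitness {a? = _ ≤? 7} tt)
NQ-bnd c (there (there (there (here refl)))) x p = ≤-trans (bndC-ok c x p) (toWitness {a? = _ ≤? 7} tt)

renA-var : ∀ (ρ : Var → Var) A x → x ∈vA subA (λ y → var (ρ y)) A → Σ Var λ y → y ∈vA A × x ≡ ρ y
renA-var ρ (atom p a b c d) x (inj₁ q) with ren-var ρ a x q
... | y , r , e = y , inj₁ r , e
renA-var ρ (atom p a b c d) x (inj₂ (inj₁ q)) with ren-var ρ b x q
... | y , r , e = y , inj₂ (inj₁ r) , e
renA-var ρ (atom p a b c d) x (inj₂ (inj₂ (inj₁ q))) with ren-var ρ c x q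
... | y , r , e = y , inj₂ (inj₂ (inj₁ r)) , e
renA-var ρ (atom p a b c d) x (inj₂ (inj₂ (inj₂ q))) with ren-var ρ d x q
... | y , r , e = y , inj₂ (inj₂ (inj₂ r)) , e

renL-var : ∀ (ρ : Var → Var) as x → Any (x ∈vA_) (map (subA (λ y → var (ρ y))) as) → Σ Var λ y → Any (y ∈vA_) as × x ≡ ρ y
renL-var ρ (A ∷ as) x (here p) with renA-var ρ A x p
... | y , r , e = y , here r , e
renL-var ρ (A ∷ as) x (there p) with renL-var ρ as x p
... | y , r , e = y , there r , e

renC-var : ∀ (ρ : Var → Var) c x → x ∈vC renC ρ c → Σ Var λ y → y ∈vC c × x ≡ ρ y
renC-var ρ (h ⇐ b) x (inj₁ p) with renA-var ρ h x p
... | y , r , e = y , inj₁ r , e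
renC-var ρ (h ⇐ b) x (inj₂ p) with renL-var ρ b x p
... | y , r , e = y , inj₂ r , e

clause₁ : Clause
clause₁ = atom pqs zro (var 0) (var 1) (var 2) ⇐ []

clause₂ : Clause
clause₂ = atom pqs (suc' (var 0)) (var 1) (var 2) (cons (var 3) (var 4)) ⇐
     (atom pqs (var 0) (var 1) (cons (var 5) (var 2)) (var 4) ∷
      atom pq (suc' (var 0)) (var 1) (var 2) (var 4) ∷ [])

-- Classes of variables, used to show that the bindings contributed by the
-- three lists in one pq-step do not interfere: the head's I (cI), variables
-- belonging to list X (cX X), and all others (cN).  sc assigns classes to the
-- clause variables of step M.
data Cls : Set where
  cI : Cls
  cX : LI → Cls
  cN : Cls

kc : (ℕ → Cls) → ℕ → Kind → Cls
kc sc M (ik _) = cN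
kc sc M (pos X _) = cX X
kc sc M (tl X _) = cX X
kc sc M (jk m s) with m ≟ M
... | yes _ = sc s
... | no _ = cN
kc sc M (jx _) = cN

kc-jk : ∀ sc M s → kc sc M (jk M s) ≡ sc s
kc-jk sc M s with M ≟ M
... | yes _ = refl
... | no n = ⊥-elim (n refl)

-- A stamp over-approximates the kinds whose names may already occur in the
-- derivation: the first M steps' clause variables, counters ik n with n ≤ ib,
-- cells pos X q below the current extent (for LU only from loU on) and tails
-- tl X q up to the extent.  Clause variants are renamed to kinds outside the
-- stamp, which makes them fresh.
record Stamp : Set where
  constructor stamp
  field M ib loU eC eU eD : ℕ

OldS : Stamp → Kind → Set
OldS st (ik n) = n ≤ Stamp.ib st
OldS st (pos LC q) = q < Stamp.eC st
OldS st (pos LU q) = Stamp.loU st ≤ q × q < Stamp.eU st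
OldS st (pos LD q) = q < Stamp.eD st
OldS st (tl LC q) = q ≤ Stamp.eC st
OldS st (tl LU q) = q ≤ Stamp.eU st
OldS st (tl LD q) = q ≤ Stamp.eD st
OldS st (jk m _) = m < Stamp.M st
OldS st (jx _) = ⊥

eOf : LI → Stamp → ℕ
eOf LC st = Stamp.eC st
eOf LU st = Stamp.eU st
eOf LD st = Stamp.eD st

oldMono : ∀ st st' → Stamp.M st ≤ Stamp.M st' → Stamp.ib st ≤ Stamp.ib st' → Stamp.loU st' ≤ Stamp.loU st →
          Stamp.eC st ≤ Stamp.eC st' → Stamp.eU st ≤ Stamp.eU st' → Stamp.eD st ≤ Stamp.eD st' →
          ∀ k → OldS st k → OldS st' k
oldMono st st' hM hi hl hC hU hD (ik n) o = ≤-trans o hi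
oldMono st st' hM hi hl hC hU hD (pos LC q) o = <-≤-trans o hC
oldMono st st' hM hi hl hC hU hD (pos LU q) (a , b) = ≤-trans hl a , <-≤-trans b hU
oldMono st st' hM hi hl hC hU hD (pos LD q) o = <-≤-trans o hD
oldMono st st' hM hi hl hC hU hD (tl LC q) o = ≤-trans o hC
oldMono st st' hM hi hl hC hU hD (tl LU q) o = ≤-trans o hU
oldMono st st' hM hi hl hC hU hD (tl LD q) o = ≤-trans o hD
oldMono st st' hM hi hl hC hU hD (jk m s) o = <-≤-trans o hM
oldMono st st' hM hi hl hC hU hD (jx _) ()

oldPos : ∀ X st q → OldS st (pos X q) → q < eOf X st
oldPos LC st q o = o
oldPos LU st q o = proj₂ o
oldPos LD st q o = o

newPos : ∀ X st q → (X ≡ LU → Stamp.loU st ≤ q) → q < eOf X st → OldS st (pos X q)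
newPos LC st q l o = o
newPos LU st q l o = l refl , o
newPos LD st q l o = o

oldTl : ∀ X st q → OldS st (tl X q) → q ≤ eOf X st
oldTl LC st q o = o
oldTl LU st q o = o
oldTl LD st q o = o

newTl : ∀ X st q → q ≤ eOf X st → OldS st (tl X q)
newTl LC st q o = o
newTl LU st q o = o
newTl LD st q o = o

cX≢ : ∀ {X Y} → X ≢ Y → cX X ≢ cX Y
cX≢ n refl = n refl

ndk : ∀ sc M k X Y → (kc sc M k ≡ cX X ⊎ kc sc M k ≡ cN) → X ≢ Y → kc sc M k ≢ cX Y
ndk sc M k X Y (inj₁ e1) n e2 = cX≢ n (trans (sym e1) e2)
ndk sc M k X Y (inj₂ e1) n e2 with trans (sym e1) e2
... | ()

LC≢LU : LC ≢ LU
LC≢LU ()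
LC≢LD : LC ≢ LD
LC≢LD ()
LU≢LD : LU ≢ LD
LU≢LD ()

class₄ : ℕ → Cls
class₄ 0 = cI
class₄ 1 = cX LC
class₄ 2 = cX LC
class₄ 3 = cX LU
class₄ 4 = cX LU
class₄ 5 = cX LD
class₄ 6 = cX LD
class₄ _ = cN

clause₄ : Clause
clause₄ = atom pq (var 0) (cons (var 1) (var 2)) (cons (var 3) (var 4)) (cons (var 5) (var 6)) ⇐
     (atom pq (var 0) (var 2) (var 4) (var 6) ∷ [])

class₃ : ℕ → Cls
class₃ 0 = cI
class₃ 1 = cX LC
class₃ 2 = cX LU
class₃ 3 = cX LD
class₃ _ = cN

clause₃ : Clause
clause₃ = atom pq (var 0) (cons (var 0) (var 1)) (cons (var 0) (var 2)) (cons (var 0) (var 3)) ⇐ []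

-- A list state: the cell function f and the extent e (number of cells).
record LS : Set where
  constructor ls
  field
    f : ℕ → Term
    e : ℕ

Ext : (Subst → Set) → Set
Ext Φ = ∀ θ θ' → (∀ x → θ x ≡ θ' x) → Φ θ → Φ θ'

⨾-assoc : ∀ (a b c : Subst) x → ((a ⨾ b) ⨾ c) x ≡ (a ⨾ (b ⨾ c)) x
⨾-assoc a b c x = sub-comp b c (a x)

subst₃ : ∀ {A B C : Set} (P : A → B → C → Set) {a a' b b' c c'} → a ≡ a' → b ≡ b' → c ≡ c' → P a b c → P a' b' c'
subst₃ P refl refl refl p = p

-- Extents only grow: placing at p after walking past q ≤ p gives extent e ⊔ suc p.
⊔-absorb-suc : ∀ e q p → q ≤ p → (e ⊔ suc q) ⊔ suc p ≡ e ⊔ suc p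
⊔-absorb-suc e q p q≤p = trans (⊔-assoc e (suc q) (suc p)) (cong (e ⊔_) (m≤n⇒m⊔n≡n (s≤s q≤p)))

-- Open lists as terms: the p-th member (nil when absent), the number of
-- members, the tail variable, and the test for being a variable.
nth : ℕ → Term → Term
nth zero t = nil
nth (suc zero) (cons h t) = h
nth (suc (suc p)) (cons h t) = nth (suc p) t
nth (suc p) _ = nil

len : Term → ℕ
len (cons h t) = suc (len t)
len _ = 0

tailv : Term → Var
tailv (var x) = x
tailv (cons h t) = tailv t
tailv _ = 0

isVar : Term → Maybe Var
isVar (var x) = just x
isVar _ = nothing

isVar-ok : ∀ t x → isVar t ≡ just x → t ≡ var x
isVar-ok (var y) x refl = refl
isVar-ok zro x ()
isVar-ok (suc' t) x ()
isVar-ok nil x ()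
isVar-ok (cons t t₁) x ()

Kth-nth : ∀ {p s t} → Kth p s t → nth p t ≡ s × 1 ≤ p × p ≤ len t
Kth-nth kh = refl , s≤s z≤n , s≤s z≤n
Kth-nth (kt {k = zero} ())
Kth-nth (kt {k = suc k} q) with Kth-nth q
... | e , a , b = e , s≤s z≤n , s≤s b

nth-Kth : ∀ p t → OpenList t → 1 ≤ p → p ≤ len t → Kth p (nth p t) t
nth-Kth (suc zero) (cons h t) (ol-cons o) _ _ = kh
nth-Kth (suc (suc p)) (cons h t) (ol-cons o) _ (s≤s le) = kt (nth-Kth (suc p) t o (s≤s z≤n) le)

Kth-fun : ∀ {p s s' t} → Kth p s t → Kth p s' t → s ≡ s'
Kth-fun kh kh = refl
Kth-fun kh (kt {k = zero} ())
Kth-fun (kt {k = zero} ()) kh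
Kth-fun (kt p) (kt q) = Kth-fun p q

Kth-pos : ∀ {p s t} → Kth p s t → 1 ≤ p
Kth-pos kh = s≤s z≤n
Kth-pos (kt q) = s≤s z≤n

LastMem-Kth : ∀ {s t} → LastMem s t → Kth (len t) s t
LastMem-Kth lm-here = kh
LastMem-Kth (lm-there {t = t} q) with len t | LastMem-Kth q
... | zero | ()
... | suc n | r = kt r

num-inj : ∀ {m n} → num m ≡ num n → m ≡ n
num-inj {zero} {zero} e = refl
num-inj {zero} {suc n} ()
num-inj {suc m} {zero} ()
num-inj {suc m} {suc n} e = cong suc (num-inj (suc'-inj e))

num≢var : ∀ {j x} → num j ≢ var x
num≢var {zero} ()
num≢var {suc j} ()

occ-var : ∀ x → occ x (var x) ≡ 1
occ-var x with x ≟ x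
... | yes _ = refl
... | no n = ⊥-elim (n refl)

occ-pos : ∀ x t → x ∈v t → 1 ≤ occ x t
occ-pos x (var y) here = ≤-reflexive (sym (occ-var x))
occ-pos x (suc' t) (inS p) = occ-pos x t p
occ-pos x (cons a b) (inH p) = ≤-trans (occ-pos x a p) (m≤m+n _ _)
occ-pos x (cons a b) (inT p) = ≤-trans (occ-pos x b p) (m≤n+m _ _)

tail-in : ∀ t → OpenList t → tailv t ∈v t
tail-in (var x) ol-var = here
tail-in (cons h t) (ol-cons o) = inT (tail-in t o)

Kth-in : ∀ {p s t} x → Kth p s t → x ∈v s → x ∈v t
Kth-in x kh q = inH q
Kth-in x (kt r) q = inT (Kth-in x r q)

memb-tail : ∀ {p s t} x → OpenList t → Linear t → Kth p s t → x ∈v s → tailv t ≡ x → ⊥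
memb-tail x o lin r q e = 1+n≰n (≤-trans (go x o r q e) (lin x))
  where
  go : ∀ {p s t} x → OpenList t → Kth p s t → x ∈v s → tailv t ≡ x → 2 ≤ occ x t
  go x (ol-cons {h} {t} o) kh q refl = +-mono-≤ (occ-pos x h q) (occ-pos x t (tail-in t o))
  go x (ol-cons {h} {t} o) (kt r) q e = ≤-trans (go x o r q e) (m≤n+m _ (occ x h))

nth-var-range : ∀ p t x → nth p t ≡ var x → 1 ≤ p × p ≤ len t
nth-var-range zero t x ()
nth-var-range (suc zero) (cons h t) x e = s≤s z≤n , s≤s z≤n
nth-var-range (suc (suc p)) (cons h t) x e with nth-var-range (suc p) t x e
... | a , b = s≤s z≤n , s≤s b
nth-var-range (suc zero) (var _) x ()
nth-var-range (suc zero) zro x ()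
nth-var-range (suc zero) (suc' t) x ()
nth-var-range (suc zero) nil x ()
nth-var-range (suc (suc p)) (var _) x ()
nth-var-range (suc (suc p)) zro x ()
nth-var-range (suc (suc p)) (suc' t) x ()
nth-var-range (suc (suc p)) nil x ()

varKth : ∀ p t x → OpenList t → isVar (nth p t) ≡ just x → Kth p (var x) t
varKth p t x o e with isVar-ok _ x e
... | e' with nth-var-range p t x e'
...   | a , b = subst (λ z → Kth p z t) e' (nth-Kth p t o a b)

noKthVar : ∀ {k s x} → Kth k s (var x) → ⊥
noKthVar ()

Distinct : Term → Set
Distinct t = ∀ k₁ k₂ s → Kth k₁ s t → Kth k₂ s t → k₁ ≡ k₂

GroundOrVar : Term → Set
GroundOrVar t = ∀ k s → Kth k s t → Ground s ⊎ Σ Var (λ x → s ≡ var x)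

-- A slot of an open list: its p-th member or its tail variable.
data Slot : Set where
  mem : ℕ → Slot
  end : Slot

mem-injective : ∀ {p q} → mem p ≡ mem q → p ≡ q
mem-injective refl = refl

AtSlot : Term → Slot → Var → Set
AtSlot t (mem p) x = Kth p (var x) t
AtSlot t end x = tailv t ≡ x

AtSlot-in : ∀ t → OpenList t → ∀ a x → AtSlot t a x → x ∈v t
AtSlot-in t o (mem p) x k = Kth-in x k here
AtSlot-in t o end x refl = tail-in t o

AtSlot-unique : ∀ t → OpenList t → Linear t → Distinct t →
                ∀ a b x → AtSlot t a x → AtSlot t b x → a ≡ b
AtSlot-unique t o lin dist (mem p) (mem q) x k k' = cong mem (dist p q (var x) k k')
AtSlot-unique t o lin dist (mem p) end x k e = ⊥-elim (memb-tail x o lin k here e)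
AtSlot-unique t o lin dist end (mem q) x e k = ⊥-elim (memb-tail x o lin k here e)
AtSlot-unique t o lin dist end end x e e' = refl

module Derivation (Name : Kind → Var) (Name-inj : ∀ {k k'} → Name k ≡ Name k' → k ≡ k') where
  open LS

  -- The open-list template [f s, f (s+1), ..., f (s+n-1) | tl X (s+n)]: the
  -- suffix from position s of list X when it has s+n cells given by f.
  LT : LI → (ℕ → Term) → ℕ → ℕ → Term
  LT X f s zero = var (Name (tl X s))
  LT X f s (suc n) = cons (f s) (LT X f (suc s) n)

  LT-vars : ∀ X f s n x → x ∈v LT X f s n →
            (Σ ℕ λ q → s ≤ q × q < s + n × x ∈v f q) ⊎ x ≡ Name (tl X (s + n))
  LT-vars X f s zero x here = inj₂ (cong (λ z → Name (tl X z)) (sym (+-identityʳ s)))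
  LT-vars X f s (suc n) x (inH p) = inj₁ (s , ≤-refl , m<m+n s (s≤s z≤n) , p)
  LT-vars X f s (suc n) x (inT p) with LT-vars X f (suc s) n x p
  ... | inj₁ (q , a , b , c) = inj₁ (q , ≤-trans (n≤1+n s) a , subst (q <_) (sym (+-suc s n)) b , c)
  ... | inj₂ e = inj₂ (trans e (cong (λ z → Name (tl X z)) (sym (+-suc s n))))

  LT-sub : ∀ (θ : Subst) X f g s n m →
           (∀ q → s ≤ q → q < s + n → sub θ (f q) ≡ g q) →
           θ (Name (tl X (s + n))) ≡ LT X g (s + n) m →
           sub θ (LT X f s n) ≡ LT X g s (n + m)
  LT-sub θ X f g s zero m hc ht = subst (λ z → θ (Name (tl X z)) ≡ LT X g z m) (+-identityʳ s) ht
  LT-sub θ X f g s (suc n) m hc ht =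
    cong₂ cons (hc s ≤-refl (m<m+n s (s≤s z≤n)))
      (LT-sub θ X f g (suc s) n m (λ q a b → hc q (≤-trans (n≤1+n s) a) (subst (q <_) (sym (+-suc s n)) b))
        (subst (λ z → θ (Name (tl X z)) ≡ LT X g z m) (+-suc s n) ht))

  LTeq : ∀ X g s t → OpenList t → (∀ q → q < len t → g (s + q) ≡ nth (suc q) t) → Name (tl X (s + len t)) ≡ tailv t → LT X g s (len t) ≡ t
  LTeq X g s (var x) ol-var hc ht = cong var (trans (cong (λ z → Name (tl X z)) (sym (+-identityʳ s))) ht)
  LTeq X g s (cons h t) (ol-cons o) hc ht =
    cong₂ cons (trans (cong g (sym (+-identityʳ s))) (hc 0 (s≤s z≤n)))
      (LTeq X g (suc s) t o (λ q lt → trans (cong g (sym (+-suc s q))) (hc (suc q) (s≤s lt)))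
        (trans (cong (λ z → Name (tl X z)) (sym (+-suc s (len t)))) ht))

  nk : ∀ {k k'} → k ≢ k' → Name k ≢ Name k'
  nk n e = n (Name-inj e)

  lkm : ∀ {k k'} t bs → k ≢ k' → look ((Name k' , t) ∷ bs) (Name k) ≡ look bs (Name k)
  lkm {k} {k'} t bs n = look-miss (Name k) (Name k') t bs (nk n)

  lkh : ∀ k t bs → look ((Name k , t) ∷ bs) (Name k) ≡ t
  lkh k t bs = look-hit (Name k) t bs

  _⊆O_ : (Var → Set) → (Kind → Set) → Set
  U ⊆O Old = ∀ x → U x → Σ Kind λ k → x ≡ Name k × Old k

  Res : (Var → Set) → List Atom → (Subst → Set) → Set₁
  Res U G Φ = Σ Subst λ θ → SLD NQUEENS U G θ × Φ θ

  -- Standardisation apart follows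
  -- from κ mapping the clause variables (all < 7) outside the old stamp Old and
  -- into the new stamp Old'; injectivity of the renaming from the left inverse
  -- dec.
  stepL : ∀ {U : Var → Set} {Old Old' : Kind → Set} {Φ Φ' : Subst → Set}
            (A : Atom) (R : List Atom) (c : Clause) (cin : c ∈ NQUEENS)
            (κ : ℕ → Kind) (dec : Kind → ℕ) (dec-ok : ∀ x → dec (κ x) ≡ x)
            (θ : Subst) (G' : List Atom) →
          U ⊆O Old →
          (∀ y → y < 7 → ¬ Old (κ y)) →
          (∀ y → y < 7 → Old' (κ y)) →
          (∀ k → Old k → Old' k) →
          MGU θ A (head (renC (λ x → Name (κ x)) c)) →
          Relevant θ A (head (renC (λ x → Name (κ x)) c)) →
          map (subA θ) (body (renC (λ x → Name (κ x)) c) ++ R) ≡ G' →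
          (∀ {U'} → U' ⊆O Old' → Res U' G' Φ') →
          (∀ σ → Φ' σ → Φ (θ ⨾ σ)) →
          Res U (A ∷ R) Φ
  stepL {U} {Old} {Old'} A R c cin κ dec dec-ok θ G' sub0 fresh new mono mg rl eqG k tr =
    let ρ = λ x → Name (κ x)
        U' = λ x → U x ⊎ x ∈vC renC ρ c
        sub' : U' ⊆O Old'
        sub' = λ { x (inj₁ u) → let (k , e , o) = sub0 x u in k , e , mono k o
                 ; x (inj₂ p) → let (y , q , e) = renC-var ρ c x p in κ y , e , new y (NQ-bnd c cin y q) }
        (σ , d , φ) = k {U'} sub'
        inj : ∀ x y → ρ x ≡ ρ y → x ≡ y
        inj x y e = trans (sym (dec-ok x)) (trans (cong dec (Name-inj e)) (dec-ok y))
        fr : ∀ x → x ∈vC c → ¬ U (ρ x)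
        fr x p u = let (k' , e , o) = sub0 (ρ x) u in fresh x (NQ-bnd c cin x p) (subst Old (sym (Name-inj e)) o)
    in θ ⨾ σ , step [] R A c ρ θ σ cin inj fr mg rl (subst (λ G → SLD NQUEENS U' G σ) (sym eqG) d) , tr σ φ

  -- Cells of list X contain only their own cell variable or counter variables
  -- (the queen of an S_pq atom is such a variable).
  CellOK : LI → (ℕ → Term) → Set
  CellOK X f = ∀ q x → x ∈v f q → x ≡ Name (pos X q) ⊎ Σ ℕ (λ n → x ≡ Name (ik n))

  Unf : LI → (ℕ → Term) → ℕ → Set
  Unf X f e = ∀ q → e ≤ q → f q ≡ var (Name (pos X q))

  -- The effect of clause 4 on one list argument: unifying the suffix of list X
  -- from position q with the head argument [Y|Cs] (clause variables sy, sz of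
  -- step M).  Inside the known cells (walk-in) Y and Cs are bound to the cell
  -- and the rest; at the tail (walk-ext) the tail variable is bound to a new
  -- cell and a new tail, which become the names of Y and Cs.
  record WComp (X : LI) (f : ℕ → Term) (e q M sy sz : ℕ) : Set where
    field
      e'   : ℕ
      ky kz : Kind
      bs   : Bind
      newk : (ky ≡ jk M sy × kz ≡ jk M sz × e' ≡ e) ⊎ (ky ≡ pos X e × kz ≡ tl X (suc e) × e' ≡ suc e)
      keys : BP (λ x t → x ≡ Name ky ⊎ x ≡ Name kz ⊎ x ≡ Name (tl X e)) bs
      unif : sub (look bs) (LT X f q (e ∸ q)) ≡ sub (look bs) (cons (var (Name ky)) (var (Name kz)))
      mgu  : BP (λ x t → ∀ σ → sub σ (LT X f q (e ∸ q)) ≡ sub σ (cons (var (Name ky)) (var (Name kz))) → σ x ≡ sub σ t) bs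
      rel  : BP (λ x t → (x ∈v LT X f q (e ∸ q) ⊎ x ∈v cons (var (Name ky)) (var (Name kz))) ×
                         (∀ y → y ∈v t → y ∈v LT X f q (e ∸ q) ⊎ y ∈v cons (var (Name ky)) (var (Name kz)))) bs
      body : look bs (Name kz) ≡ LT X f (suc q) (e' ∸ suc q)
      eff  : ∀ s → s ≤ e → sub (look bs) (LT X f s (e ∸ s)) ≡ LT X f s (e' ∸ s)
      e'≥  : e ≤ e'
      q<e' : q < e'

  LTv : ∀ X f s n x → CellOK X f → x ∈v LT X f s n →
        (Σ ℕ λ q → x ≡ Name (pos X q) × s ≤ q × q < s + n) ⊎ (Σ ℕ λ m → x ≡ Name (ik m)) ⊎ x ≡ Name (tl X (s + n))
  LTv X f s n x ok p with LT-vars X f s n x p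
  ... | inj₂ e = inj₂ (inj₂ e)
  ... | inj₁ (q , a , b , c) with ok q x c
  ...   | inj₁ e = inj₁ (q , e , a , b)
  ...   | inj₂ m = inj₂ (inj₁ m)

  notJK : ∀ X f s n x → CellOK X f → x ∈v LT X f s n → ∀ M s' → x ≢ Name (jk M s')
  notJK X f s n x ok p M s' e with LTv X f s n x ok p
  ... | inj₁ (q , e1 , _) with Name-inj (trans (sym e1) e)
  ...   | ()
  notJK X f s n x ok p M s' e | inj₂ (inj₁ (m , e1)) with Name-inj (trans (sym e1) e)
  ...   | ()
  notJK X f s n x ok p M s' e | inj₂ (inj₂ e1) with Name-inj (trans (sym e1) e)
  ...   | ()

  fixBS : ∀ bs t → (∀ x → x ∈v t → NotDom x bs) → sub (look bs) t ≡ t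
  fixBS bs t h = sub-fix (look bs) t (λ x p → look-notdom x bs (h x p))

  e∸q : ∀ {e q} → q < e → e ∸ q ≡ suc (e ∸ suc q)
  e∸q {e} {q} q<e = +-∸-assoc 1 q<e

  walk-in : ∀ X f e q M sy sz → sy ≢ sz → CellOK X f → Unf X f e → q < e → WComp X f e q M sy sz
  walk-in X f e q M sy sz sy≢sz ok unf q<e = record
    { e' = e ; ky = jk M sy ; kz = jk M sz ; bs = bs
    ; newk = inj₁ (refl , refl , refl)
    ; keys = inj₁ refl ∷ inj₂ (inj₁ refl) ∷ []
    ; unif = trans (fixBS bs _ fixv) (trans aeq (sym rhs))
    ; mgu = (λ σ u → sym (cons-inj₁ (trans (sym (cong (sub σ) aeq)) u)))
          ∷ (λ σ u → sym (cons-inj₂ (trans (sym (cong (sub σ) aeq)) u))) ∷ []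
    ; rel = (inj₂ (inH here) , λ y p → inj₁ (subst (y ∈v_) (sym aeq) (inH p)))
          ∷ (inj₂ (inT here) , λ y p → inj₁ (subst (y ∈v_) (sym aeq) (inT p))) ∷ []
    ; body = trans (look-miss (Name (jk M sz)) (Name (jk M sy)) (f q) _ (λ e → sy≢ (Name-inj e))) (look-hit (Name (jk M sz)) (LT X f (suc q) n) [])
    ; eff = λ s s≤e → fixBS bs _ (λ x p → nd x (notJK X f s (e ∸ s) x ok p M sy) (notJK X f s (e ∸ s) x ok p M sz))
    ; e'≥ = ≤-refl ; q<e' = q<e }
    where
    n = e ∸ suc q
    aeq : LT X f q (e ∸ q) ≡ cons (f q) (LT X f (suc q) n)
    aeq = cong (LT X f q) (e∸q q<e)
    bs = (Name (jk M sy) , f q) ∷ (Name (jk M sz) , LT X f (suc q) n) ∷ []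
    sy≢ : jk M sz ≢ jk M sy
    sy≢ refl = sy≢sz refl
    rhs : sub (look bs) (cons (var (Name (jk M sy))) (var (Name (jk M sz)))) ≡ cons (f q) (LT X f (suc q) n)
    rhs = cong₂ cons (look-hit (Name (jk M sy)) (f q) _) (trans (look-miss (Name (jk M sz)) (Name (jk M sy)) (f q) _ (λ e → sy≢ (Name-inj e))) (look-hit (Name (jk M sz)) (LT X f (suc q) n) []))
    nd : ∀ x → x ≢ Name (jk M sy) → x ≢ Name (jk M sz) → NotDom x bs
    nd x a b = a ∷ b ∷ []
    fixv : ∀ x → x ∈v LT X f q (e ∸ q) → NotDom x bs
    fixv x p = nd x (notJK X f q (e ∸ q) x ok p M sy) (notJK X f q (e ∸ q) x ok p M sz)

  walk-ext : ∀ X f e M sy sz → CellOK X f → Unf X f e → WComp X f e e M sy sz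
  walk-ext X f e M sy sz ok unf = record
    { e' = suc e ; ky = pos X e ; kz = tl X (suc e) ; bs = bs
    ; newk = inj₂ (refl , refl , refl)
    ; keys = inj₂ (inj₂ refl) ∷ []
    ; unif = trans (cong (sub (look bs)) aeq) (trans (look-hit (Name (tl X e)) T []) (sym rhs))
    ; mgu = (λ σ u → trans (sym (cong (sub σ) aeq)) u) ∷ []
    ; rel = (inj₁ (subst (Name (tl X e) ∈v_) (sym aeq) here) , λ y p → inj₂ p) ∷ []
    ; body = trans (look-miss _ _ T [] (λ e' → tl≢ (Name-inj e'))) (cong (LT X f (suc e)) (sym (n∸n≡0 e)))
    ; eff = effp
    ; e'≥ = n≤1+n e ; q<e' = ≤-refl }
    where
    T = cons (var (Name (pos X e))) (var (Name (tl X (suc e))))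
    bs = (Name (tl X e) , T) ∷ []
    aeq : LT X f e (e ∸ e) ≡ var (Name (tl X e))
    aeq = cong (LT X f e) (n∸n≡0 e)
    tl≢ : tl X (suc e) ≢ tl X e
    tl≢ ()
    rhs : sub (look bs) T ≡ T
    rhs = cong₂ cons (look-miss (Name (pos X e)) _ T [] (λ e' → p≢ (Name-inj e'))) (look-miss (Name (tl X (suc e))) _ T [] (λ e' → tl≢ (Name-inj e')))
      where
      p≢ : pos X e ≢ tl X e
      p≢ ()
    effp : ∀ s → s ≤ e → sub (look bs) (LT X f s (e ∸ s)) ≡ LT X f s (suc e ∸ s)
    effp s s≤e = trans (LT-sub (look bs) X f f s (e ∸ s) 1 hc ht) (cong (LT X f s) (trans (+-comm (e ∸ s) 1) (sym (+-∸-assoc 1 s≤e))))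
      where
      se : s + (e ∸ s) ≡ e
      se = m+[n∸m]≡n s≤e
      hc : ∀ q → s ≤ q → q < s + (e ∸ s) → sub (look bs) (f q) ≡ f q
      hc q _ q< = sub-fix (look bs) (f q) (λ x p → look-notdom x bs ((λ ex → nt x p ex) ∷ []))
        where
        nt : ∀ x → x ∈v f q → x ≢ Name (tl X e)
        nt x p ex with ok q x p
        ... | inj₁ e1 with Name-inj (trans (sym e1) ex)
        ...   | ()
        nt x p ex | inj₂ (m , e1) with Name-inj (trans (sym e1) ex)
        ...   | ()
      ht : look bs (Name (tl X (s + (e ∸ s)))) ≡ LT X f (s + (e ∸ s)) 1
      ht rewrite se = trans (look-hit (Name (tl X e)) T []) (cong (λ z → cons z (var (Name (tl X (suc e))))) (sym (unf e ≤-refl)))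

  -- Terms whose variables are counter variables; every queen is such a term.
  IkT : Term → Set
  IkT t = ∀ x → x ∈v t → Σ ℕ λ n → x ≡ Name (ik n)

  -- A pending goal pq(v, C from a, U from b, D from c), described by the queen
  -- v and the three starting positions.
  Desc : Set
  Desc = Term × ℕ × ℕ × ℕ

  pqA : LS → LS → LS → Term → ℕ → ℕ → ℕ → Atom
  pqA C U D v a b c = atom pq v (LT LC (f C) a (e C ∸ a)) (LT LU (f U) b (e U ∸ b)) (LT LD (f D) c (e D ∸ c))

  rest : LS → LS → LS → List Desc → List Atom
  rest C U D [] = []
  rest C U D ((v , a , b , c) ∷ ds) = pqA C U D v a b c ∷ rest C U D ds

  Fits : LS → LS → LS → Desc → Set
  Fits C U D (v , a , b , c) = IkT v × a ≤ e C × b ≤ e U × c ≤ e D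

  EffL : LI → LS → LS → Subst → Set
  EffL X S S' θ = ∀ s → s ≤ e S → sub θ (LT X (f S) s (e S ∸ s)) ≡ LT X (f S') s (e S' ∸ s)

  -- This is what lets pending goals be updated without inspecting them.
  Eff : LS → LS → LS → LS → LS → LS → Subst → Set
  Eff C U D C' U' D' θ = EffL LC C C' θ × EffL LU U U' θ × EffL LD D D' θ × (∀ t → IkT t → sub θ t ≡ t)

  rest-eff : ∀ C U D C' U' D' θ ds → Eff C U D C' U' D' θ → All (Fits C U D) ds → map (subA θ) (rest C U D ds) ≡ rest C' U' D' ds
  rest-eff C U D C' U' D' θ [] ef [] = refl
  rest-eff C U D C' U' D' θ ((v , a , b , c) ∷ ds) ef@(eC , eU , eD , ei) ((iv , a≤ , b≤ , c≤) ∷ fs) =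
    cong₂ _∷_ (atomEq (ei v iv) (eC a a≤) (eU b b≤) (eD c c≤)) (rest-eff C U D C' U' D' θ ds ef fs)

  notdom-cls : ∀ sc M b c k → BP (λ y t → Σ Kind λ k' → y ≡ Name k' × kc sc M k' ≡ c) b → kc sc M k ≢ c → NotDom (Name k) b
  notdom-cls sc M [] c k [] n = []
  notdom-cls sc M (_ ∷ b) c k ((k' , e1 , e2) ∷ ps) n = (λ ex → n (trans (cong (kc sc M) (Name-inj (trans ex e1))) e2)) ∷ notdom-cls sc M b c k ps n

  XN : (ℕ → Cls) → ℕ → LI → Var → Set
  XN sc M X x = Σ Kind λ k → x ≡ Name k × (kc sc M k ≡ cX X ⊎ kc sc M k ≡ cN)

  LT-XN : ∀ sc M X g s n → CellOK X g → ∀ x → x ∈v LT X g s n → XN sc M X x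
  LT-XN sc M X g s n ok x p with LTv X g s n x ok p
  ... | inj₁ (q , e1 , _) = pos X q , e1 , inj₁ refl
  ... | inj₂ (inj₁ (m , e1)) = ik m , e1 , inj₂ refl
  ... | inj₂ (inj₂ e1) = tl X _ , e1 , inj₁ refl

  wkeys : ∀ {X g e0 q M sy sz} (w : WComp X g e0 q M sy sz) → class₄ sy ≡ cX X → class₄ sz ≡ cX X →
          BP (λ y t → Σ Kind λ k' → y ≡ Name k' × kc class₄ M k' ≡ cX X) (WComp.bs w)
  wkeys {X} {g} {e0} {q} {M} {sy} {sz} w hy hz = All.map (λ {e} → fk {proj₁ e} {proj₂ e}) (WComp.keys w)
    where
    cy : kc class₄ M (WComp.ky w) ≡ cX X
    cy with WComp.newk w
    ... | inj₁ (e1 , _ , _) rewrite e1 = trans (kc-jk class₄ M sy) hy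
    ... | inj₂ (e1 , _ , _) rewrite e1 = refl
    cz : kc class₄ M (WComp.kz w) ≡ cX X
    cz with WComp.newk w
    ... | inj₁ (_ , e1 , _) rewrite e1 = trans (kc-jk class₄ M sz) hz
    ... | inj₂ (_ , e1 , _) rewrite e1 = refl
    fk : ∀ {x : Var} {t : Term} → (x ≡ Name (WComp.ky w) ⊎ x ≡ Name (WComp.kz w) ⊎ x ≡ Name (tl X e0)) →
        Σ Kind λ k' → x ≡ Name k' × kc class₄ M k' ≡ cX X
    fk (inj₁ e1) = _ , e1 , cy
    fk (inj₂ (inj₁ e1)) = _ , e1 , cz
    fk (inj₂ (inj₂ e1)) = _ , e1 , refl

  wfreshY : ∀ {X g e0 q M sy sz} (w : WComp X g e0 q M sy sz) st → Stamp.M st ≡ M → eOf X st ≡ e0 → ¬ OldS st (WComp.ky w)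
  wfreshY {X} {g} {e0} {q} {M} {sy} {sz} w st hM he o with WComp.newk w
  ... | inj₁ (e1 , _ , _) rewrite e1 = <-irrefl (sym hM) o
  ... | inj₂ (e1 , _ , _) rewrite e1 = <-irrefl (sym he) (oldPos X st e0 o)

  wfreshZ : ∀ {X g e0 q M sy sz} (w : WComp X g e0 q M sy sz) st → Stamp.M st ≡ M → eOf X st ≡ e0 → ¬ OldS st (WComp.kz w)
  wfreshZ {X} {g} {e0} {q} {M} {sy} {sz} w st hM he o with WComp.newk w
  ... | inj₁ (_ , e1 , _) rewrite e1 = <-irrefl (sym hM) o
  ... | inj₂ (_ , e1 , _) rewrite e1 = 1+n≰n (subst (suc e0 ≤_) he (oldTl X st (suc e0) o))

  wnewY : ∀ {X g e0 q M sy sz} (w : WComp X g e0 q M sy sz) st → Stamp.M st ≡ suc M → eOf X st ≡ WComp.e' w → (X ≡ LU → Stamp.loU st ≤ e0) → OldS st (WComp.ky w)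
  wnewY {X} {g} {e0} {q} {M} {sy} {sz} w st hM he hl with WComp.newk w
  ... | inj₁ (e1 , _ , _) rewrite e1 | hM = ≤-refl
  ... | inj₂ (e1 , _ , e2) rewrite e1 = newPos X st e0 hl (subst (e0 <_) (sym (trans he e2)) ≤-refl)

  wnewZ : ∀ {X g e0 q M sy sz} (w : WComp X g e0 q M sy sz) st → Stamp.M st ≡ suc M → eOf X st ≡ WComp.e' w → OldS st (WComp.kz w)
  wnewZ {X} {g} {e0} {q} {M} {sy} {sz} w st hM he with WComp.newk w
  ... | inj₁ (_ , e1 , _) rewrite e1 | hM = ≤-refl
  ... | inj₂ (_ , e1 , e2) rewrite e1 = newTl X st (suc e0) (subst (suc e0 ≤_) (sym (trans he e2)) ≤-refl)

  wcy : ∀ {X g e0 q M sy sz} (w : WComp X g e0 q M sy sz) → class₄ sy ≡ cX X → kc class₄ M (WComp.ky w) ≡ cX X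
  wcy {X} {g} {e0} {q} {M} {sy} {sz} w hy with WComp.newk w
  ... | inj₁ (e1 , _ , _) rewrite e1 = trans (kc-jk class₄ M sy) hy
  ... | inj₂ (e1 , _ , _) rewrite e1 = refl

  wcz : ∀ {X g e0 q M sy sz} (w : WComp X g e0 q M sy sz) → class₄ sz ≡ cX X → kc class₄ M (WComp.kz w) ≡ cX X
  wcz {X} {g} {e0} {q} {M} {sy} {sz} w hz with WComp.newk w
  ... | inj₁ (_ , e1 , _) rewrite e1 = trans (kc-jk class₄ M sz) hz
  ... | inj₂ (_ , e1 , _) rewrite e1 = refl

  -- Since the
  -- three binding lists use variables of pairwise different classes, the joint
  -- substitution agrees with each per-list substitution on that list's variables.
  ClassKeys : (ℕ → Cls) → ℕ → LI → Bind → Set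
  ClassKeys sc M X = BP (λ y t → Σ Kind λ k' → y ≡ Name k' × kc sc M k' ≡ cX X)

  module JointBinding (sc : ℕ → Cls) (sc0 : sc 0 ≡ cI) (M : ℕ) (v : Term) (bC bU bD : Bind)
           (kC : ClassKeys sc M LC bC) (kU : ClassKeys sc M LU bU) (kD : ClassKeys sc M LD bD) where
    I : Var
    I = Name (jk M 0)

    bs : Bind
    bs = (I , v) ∷ (bC ++ bU ++ bD)

    θ : Subst
    θ = look bs

    notI : ∀ k X → (kc sc M k ≡ cX X ⊎ kc sc M k ≡ cN) → Name k ≢ I
    notI k X h ex with trans (cong (kc sc M) (Name-inj ex)) (trans (kc-jk sc M 0) sc0)
    notI k X (inj₁ e1) ex | e2 with trans (sym e1) e2
    ... | ()
    notI k X (inj₂ e1) ex | e2 with trans (sym e1) e2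
    ... | ()

    agC : ∀ x → XN sc M LC x → θ x ≡ look bC x
    agC x (k , refl , h) = trans (look-miss (Name k) I v _ (notI k LC h))
      (look-++ʳ (Name k) bC (bU ++ bD) (++⁺ (notdom-cls sc M bU (cX LU) k kU (ndk sc M k LC LU h LC≢LU))
                                            (notdom-cls sc M bD (cX LD) k kD (ndk sc M k LC LD h LC≢LD))))

    agU : ∀ x → XN sc M LU x → θ x ≡ look bU x
    agU x (k , refl , h) = trans (look-miss (Name k) I v _ (notI k LU h))
      (trans (look-++ˡ (Name k) bC (bU ++ bD) (notdom-cls sc M bC (cX LC) k kC (ndk sc M k LU LC h (λ e → LC≢LU (sym e)))))
        (look-++ʳ (Name k) bU bD (notdom-cls sc M bD (cX LD) k kD (ndk sc M k LU LD h LU≢LD))))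

    agD : ∀ x → XN sc M LD x → θ x ≡ look bD x
    agD x (k , refl , h) = trans (look-miss (Name k) I v _ (notI k LD h))
      (trans (look-++ˡ (Name k) bC (bU ++ bD) (notdom-cls sc M bC (cX LC) k kC (ndk sc M k LD LC h (λ e → LC≢LD (sym e)))))
        (look-++ˡ (Name k) bU bD (notdom-cls sc M bU (cX LU) k kU (ndk sc M k LD LU h (λ e → LU≢LD (sym e))))))

    ikFix : ∀ t → IkT t → sub θ t ≡ t
    ikFix t it = sub-fix θ t (λ x p → let (m , ex) = it x p in trans (agC x (ik m , ex , inj₂ refl)) (subst (λ z → look bC z ≡ var z) (sym ex) (look-notdom (Name (ik m)) bC (notdom-cls sc M bC (cX LC) (ik m) kC (λ ())))))

    onC : ∀ t → (∀ x → x ∈v t → XN sc M LC x) → sub θ t ≡ sub (look bC) t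
    onC t h = sub-ext θ (look bC) t (λ x p → agC x (h x p))

    onU : ∀ t → (∀ x → x ∈v t → XN sc M LU x) → sub θ t ≡ sub (look bU) t
    onU t h = sub-ext θ (look bU) t (λ x p → agU x (h x p))

    onD : ∀ t → (∀ x → x ∈v t → XN sc M LD x) → sub θ t ≡ sub (look bD) t
    onD t h = sub-ext θ (look bD) t (λ x p → agD x (h x p))

    jointEff : ∀ C U D C' U' D' → CellOK LC (f C) → CellOK LU (f U) → CellOK LD (f D) →
               EffL LC C C' (look bC) → EffL LU U U' (look bU) → EffL LD D D' (look bD) → Eff C U D C' U' D' θ
    jointEff C U D C' U' D' okC okU okD effC effU effD =
        (λ s s≤ → trans (onC _ (LT-XN sc M LC (f C) s (e C ∸ s) okC)) (effC s s≤))
      , (λ s s≤ → trans (onU _ (LT-XN sc M LU (f U) s (e U ∸ s) okU)) (effU s s≤))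
      , (λ s s≤ → trans (onD _ (LT-XN sc M LD (f D) s (e D ∸ s) okD)) (effD s s≤))
      , ikFix

  module WalkRenaming (M ib loU : ℕ) (C U D : LS) {qC qU qD : ℕ}
           (wc : WComp LC (f C) (e C) qC M 1 2) (wu : WComp LU (f U) (e U) qU M 3 4) (wd : WComp LD (f D) (e D) qD M 5 6)
           (lo≤ : loU ≤ e U) where
    κ : ℕ → Kind
    κ 0 = jk M 0
    κ 1 = WComp.ky wc
    κ 2 = WComp.kz wc
    κ 3 = WComp.ky wu
    κ 4 = WComp.kz wu
    κ 5 = WComp.ky wd
    κ 6 = WComp.kz wd
    κ (suc (suc (suc (suc (suc (suc (suc x))))))) = jx (7 + x)
    dec : Kind → ℕ
    dec (ik _) = 0
    dec (pos LC _) = 1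
    dec (tl LC _) = 2
    dec (pos LU _) = 3
    dec (tl LU _) = 4
    dec (pos LD _) = 5
    dec (tl LD _) = 6
    dec (jk _ s) = s
    dec (jx x) = x
    dy : ∀ {X g e0 q sy sz} (w : WComp X g e0 q M sy sz) → dec (pos X e0) ≡ sy → dec (WComp.ky w) ≡ sy
    dy w h with WComp.newk w
    ... | inj₁ (e1 , _ , _) rewrite e1 = refl
    ... | inj₂ (e1 , _ , _) rewrite e1 = h
    dz : ∀ {X g e0 q sy sz} (w : WComp X g e0 q M sy sz) → dec (tl X (suc e0)) ≡ sz → dec (WComp.kz w) ≡ sz
    dz w h with WComp.newk w
    ... | inj₁ (_ , e1 , _) rewrite e1 = refl
    ... | inj₂ (_ , e1 , _) rewrite e1 = h
    dec-ok : ∀ x → dec (κ x) ≡ x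
    dec-ok 0 = refl
    dec-ok 1 = dy wc refl
    dec-ok 2 = dz wc refl
    dec-ok 3 = dy wu refl
    dec-ok 4 = dz wu refl
    dec-ok 5 = dy wd refl
    dec-ok 6 = dz wd refl
    dec-ok (suc (suc (suc (suc (suc (suc (suc x))))))) = refl
    st st' : Stamp
    st = stamp M ib loU (e C) (e U) (e D)
    st' = stamp (suc M) ib loU (WComp.e' wc) (WComp.e' wu) (WComp.e' wd)
    fresh : ∀ y → y < 7 → ¬ OldS st (κ y)
    fresh 0 _ o = <-irrefl refl o
    fresh 1 _ = wfreshY wc st refl refl
    fresh 2 _ = wfreshZ wc st refl refl
    fresh 3 _ = wfreshY wu st refl refl
    fresh 4 _ = wfreshZ wu st refl refl
    fresh 5 _ = wfreshY wd st refl refl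
    fresh 6 _ = wfreshZ wd st refl refl
    fresh (suc (suc (suc (suc (suc (suc (suc y))))))) (s≤s (s≤s (s≤s (s≤s (s≤s (s≤s (s≤s ())))))))
    new : ∀ y → y < 7 → OldS st' (κ y)
    new 0 _ = ≤-refl
    new 1 _ = wnewY wc st' refl refl (λ ())
    new 2 _ = wnewZ wc st' refl refl
    new 3 _ = wnewY wu st' refl refl (λ _ → lo≤)
    new 4 _ = wnewZ wu st' refl refl
    new 5 _ = wnewY wd st' refl refl (λ ())
    new 6 _ = wnewZ wd st' refl refl
    new (suc (suc (suc (suc (suc (suc (suc y))))))) (s≤s (s≤s (s≤s (s≤s (s≤s (s≤s (s≤s ())))))))
    mono : ∀ k → OldS st k → OldS st' k
    mono = oldMono st st' (n≤1+n M) ≤-refl ≤-refl (WComp.e'≥ wc) (WComp.e'≥ wu) (WComp.e'≥ wd)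

  -- Clause 4 applied to the first pending goal: the three list arguments walk
  -- one cell further, all other pending goals follow by the effect.
  walkStep : ∀ {Uv : Var → Set} {Φ Φ' : Subst → Set} (M ib loU : ℕ) (v : Term) (C U D : LS) (qC qU qD : ℕ) (ds : List Desc)
    (wc : WComp LC (f C) (e C) qC M 1 2) (wu : WComp LU (f U) (e U) qU M 3 4) (wd : WComp LD (f D) (e D) qD M 5 6) →
    loU ≤ e U →
    CellOK LC (f C) → CellOK LU (f U) → CellOK LD (f D) →
    IkT v → All (Fits C U D) ds →
    Uv ⊆O OldS (stamp M ib loU (e C) (e U) (e D)) →
    (∀ {U'} → U' ⊆O OldS (stamp (suc M) ib loU (WComp.e' wc) (WComp.e' wu) (WComp.e' wd)) →
        Res U' (pqA (ls (f C) (WComp.e' wc)) (ls (f U) (WComp.e' wu)) (ls (f D) (WComp.e' wd)) v (suc qC) (suc qU) (suc qD)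
               ∷ rest (ls (f C) (WComp.e' wc)) (ls (f U) (WComp.e' wu)) (ls (f D) (WComp.e' wd)) ds) Φ') →
    (∀ θ → Eff C U D (ls (f C) (WComp.e' wc)) (ls (f U) (WComp.e' wu)) (ls (f D) (WComp.e' wd)) θ → ∀ σ → Φ' σ → Φ (θ ⨾ σ)) →
    Res Uv (pqA C U D v qC qU qD ∷ rest C U D ds) Φ
  walkStep {Uv} {Φ} {Φ'} M ib loU v C U D qC qU qD ds wc wu wd lo≤ okC okU okD iv fits sub0 k tr =
    stepL A (rest C U D ds) clause₄ (there (there (there (here refl)))) κ dec dec-ok θ G' sub0 fresh new mono (mguL A H bs uni mgs) (relL A H bs rls) eqG k tr'
    where
    bC = WComp.bs wc
    bU = WComp.bs wu
    bD = WComp.bs wd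
    open JointBinding class₄ refl M v bC bU bD (wkeys wc refl refl) (wkeys wu refl refl) (wkeys wd refl refl)
    C' = ls (f C) (WComp.e' wc)
    U' = ls (f U) (WComp.e' wu)
    D' = ls (f D) (WComp.e' wd)
    open WalkRenaming M ib loU C U D wc wu wd lo≤
    A = pqA C U D v qC qU qD
    H = head (renC (λ x → Name (κ x)) clause₄)
    aC = LT LC (f C) qC (e C ∸ qC)
    aU = LT LU (f U) qU (e U ∸ qU)
    aD = LT LD (f D) qD (e D ∸ qD)
    hC = cons (var (Name (WComp.ky wc))) (var (Name (WComp.kz wc)))
    hU = cons (var (Name (WComp.ky wu))) (var (Name (WComp.kz wu)))
    hD = cons (var (Name (WComp.ky wd))) (var (Name (WComp.kz wd)))
    hXN : ∀ {X g e0 q sy sz} (w : WComp X g e0 q M sy sz) → class₄ sy ≡ cX X → class₄ sz ≡ cX X → ∀ x → x ∈v cons (var (Name (WComp.ky w))) (var (Name (WComp.kz w))) → XN class₄ M X x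
    hXN w hy hz x (inH here) = _ , refl , inj₁ (wcy w hy)
    hXN w hy hz x (inT here) = _ , refl , inj₁ (wcz w hz)
    uC : sub θ aC ≡ sub θ hC
    uC = trans (onC aC (LT-XN class₄ M LC (f C) qC _ okC)) (trans (WComp.unif wc) (sym (onC hC (hXN wc refl refl))))
    uU : sub θ aU ≡ sub θ hU
    uU = trans (onU aU (LT-XN class₄ M LU (f U) qU _ okU)) (trans (WComp.unif wu) (sym (onU hU (hXN wu refl refl))))
    uD : sub θ aD ≡ sub θ hD
    uD = trans (onD aD (LT-XN class₄ M LD (f D) qD _ okD)) (trans (WComp.unif wd) (sym (onD hD (hXN wd refl refl))))
    uni : Unifier θ A H
    uni = atomEq (trans (ikFix v iv) (sym (look-hit I v _))) uC uU uD
    MP = λ x t → ∀ σ → Unifier σ A H → σ x ≡ sub σ t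
    mgs : BP MP bs
    mgs = (λ σ u → sym (arg1 u)) ∷ ++⁺ (All.map (λ h σ u → h σ (arg2 u)) (WComp.mgu wc))
                                     (++⁺ (All.map (λ h σ u → h σ (arg3 u)) (WComp.mgu wu)) (All.map (λ h σ u → h σ (arg4 u)) (WComp.mgu wd)))
    RP = λ x t → (x ∈vA A ⊎ x ∈vA H) × (∀ y → y ∈v t → y ∈vA A ⊎ y ∈vA H)
    lC : ∀ {x} → x ∈v aC ⊎ x ∈v hC → x ∈vA A ⊎ x ∈vA H
    lC (inj₁ p) = inj₁ (inj₂ (inj₁ p))
    lC (inj₂ p) = inj₂ (inj₂ (inj₁ p))
    lU : ∀ {x} → x ∈v aU ⊎ x ∈v hU → x ∈vA A ⊎ x ∈vA H
    lU (inj₁ p) = inj₁ (inj₂ (inj₂ (inj₁ p)))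
    lU (inj₂ p) = inj₂ (inj₂ (inj₂ (inj₁ p)))
    lD : ∀ {x} → x ∈v aD ⊎ x ∈v hD → x ∈vA A ⊎ x ∈vA H
    lD (inj₁ p) = inj₁ (inj₂ (inj₂ (inj₂ p)))
    lD (inj₂ p) = inj₂ (inj₂ (inj₂ (inj₂ p)))
    rls : BP RP bs
    rls = (inj₂ (inj₁ here) , λ y p → inj₁ (inj₁ p))
        ∷ ++⁺ (All.map (λ { (a , b) → lC a , λ y p → lC (b y p) }) (WComp.rel wc))
              (++⁺ (All.map (λ { (a , b) → lU a , λ y p → lU (b y p) }) (WComp.rel wu))
                   (All.map (λ { (a , b) → lD a , λ y p → lD (b y p) }) (WComp.rel wd)))
    G' = pqA C' U' D' v (suc qC) (suc qU) (suc qD) ∷ rest C' U' D' ds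
    ef : Eff C U D C' U' D' θ
    ef = jointEff C U D C' U' D' okC okU okD (WComp.eff wc) (WComp.eff wu) (WComp.eff wd)
    eqG : map (subA θ) (body (renC (λ x → Name (κ x)) clause₄) ++ rest C U D ds) ≡ G'
    eqG = cong₂ _∷_ (atomEq (look-hit I v _)
                            (trans (agC _ (_ , refl , inj₁ (wcz wc refl))) (WComp.body wc))
                            (trans (agU _ (_ , refl , inj₁ (wcz wu refl))) (WComp.body wu))
                            (trans (agD _ (_ , refl , inj₁ (wcz wd refl))) (WComp.body wd)))
                    (rest-eff C U D C' U' D' θ ds ef fits)
    tr' : ∀ σ → Φ' σ → Φ (θ ⨾ σ)
    tr' = tr θ ef

  -- The effect of clause 3 on one list argument: the suffix of list X from
  -- position p is unified with [I|Xk] where I is bound to the queen val; the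
  -- cell p (if inside the list) or a new cell at the tail (if p is the extent)
  -- receives val.
  record FComp (X : LI) (g : ℕ → Term) (e0 p M sx : ℕ) (val : Term) : Set where
    field
      e'   : ℕ
      kx   : Kind
      bs   : Bind
      newk : (kx ≡ jk M sx × e' ≡ e0) ⊎ (kx ≡ tl X (suc e0) × e' ≡ suc e0)
      keys : BP (λ x t → x ≡ Name kx ⊎ x ≡ Name (pos X p) ⊎ x ≡ Name (tl X e0)) bs
      unif : sub (look bs) (LT X g p (e0 ∸ p)) ≡ cons val (look bs (Name kx))
      mgu  : BP (λ x t → ∀ σ → sub σ (LT X g p (e0 ∸ p)) ≡ cons (sub σ val) (σ (Name kx)) → σ x ≡ sub σ t) bs
      rel  : BP (λ x t → (x ∈v LT X g p (e0 ∸ p) ⊎ x ≡ Name kx) ×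
                         (∀ y → y ∈v t → y ∈v LT X g p (e0 ∸ p) ⊎ y ≡ Name kx ⊎ y ∈v val)) bs
      eff  : ∀ s → s ≤ e0 → sub (look bs) (LT X g s (e0 ∸ s)) ≡ LT X (upd g p val) s (e' ∸ s)
      e'≥  : e0 ≤ e'
      p<e' : p < e'

  fin-in : ∀ X g e0 p M sx val → CellOK X g → g p ≡ var (Name (pos X p)) → p < e0 → FComp X g e0 p M sx val
  fin-in X g e0 p M sx val ok gp p<e = record
    { e' = e0 ; kx = jk M sx ; bs = bs
    ; newk = inj₁ (refl , refl)
    ; keys = inj₂ (inj₁ refl) ∷ inj₁ refl ∷ []
    ; unif = trans (cong (sub (look bs)) aeq) (cong₂ cons (look-hit P val _) (trans rfix (sym lkx)))
    ; mgu = (λ σ u → cons-inj₁ (trans (sym (cong (sub σ) aeq)) u))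
          ∷ (λ σ u → sym (cons-inj₂ (trans (sym (cong (sub σ) aeq)) u))) ∷ []
    ; rel = (inj₁ (subst (P ∈v_) (sym aeq) (inH here)) , λ y q → inj₂ (inj₂ q))
          ∷ (inj₂ refl , λ y q → inj₁ (subst (y ∈v_) (sym aeq) (inT q))) ∷ []
    ; eff = effp
    ; e'≥ = ≤-refl ; p<e' = p<e }
    where
    n = e0 ∸ suc p
    P = Name (pos X p)
    R = LT X g (suc p) n
    aeq : LT X g p (e0 ∸ p) ≡ cons (var P) R
    aeq = trans (cong (LT X g p) (e∸q p<e)) (cong (λ z → cons z R) gp)
    bs = (P , val) ∷ (Name (jk M sx) , R) ∷ []
    P≢ : ∀ q → pos X q ≢ jk M sx
    P≢ q ()
    lkx : look bs (Name (jk M sx)) ≡ R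
    lkx = trans (look-miss (Name (jk M sx)) P val _ (λ e → P≢ p (sym (Name-inj e)))) (look-hit (Name (jk M sx)) R [])
    nd : ∀ x → x ≢ P → x ≢ Name (jk M sx) → NotDom x bs
    nd x a b = a ∷ b ∷ []
    rfix : sub (look bs) R ≡ R
    rfix = sub-fix (look bs) R (λ x q → look-notdom x bs (nd x (np x q) (notJK X g (suc p) n x ok q M sx)))
      where
      np : ∀ x → x ∈v R → x ≢ P
      np x q ex with LTv X g (suc p) n x ok q
      ... | inj₁ (q' , e1 , a , _) = <-irrefl (sym (pos-inj (Name-inj (trans (sym e1) ex)))) a
        where
        pos-inj : ∀ {a b} → pos X a ≡ pos X b → a ≡ b
        pos-inj refl = refl
      ... | inj₂ (inj₁ (m , e1)) with Name-inj (trans (sym e1) ex)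
      ...   | ()
      np x q ex | inj₂ (inj₂ e1) with Name-inj (trans (sym e1) ex)
      ...   | ()
    effp : ∀ s → s ≤ e0 → sub (look bs) (LT X g s (e0 ∸ s)) ≡ LT X (upd g p val) s (e0 ∸ s)
    effp s s≤e = trans (LT-sub (look bs) X g (upd g p val) s (e0 ∸ s) 0 hc ht) (cong (LT X (upd g p val) s) (+-identityʳ (e0 ∸ s)))
      where
      hc : ∀ q → s ≤ q → q < s + (e0 ∸ s) → sub (look bs) (g q) ≡ upd g p val q
      hc q _ _ with q ≟ p
      ... | yes refl = trans (cong (sub (look bs)) gp) (look-hit P val _)
      ... | no q≢p = trans (sub-fix (look bs) (g q) (λ x r → look-notdom x bs (nd x (np x r) (nj x r)))) refl
        where
        np : ∀ x → x ∈v g q → x ≢ P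
        np x r ex with ok q x r
        ... | inj₁ e1 = q≢p (pos-inj (Name-inj (trans (sym e1) ex)))
          where
          pos-inj : ∀ {a b} → pos X a ≡ pos X b → a ≡ b
          pos-inj refl = refl
        ... | inj₂ (m , e1) with Name-inj (trans (sym e1) ex)
        ...   | ()
        nj : ∀ x → x ∈v g q → x ≢ Name (jk M sx)
        nj x r ex with ok q x r
        ... | inj₁ e1 with Name-inj (trans (sym e1) ex)
        ...   | ()
        nj x r ex | inj₂ (m , e1) with Name-inj (trans (sym e1) ex)
        ...   | ()
      ht : look bs (Name (tl X (s + (e0 ∸ s)))) ≡ LT X (upd g p val) (s + (e0 ∸ s)) 0
      ht = look-notdom _ bs (nd _ (λ e → t≢p (Name-inj e)) (λ e → t≢j (Name-inj e)))
        where
        t≢p : tl X (s + (e0 ∸ s)) ≢ pos X p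
        t≢p ()
        t≢j : tl X (s + (e0 ∸ s)) ≢ jk M sx
        t≢j ()

  fin-ext : ∀ X g e0 M sx val → CellOK X g → FComp X g e0 e0 M sx val
  fin-ext X g e0 M sx val ok = record
    { e' = suc e0 ; kx = tl X (suc e0) ; bs = bs
    ; newk = inj₂ (refl , refl)
    ; keys = inj₂ (inj₂ refl) ∷ []
    ; unif = trans (cong (sub (look bs)) aeq) (trans (look-hit T (cons val (var K)) []) (cong (cons val) (sym lk)))
    ; mgu = (λ σ u → trans (sym (cong (sub σ) aeq)) u) ∷ []
    ; rel = (inj₁ (subst (T ∈v_) (sym aeq) here) , rr) ∷ []
    ; eff = effp
    ; e'≥ = n≤1+n e0 ; p<e' = ≤-refl }
    where
    T = Name (tl X e0)
    K = Name (tl X (suc e0))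
    bs = (T , cons val (var K)) ∷ []
    aeq : LT X g e0 (e0 ∸ e0) ≡ var T
    aeq = cong (LT X g e0) (n∸n≡0 e0)
    tl≢ : tl X (suc e0) ≢ tl X e0
    tl≢ ()
    lk : look bs K ≡ var K
    lk = look-miss K T _ [] (λ e → tl≢ (Name-inj e))
    rr : ∀ y → y ∈v cons val (var K) → y ∈v LT X g e0 (e0 ∸ e0) ⊎ y ≡ K ⊎ y ∈v val
    rr y (inH q) = inj₂ (inj₂ q)
    rr y (inT here) = inj₂ (inj₁ refl)
    effp : ∀ s → s ≤ e0 → sub (look bs) (LT X g s (e0 ∸ s)) ≡ LT X (upd g e0 val) s (suc e0 ∸ s)
    effp s s≤e = trans (LT-sub (look bs) X g (upd g e0 val) s (e0 ∸ s) 1 hc ht) (cong (LT X (upd g e0 val) s) (trans (+-comm (e0 ∸ s) 1) (sym (+-∸-assoc 1 s≤e))))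
      where
      se : s + (e0 ∸ s) ≡ e0
      se = m+[n∸m]≡n s≤e
      hc : ∀ q → s ≤ q → q < s + (e0 ∸ s) → sub (look bs) (g q) ≡ upd g e0 val q
      hc q _ q< = trans (sub-fix (look bs) (g q) (λ x p → look-notdom x bs ((λ ex → nt x p ex) ∷ [])))
                        (sym (upd-miss g e0 val q (λ e → <-irrefl e (subst (q <_) se q<))))
        where
        nt : ∀ x → x ∈v g q → x ≢ T
        nt x p ex with ok q x p
        ... | inj₁ e1 with Name-inj (trans (sym e1) ex)
        ...   | ()
        nt x p ex | inj₂ (m , e1) with Name-inj (trans (sym e1) ex)
        ...   | ()
      ht : look bs (Name (tl X (s + (e0 ∸ s)))) ≡ LT X (upd g e0 val) (s + (e0 ∸ s)) 1
      ht rewrite se = trans (look-hit T (cons val (var K)) []) (cong (λ z → cons z (var K)) (sym (upd-hit g e0 val)))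

  fcx : ∀ {X g e0 p M sx val} (w : FComp X g e0 p M sx val) → class₃ sx ≡ cX X → kc class₃ M (FComp.kx w) ≡ cX X
  fcx {X} {g} {e0} {p} {M} {sx} w h with FComp.newk w
  ... | inj₁ (e1 , _) rewrite e1 = trans (kc-jk class₃ M sx) h
  ... | inj₂ (e1 , _) rewrite e1 = refl

  fkeys : ∀ {X g e0 p M sx val} (w : FComp X g e0 p M sx val) → class₃ sx ≡ cX X →
          BP (λ y t → Σ Kind λ k' → y ≡ Name k' × kc class₃ M k' ≡ cX X) (FComp.bs w)
  fkeys {X} {g} {e0} {p} {M} {sx} {val} w h = All.map (λ {e} → fk {proj₁ e} {proj₂ e}) (FComp.keys w)
    where
    fk : ∀ {x : Var} {t : Term} → (x ≡ Name (FComp.kx w) ⊎ x ≡ Name (pos X p) ⊎ x ≡ Name (tl X e0)) →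
         Σ Kind λ k' → x ≡ Name k' × kc class₃ M k' ≡ cX X
    fk (inj₁ e1) = _ , e1 , fcx w h
    fk (inj₂ (inj₁ e1)) = _ , e1 , refl
    fk (inj₂ (inj₂ e1)) = _ , e1 , refl

  ffresh : ∀ {X g e0 p M sx val} (w : FComp X g e0 p M sx val) st → Stamp.M st ≡ M → eOf X st ≡ e0 → ¬ OldS st (FComp.kx w)
  ffresh {X} {g} {e0} {p} {M} {sx} w st hM he o with FComp.newk w
  ... | inj₁ (e1 , _) rewrite e1 = <-irrefl (sym hM) o
  ... | inj₂ (e1 , _) rewrite e1 = 1+n≰n (subst (suc e0 ≤_) he (oldTl X st (suc e0) o))

  fnew : ∀ {X g e0 p M sx val} (w : FComp X g e0 p M sx val) st → Stamp.M st ≡ suc M → eOf X st ≡ FComp.e' w → OldS st (FComp.kx w)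
  fnew {X} {g} {e0} {p} {M} {sx} w st hM he with FComp.newk w
  ... | inj₁ (e1 , _) rewrite e1 | hM = ≤-refl
  ... | inj₂ (e1 , e2) rewrite e1 = newTl X st (suc e0) (subst (suc e0 ≤_) (sym (trans he e2)) ≤-refl)

  module FinalRenaming (M ib loU : ℕ) (v : Term) (C U D : LS) {pC pU pD : ℕ}
           (wc : FComp LC (f C) (e C) pC M 1 v) (wu : FComp LU (f U) (e U) pU M 2 v) (wd : FComp LD (f D) (e D) pD M 3 v) where
    κ : ℕ → Kind
    κ 0 = jk M 0
    κ 1 = FComp.kx wc
    κ 2 = FComp.kx wu
    κ 3 = FComp.kx wd
    κ 4 = jk M 4
    κ 5 = jk M 5
    κ 6 = jk M 6
    κ (suc (suc (suc (suc (suc (suc (suc x))))))) = jx (7 + x)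
    dec : Kind → ℕ
    dec (tl LC _) = 1
    dec (tl LU _) = 2
    dec (tl LD _) = 3
    dec (jk _ s) = s
    dec (jx x) = x
    dec _ = 0
    dx : ∀ {X g e0 p sx} (w : FComp X g e0 p M sx v) → dec (tl X (suc e0)) ≡ sx → dec (FComp.kx w) ≡ sx
    dx w h with FComp.newk w
    ... | inj₁ (e1 , _) rewrite e1 = refl
    ... | inj₂ (e1 , _) rewrite e1 = h
    dec-ok : ∀ x → dec (κ x) ≡ x
    dec-ok 0 = refl
    dec-ok 1 = dx wc refl
    dec-ok 2 = dx wu refl
    dec-ok 3 = dx wd refl
    dec-ok 4 = refl
    dec-ok 5 = refl
    dec-ok 6 = refl
    dec-ok (suc (suc (suc (suc (suc (suc (suc x))))))) = refl
    st st' : Stamp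
    st = stamp M ib loU (e C) (e U) (e D)
    st' = stamp (suc M) ib loU (FComp.e' wc) (FComp.e' wu) (FComp.e' wd)
    fresh : ∀ y → y < 7 → ¬ OldS st (κ y)
    fresh 0 _ o = <-irrefl refl o
    fresh 1 _ = ffresh wc st refl refl
    fresh 2 _ = ffresh wu st refl refl
    fresh 3 _ = ffresh wd st refl refl
    fresh 4 _ o = <-irrefl refl o
    fresh 5 _ o = <-irrefl refl o
    fresh 6 _ o = <-irrefl refl o
    fresh (suc (suc (suc (suc (suc (suc (suc y))))))) (s≤s (s≤s (s≤s (s≤s (s≤s (s≤s (s≤s ())))))))
    new : ∀ y → y < 7 → OldS st' (κ y)
    new 0 _ = ≤-refl
    new 1 _ = fnew wc st' refl refl
    new 2 _ = fnew wu st' refl refl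
    new 3 _ = fnew wd st' refl refl
    new 4 _ = ≤-refl
    new 5 _ = ≤-refl
    new 6 _ = ≤-refl
    new (suc (suc (suc (suc (suc (suc (suc y))))))) (s≤s (s≤s (s≤s (s≤s (s≤s (s≤s (s≤s ())))))))
    mono : ∀ k → OldS st k → OldS st' k
    mono = oldMono st st' (n≤1+n M) ≤-refl ≤-refl (FComp.e'≥ wc) (FComp.e'≥ wu) (FComp.e'≥ wd)

  -- Clause 3 applied to the first pending goal: the queen v is placed at
  -- positions pC, pU, pD of the three lists and the goal disappears.
  finalStep : ∀ {Uv : Var → Set} {Φ Φ' : Subst → Set} (M ib loU : ℕ) (v : Term) (C U D : LS) (pC pU pD : ℕ) (ds : List Desc)
    (wc : FComp LC (f C) (e C) pC M 1 v) (wu : FComp LU (f U) (e U) pU M 2 v) (wd : FComp LD (f D) (e D) pD M 3 v) →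
    CellOK LC (f C) → CellOK LU (f U) → CellOK LD (f D) →
    IkT v → All (Fits C U D) ds →
    Uv ⊆O OldS (stamp M ib loU (e C) (e U) (e D)) →
    (∀ {U'} → U' ⊆O OldS (stamp (suc M) ib loU (FComp.e' wc) (FComp.e' wu) (FComp.e' wd)) →
        Res U' (rest (ls (upd (f C) pC v) (FComp.e' wc)) (ls (upd (f U) pU v) (FComp.e' wu)) (ls (upd (f D) pD v) (FComp.e' wd)) ds) Φ') →
    (∀ θ → Eff C U D (ls (upd (f C) pC v) (FComp.e' wc)) (ls (upd (f U) pU v) (FComp.e' wu)) (ls (upd (f D) pD v) (FComp.e' wd)) θ →
       ∀ σ → Φ' σ → Φ (θ ⨾ σ)) →
    Res Uv (pqA C U D v pC pU pD ∷ rest C U D ds) Φ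
  finalStep {Uv} {Φ} {Φ'} M ib loU v C U D pC pU pD ds wc wu wd okC okU okD iv fits sub0 k tr =
    stepL A (rest C U D ds) clause₃ (there (there (here refl))) κ dec dec-ok θ G' sub0 fresh new mono (mguL A H bs uni mgs) (relL A H bs rls) eqG k tr'
    where
    bC = FComp.bs wc
    bU = FComp.bs wu
    bD = FComp.bs wd
    open JointBinding class₃ refl M v bC bU bD (fkeys wc refl) (fkeys wu refl) (fkeys wd refl)
    C' = ls (upd (f C) pC v) (FComp.e' wc)
    U' = ls (upd (f U) pU v) (FComp.e' wu)
    D' = ls (upd (f D) pD v) (FComp.e' wd)
    open FinalRenaming M ib loU v C U D wc wu wd
    A = pqA C U D v pC pU pD
    H = head (renC (λ x → Name (κ x)) clause₃)
    aC = LT LC (f C) pC (e C ∸ pC)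
    aU = LT LU (f U) pU (e U ∸ pU)
    aD = LT LD (f D) pD (e D ∸ pD)
    θI : θ I ≡ v
    θI = look-hit I v _
    uC : sub θ aC ≡ cons (θ I) (θ (Name (FComp.kx wc)))
    uC = trans (onC aC (LT-XN class₃ M LC (f C) pC _ okC))
         (trans (FComp.unif wc) (cong₂ cons (sym θI) (sym (agC _ (_ , refl , inj₁ (fcx wc refl))))))
    uU : sub θ aU ≡ cons (θ I) (θ (Name (FComp.kx wu)))
    uU = trans (onU aU (LT-XN class₃ M LU (f U) pU _ okU))
         (trans (FComp.unif wu) (cong₂ cons (sym θI) (sym (agU _ (_ , refl , inj₁ (fcx wu refl))))))
    uD : sub θ aD ≡ cons (θ I) (θ (Name (FComp.kx wd)))
    uD = trans (onD aD (LT-XN class₃ M LD (f D) pD _ okD))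
         (trans (FComp.unif wd) (cong₂ cons (sym θI) (sym (agD _ (_ , refl , inj₁ (fcx wd refl))))))
    uni : Unifier θ A H
    uni = atomEq (trans (ikFix v iv) (sym θI)) uC uU uD
    MP = λ x t → ∀ σ → Unifier σ A H → σ x ≡ sub σ t
    queen-at-I : ∀ σ → Unifier σ A H → ∀ {a K} → sub σ a ≡ cons (σ I) (σ K) → sub σ a ≡ cons (sub σ v) (σ K)
    queen-at-I σ u h = trans h (cong (λ z → cons z _) (sym (arg1 u)))
    mgs : BP MP bs
    mgs = (λ σ u → sym (arg1 u)) ∷ ++⁺ (All.map (λ h σ u → h σ (queen-at-I σ u {aC} (arg2 u))) (FComp.mgu wc))
                                     (++⁺ (All.map (λ h σ u → h σ (queen-at-I σ u {aU} (arg3 u))) (FComp.mgu wu)) (All.map (λ h σ u → h σ (queen-at-I σ u {aD} (arg4 u))) (FComp.mgu wd)))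
    RP = λ x t → (x ∈vA A ⊎ x ∈vA H) × (∀ y → y ∈v t → y ∈vA A ⊎ y ∈vA H)
    lC : ∀ {x} → x ∈v aC ⊎ x ≡ Name (FComp.kx wc) → x ∈vA A ⊎ x ∈vA H
    lC (inj₁ p) = inj₁ (inj₂ (inj₁ p))
    lC (inj₂ refl) = inj₂ (inj₂ (inj₁ (inT here)))
    lU : ∀ {x} → x ∈v aU ⊎ x ≡ Name (FComp.kx wu) → x ∈vA A ⊎ x ∈vA H
    lU (inj₁ p) = inj₁ (inj₂ (inj₂ (inj₁ p)))
    lU (inj₂ refl) = inj₂ (inj₂ (inj₂ (inj₁ (inT here))))
    lD : ∀ {x} → x ∈v aD ⊎ x ≡ Name (FComp.kx wd) → x ∈vA A ⊎ x ∈vA H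
    lD (inj₁ p) = inj₁ (inj₂ (inj₂ (inj₂ p)))
    lD (inj₂ refl) = inj₂ (inj₂ (inj₂ (inj₂ (inT here))))
    l3 : ∀ {x} {a K} → (∀ {x} → x ∈v a ⊎ x ≡ K → x ∈vA A ⊎ x ∈vA H) → x ∈v a ⊎ x ≡ K ⊎ x ∈v v → x ∈vA A ⊎ x ∈vA H
    l3 l (inj₁ p) = l (inj₁ p)
    l3 l (inj₂ (inj₁ p)) = l (inj₂ p)
    l3 l (inj₂ (inj₂ p)) = inj₁ (inj₁ p)
    rls : BP RP bs
    rls = (inj₂ (inj₁ here) , λ y p → inj₁ (inj₁ p))
        ∷ ++⁺ (All.map (λ { (a , b) → lC a , λ y p → l3 lC (b y p) }) (FComp.rel wc))
              (++⁺ (All.map (λ { (a , b) → lU a , λ y p → l3 lU (b y p) }) (FComp.rel wu))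
                   (All.map (λ { (a , b) → lD a , λ y p → l3 lD (b y p) }) (FComp.rel wd)))
    G' = rest C' U' D' ds
    ef : Eff C U D C' U' D' θ
    ef = jointEff C U D C' U' D' okC okU okD (FComp.eff wc) (FComp.eff wu) (FComp.eff wd)
    eqG : map (subA θ) (body (renC (λ x → Name (κ x)) clause₃) ++ rest C U D ds) ≡ G'
    eqG = rest-eff C U D C' U' D' θ ds ef fits
    tr' : ∀ σ → Φ' σ → Φ (θ ⨾ σ)
    tr' = tr θ ef

  Eff-comp : ∀ C U D C1 U1 D1 C2 U2 D2 θ1 θ2 → e C ≤ e C1 → e U ≤ e U1 → e D ≤ e D1 →
             Eff C U D C1 U1 D1 θ1 → Eff C1 U1 D1 C2 U2 D2 θ2 → Eff C U D C2 U2 D2 (θ1 ⨾ θ2)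
  Eff-comp C U D C1 U1 D1 C2 U2 D2 θ1 θ2 hC hU hD (a1 , b1 , c1 , d1) (a2 , b2 , c2 , d2) =
      (λ s s≤ → trans (sym (sub-comp θ1 θ2 (LT LC (f C) s (e C ∸ s)))) (trans (cong (sub θ2) (a1 s s≤)) (a2 s (≤-trans s≤ hC))))
    , (λ s s≤ → trans (sym (sub-comp θ1 θ2 (LT LU (f U) s (e U ∸ s)))) (trans (cong (sub θ2) (b1 s s≤)) (b2 s (≤-trans s≤ hU))))
    , (λ s s≤ → trans (sym (sub-comp θ1 θ2 (LT LD (f D) s (e D ∸ s)))) (trans (cong (sub θ2) (c1 s s≤)) (c2 s (≤-trans s≤ hD))))
    , (λ t it → trans (sym (sub-comp θ1 θ2 t)) (trans (cong (sub θ2) (d1 t it)) (d2 t it)))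

  Kont : (Subst → Set) → List Desc → ℕ → ℕ → ℕ → (ℕ → Term) → (ℕ → Term) → (ℕ → Term) → ℕ → ℕ → ℕ → Set₁
  Kont Φ' ds M' ib loU gC gU gD EC EU ED =
    ∀ {U'} → U' ⊆O OldS (stamp M' ib loU EC EU ED) → Res U' (rest (ls gC EC) (ls gU EU) (ls gD ED) ds) Φ'

  Trk : (Subst → Set) → (Subst → Set) → LS → LS → LS → (ℕ → Term) → (ℕ → Term) → (ℕ → Term) → ℕ → ℕ → ℕ → Set
  Trk Φ Φ' C U D gC gU gD EC EU ED = ∀ θ → Eff C U D (ls gC EC) (ls gU EU) (ls gD ED) θ → ∀ σ → Φ' σ → Φ (θ ⨾ σ)

  Kont-tr : ∀ {Φ' ds ib loU gC gU gD M1 M2 EC EU ED EC' EU' ED'} → M1 ≡ M2 → EC ≡ EC' → EU ≡ EU' → ED ≡ ED' →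
            Kont Φ' ds M2 ib loU gC gU gD EC' EU' ED' → Kont Φ' ds M1 ib loU gC gU gD EC EU ED
  Kont-tr refl refl refl refl k = k

  Trk-tr : ∀ {Φ Φ' C U D gC gU gD EC EU ED EC' EU' ED'} → EC ≡ EC' → EU ≡ EU' → ED ≡ ED' →
           Trk Φ Φ' C U D gC gU gD EC' EU' ED' → Trk Φ Φ' C U D gC gU gD EC EU ED
  Trk-tr refl refl refl k = k

  fits-mono : ∀ C U D C' U' D' ds → e C ≤ e C' → e U ≤ e U' → e D ≤ e D' → All (Fits C U D) ds → All (Fits C' U' D') ds
  fits-mono C U D C' U' D' [] hC hU hD [] = []
  fits-mono C U D C' U' D' (_ ∷ ds) hC hU hD ((iv , a , b , c) ∷ fs) =
    (iv , ≤-trans a hC , ≤-trans b hU , ≤-trans c hD) ∷ fits-mono C U D C' U' D' ds hC hU hD fs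

  unf-mono : ∀ X g e0 e1 → e0 ≤ e1 → Unf X g e0 → Unf X g e1
  unf-mono X g e0 e1 h u q le = u q (≤-trans h le)

  wchoose : ∀ X g e0 q M sy sz → sy ≢ sz → CellOK X g → Unf X g e0 → q ≤ e0 →
            Σ (WComp X g e0 q M sy sz) λ w → WComp.e' w ≡ e0 ⊔ suc q
  wchoose X g e0 q M sy sz n ok u q≤ with m≤n⇒m<n∨m≡n q≤
  ... | inj₁ q<e = walk-in X g e0 q M sy sz n ok u q<e , sym (m≥n⇒m⊔n≡m q<e)
  ... | inj₂ refl = walk-ext X g q M sy sz ok u , sym (m≤n⇒m⊔n≡n (n≤1+n q))

  fchoose : ∀ X g e0 p M sx val → CellOK X g → g p ≡ var (Name (pos X p)) → p ≤ e0 →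
            Σ (FComp X g e0 p M sx val) λ w → FComp.e' w ≡ e0 ⊔ suc p
  fchoose X g e0 p M sx val ok gp p≤ with m≤n⇒m<n∨m≡n p≤
  ... | inj₁ p<e = fin-in X g e0 p M sx val ok gp p<e , sym (m≥n⇒m⊔n≡m p<e)
  ... | inj₂ refl = fin-ext X g p M sx val ok , sym (m≤n⇒m⊔n≡n (n≤1+n p))

  -- Solving the pending goal pq(v, ...) starting at positions qC, qU, qD: t
  -- walks with clause 4 followed by clause 3 place v at positions pC = qC + t,
  -- pU = qU + t and pD = qD + t, whose cells must still be unfilled.
  pqWalk : ∀ t {Uv : Var → Set} {Φ Φ' : Subst → Set} (M ib loU : ℕ) (v : Term) (C U D : LS) (qC qU qD pC pU pD : ℕ) (ds : List Desc) →
    qC + t ≡ pC → qU + t ≡ pU → qD + t ≡ pD →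
    qC ≤ e C → qU ≤ e U → qD ≤ e D → loU ≤ e U →
    CellOK LC (f C) → CellOK LU (f U) → CellOK LD (f D) →
    Unf LC (f C) (e C) → Unf LU (f U) (e U) → Unf LD (f D) (e D) →
    f C pC ≡ var (Name (pos LC pC)) → f U pU ≡ var (Name (pos LU pU)) → f D pD ≡ var (Name (pos LD pD)) →
    IkT v → All (Fits C U D) ds → Ext Φ →
    Uv ⊆O OldS (stamp M ib loU (e C) (e U) (e D)) →
    Kont Φ' ds (suc t + M) ib loU (upd (f C) pC v) (upd (f U) pU v) (upd (f D) pD v) (e C ⊔ suc pC) (e U ⊔ suc pU) (e D ⊔ suc pD) →
    Trk Φ Φ' C U D (upd (f C) pC v) (upd (f U) pU v) (upd (f D) pD v) (e C ⊔ suc pC) (e U ⊔ suc pU) (e D ⊔ suc pD) →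
    Res Uv (pqA C U D v qC qU qD ∷ rest C U D ds) Φ
  pqWalk zero {Uv} {Φ} {Φ'} M ib loU v C U D qC qU qD pC pU pD ds eqC eqU eqD qC≤ qU≤ qD≤ lo okC okU okD uC uU uD fC fU fD iv fits ext sub0 k tr
    with trans (sym (+-identityʳ qC)) eqC | trans (sym (+-identityʳ qU)) eqU | trans (sym (+-identityʳ qD)) eqD
  ... | refl | refl | refl =
    let (wc , hc) = fchoose LC (f C) (e C) qC M 1 v okC fC qC≤
        (wu , hu) = fchoose LU (f U) (e U) qU M 2 v okU fU qU≤
        (wd , hd) = fchoose LD (f D) (e D) qD M 3 v okD fD qD≤
    in finalStep M ib loU v C U D qC qU qD ds wc wu wd okC okU okD iv fits sub0
         (Kont-tr refl hc hu hd k) (Trk-tr {Φ = Φ} hc hu hd tr)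
  pqWalk (suc t) {Uv} {Φ} {Φ'} M ib loU v C U D qC qU qD pC pU pD ds eqC eqU eqD qC≤ qU≤ qD≤ lo okC okU okD uC uU uD fC fU fD iv fits ext sub0 k tr =
    let (wc , hc) = wchoose LC (f C) (e C) qC M 1 2 (λ ()) okC uC qC≤
        (wu , hu) = wchoose LU (f U) (e U) qU M 3 4 (λ ()) okU uU qU≤
        (wd , hd) = wchoose LD (f D) (e D) qD M 5 6 (λ ()) okD uD qD≤
        C1 = ls (f C) (WComp.e' wc)
        U1 = ls (f U) (WComp.e' wu)
        D1 = ls (f D) (WComp.e' wd)
        Φ1 : Subst → Set
        Φ1 τ = ∀ θ1 → Eff C U D C1 U1 D1 θ1 → Φ (θ1 ⨾ τ)
        qCp : qC ≤ pC
        qCp = subst (qC ≤_) eqC (m≤m+n qC (suc t))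
        qUp : qU ≤ pU
        qUp = subst (qU ≤_) eqU (m≤m+n qU (suc t))
        qDp : qD ≤ pD
        qDp = subst (qD ≤_) eqD (m≤m+n qD (suc t))
        mC : WComp.e' wc ⊔ suc pC ≡ e C ⊔ suc pC
        mC = trans (cong (_⊔ suc pC) hc) (⊔-absorb-suc (e C) qC pC qCp)
        mU : WComp.e' wu ⊔ suc pU ≡ e U ⊔ suc pU
        mU = trans (cong (_⊔ suc pU) hu) (⊔-absorb-suc (e U) qU pU qUp)
        mD : WComp.e' wd ⊔ suc pD ≡ e D ⊔ suc pD
        mD = trans (cong (_⊔ suc pD) hd) (⊔-absorb-suc (e D) qD pD qDp)
        k1 : ∀ {U'} → U' ⊆O OldS (stamp (suc M) ib loU (WComp.e' wc) (WComp.e' wu) (WComp.e' wd)) →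
             Res U' (pqA C1 U1 D1 v (suc qC) (suc qU) (suc qD) ∷ rest C1 U1 D1 ds) Φ1
        k1 {U'} sub1 = pqWalk t {U'} {Φ1} {Φ'} (suc M) ib loU v C1 U1 D1 (suc qC) (suc qU) (suc qD) pC pU pD ds
          (trans (sym (+-suc qC t)) eqC) (trans (sym (+-suc qU t)) eqU) (trans (sym (+-suc qD t)) eqD)
          (WComp.q<e' wc) (WComp.q<e' wu) (WComp.q<e' wd) (≤-trans lo (WComp.e'≥ wu))
          okC okU okD
          (unf-mono LC (f C) (e C) _ (WComp.e'≥ wc) uC) (unf-mono LU (f U) (e U) _ (WComp.e'≥ wu) uU) (unf-mono LD (f D) (e D) _ (WComp.e'≥ wd) uD)
          fC fU fD iv
          (fits-mono C U D C1 U1 D1 ds (WComp.e'≥ wc) (WComp.e'≥ wu) (WComp.e'≥ wd) fits)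
          (λ τ τ' h φ θ1 ef → ext (θ1 ⨾ τ) (θ1 ⨾ τ') (λ x → sub-ext τ τ' (θ1 x) (λ y _ → h y)) (φ θ1 ef))
          sub1
          (Kont-tr (+-suc (suc t) M) mC mU mD k)
          (λ θ2 ef2 σ φ θ1 ef1 → ext ((θ1 ⨾ θ2) ⨾ σ) (θ1 ⨾ (θ2 ⨾ σ)) (⨾-assoc θ1 θ2 σ)
             (tr (θ1 ⨾ θ2) (Eff-comp C U D C1 U1 D1 _ _ _ θ1 θ2 (WComp.e'≥ wc) (WComp.e'≥ wu) (WComp.e'≥ wd) ef1
                               (subst₃ (λ a b c → Eff C1 U1 D1 (ls (upd (f C) pC v) a) (ls (upd (f U) pU v) b) (ls (upd (f D) pD v) c) θ2) mC mU mD ef2)) σ φ))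
    in walkStep M ib loU v C U D qC qU qD ds wc wu wd lo okC okU okD iv fits sub0 k1 (λ θ ef τ φ → φ θ ef)

  -- The derivation for the most general pqs atom in which queen j (1 ≤ j ≤ i)
  -- is placed after r j walks of clause 4.
  module Queens (i : ℕ) (r : ℕ → ℕ) where

    -- The cell receiving queen j in each list: column r j + 1, up diagonal
    -- j + r j and down diagonal (i - j) + 1 + r j, counted from the start of the
    -- lists as built by phase 1.
    psn : LI → ℕ → ℕ
    psn LC j = suc (r j)
    psn LU j = j + r j
    psn LD j = suc (i ∸ j) + r j

    -- The list states after placing queens 1,...,m; initially all cells are
    -- unfilled, the column list is empty from position 1 on and the diagonal
    -- lists have the i cells created by phase 1.
    fS : LI → ℕ → ℕ → Term
    fS X zero = λ q → var (Name (pos X q))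
    fS X (suc m) = upd (fS X m) (psn X (suc m)) (num (suc m))

    e0 : LI → ℕ
    e0 LC = 1
    e0 LU = i
    e0 LD = i

    eS : LI → ℕ → ℕ
    eS X zero = e0 X
    eS X (suc m) = eS X m ⊔ suc (psn X (suc m))

    S : LI → ℕ → LS
    S X m = ls (fS X m) (eS X m)

    desc : ℕ → Desc
    desc j = (num j , 1 , j , suc (i ∸ j))

    dsJ : ℕ → ℕ → List Desc
    dsJ m zero = []
    dsJ m (suc n) = desc (suc m) ∷ dsJ (suc m) n

    finalList : LI → Term
    finalList LC = LT LC (fS LC i) 1 (eS LC i ∸ 1)
    finalList LU = LT LU (fS LU i) i (eS LU i ∸ i)
    finalList LD = LT LD (fS LD i) 0 (eS LD i ∸ 0)

    Φ2 : ℕ → Subst → Set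
    Φ2 m θ = sub θ (LT LC (fS LC m) 1 (eS LC m ∸ 1)) ≡ finalList LC ×
             sub θ (LT LU (fS LU m) i (eS LU m ∸ i)) ≡ finalList LU ×
             sub θ (LT LD (fS LD m) 0 (eS LD m ∸ 0)) ≡ finalList LD

    Φ2-ext : ∀ m → Ext (Φ2 m)
    Φ2-ext m θ θ' h (a , b , c) =
      trans (sym (sub-ext θ θ' (LT LC (fS LC m) 1 (eS LC m ∸ 1)) (λ x _ → h x))) a ,
      trans (sym (sub-ext θ θ' (LT LU (fS LU m) i (eS LU m ∸ i)) (λ x _ → h x))) b ,
      trans (sym (sub-ext θ θ' (LT LD (fS LD m) 0 (eS LD m ∸ 0)) (λ x _ → h x))) c

    e-mono : ∀ X m → e0 X ≤ eS X m
    e-mono X zero = ≤-refl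
    e-mono X (suc m) = ≤-trans (e-mono X m) (m≤m⊔n _ _)

    cellOK : ∀ X m → CellOK X (fS X m)
    cellOK X zero q x here = inj₁ refl
    cellOK X (suc m) q x p with q ≟ psn X (suc m)
    ... | yes _ = ⊥-elim (num-ground (suc m) x p)
    ... | no _ = cellOK X m q x p

    unf : ∀ X m → Unf X (fS X m) (eS X m)
    unf X zero q _ = refl
    unf X (suc m) q le = trans (upd-miss (fS X m) (psn X (suc m)) (num (suc m)) q ne) (unf X m q (≤-trans (m≤m⊔n _ _) le))
      where
      ne : q ≢ psn X (suc m)
      ne refl = 1+n≰n (≤-trans (m≤n⊔m (eS X m) _) le)

    unfilled : ∀ X m q → (∀ j → 1 ≤ j → j ≤ m → psn X j ≢ q) → fS X m q ≡ var (Name (pos X q))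
    unfilled X zero q h = refl
    unfilled X (suc m) q h = trans (upd-miss (fS X m) (psn X (suc m)) (num (suc m)) q (λ e → h (suc m) (s≤s z≤n) ≤-refl (sym e)))
                                   (unfilled X m q (λ j a b → h j a (m≤n⇒m≤1+n b)))

    num-ik : ∀ n → IkT (num n)
    num-ik n x p = ⊥-elim (num-ground n x p)

    eS-ub : ∀ X m E → e0 X ≤ E → (∀ j → 1 ≤ j → j ≤ m → suc (psn X j) ≤ E) → eS X m ≤ E
    eS-ub X zero E h0 h = h0
    eS-ub X (suc m) E h0 h = ⊔-lub (eS-ub X m E h0 (λ j a b → h j a (m≤n⇒m≤1+n b))) (h (suc m) (s≤s z≤n) ≤-refl)

    eS-lb : ∀ X m j → 1 ≤ j → j ≤ m → suc (psn X j) ≤ eS X m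
    eS-lb X zero j a b with ≤-trans a b
    ... | ()
    eS-lb X (suc m) j a b with m≤n⇒m<n∨m≡n b
    ... | inj₂ refl = m≤n⊔m (eS X m) _
    ... | inj₁ (s≤s lt) = ≤-trans (eS-lb X m j a lt) (m≤m⊔n _ _)

    fitsJ : ∀ m' m n → m + n ≤ i → All (Fits (S LC m') (S LU m') (S LD m')) (dsJ m n)
    fitsJ m' m zero h = []
    fitsJ m' m (suc n) h = (num-ik (suc m) , e-mono LC m' , ≤-trans jle (e-mono LU m') , ≤-trans dle (e-mono LD m'))
                        ∷ fitsJ m' (suc m) n (subst (_≤ i) (+-suc m n) h)
      where
      jle : suc m ≤ i
      jle = ≤-trans (s≤s (m≤m+n m n)) (subst (_≤ i) (+-suc m n) h)
      dle : suc (i ∸ suc m) ≤ i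
      dle = subst (_≤ i) (+-∸-assoc 1 jle) (m∸n≤m i m)

    f0U : ℕ → Term
    f0U = fS LU 0
    f0D : ℕ → Term
    f0D = fS LD 0
    C0 : Var
    C0 = Name (tl LC 1)
    U0 : Var
    U0 = Name (tl LU i)

    Uarg : ℕ → Term
    Uarg r' = LT LU f0U (i ∸ r') r'

    atomP : ℕ → ℕ → Atom
    atomP r' d = atom pq (sucs (r' ∸ d) (var (Name (ik r')))) (var C0) (LT LU f0U (i ∸ d) d) (LT LD f0D (suc d) (r' ∸ suc d))

    pendL : ℕ → ℕ → List Atom
    pendL r' zero = []
    pendL r' (suc d) = atomP r' d ∷ pendL r' d

    goal : ℕ → List Atom
    goal r' = atom pqs (var (Name (ik r'))) (var C0) (Uarg r') (var (Name (tl LD r'))) ∷ pendL r' r'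

    Φ1 : ℕ → Subst → Set
    Φ1 r' θ = sub θ (sucs r' (var (Name (ik r')))) ≡ num i × θ C0 ≡ finalList LC × θ U0 ≡ finalList LU × sub θ (LT LD f0D 0 r') ≡ finalList LD

    Uvars : ∀ s n x → x ∈v LT LU f0U s n → (Σ ℕ λ q → x ≡ Name (pos LU q)) ⊎ (Σ ℕ λ q → x ≡ Name (tl LU q))
    Uvars s n x p with LT-vars LU f0U s n x p
    ... | inj₁ (q , _ , _ , here) = inj₁ (q , refl)
    ... | inj₂ e = inj₂ (_ , e)

    Dvars : ∀ s n x → x ∈v LT LD f0D s n → (Σ ℕ λ q → x ≡ Name (pos LD q)) ⊎ (Σ ℕ λ q → x ≡ Name (tl LD q))
    Dvars s n x p with LT-vars LD f0D s n x p
    ... | inj₁ (q , _ , _ , here) = inj₁ (q , refl)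
    ... | inj₂ e = inj₂ (_ , e)

    ik≢ : ∀ n → ik (suc n) ≢ ik n
    ik≢ n e = 1+n≢n (ik-inj e)

    iminus : ∀ r' → r' < i → suc (i ∸ suc r') ≡ i ∸ r'
    iminus r' lt = sym (+-∸-assoc 1 lt)

    -- The renaming of clause 2 in step M at stage r': the counter to ik (r'+1),
    -- Y and Ds to the new last cell and tail of D, Z to the new first cell of U,
    -- and the remaining variables to clause variables of step M.
    module UnfoldRenaming (r' M : ℕ) (lt : r' < i) where
      κ : ℕ → Kind
      κ 0 = ik (suc r')
      κ 1 = jk M 1
      κ 2 = jk M 2
      κ 3 = pos LD r'
      κ 4 = tl LD (suc r')
      κ 5 = pos LU (i ∸ suc r')
      κ 6 = jk M 6
      κ (suc (suc (suc (suc (suc (suc (suc x))))))) = jx (7 + x)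
      dec : Kind → ℕ
      dec (ik _) = 0
      dec (jk _ s) = s
      dec (pos LD _) = 3
      dec (tl LD _) = 4
      dec (pos LU _) = 5
      dec (jx x) = x
      dec _ = 0
      dec-ok : ∀ x → dec (κ x) ≡ x
      dec-ok 0 = refl
      dec-ok 1 = refl
      dec-ok 2 = refl
      dec-ok 3 = refl
      dec-ok 4 = refl
      dec-ok 5 = refl
      dec-ok 6 = refl
      dec-ok (suc (suc (suc (suc (suc (suc (suc x))))))) = refl
      st st' : Stamp
      st = stamp M r' (i ∸ r') 1 i r'
      st' = stamp (suc M) (suc r') (i ∸ suc r') 1 i (suc r')
      fresh : ∀ y → y < 7 → ¬ OldS st (κ y)
      fresh 0 _ o = 1+n≰n o
      fresh 1 _ o = <-irrefl refl o
      fresh 2 _ o = <-irrefl refl o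
      fresh 3 _ o = <-irrefl refl o
      fresh 4 _ o = 1+n≰n o
      fresh 5 _ (a , _) = 1+n≰n (≤-trans (≤-reflexive (iminus r' lt)) a)
      fresh 6 _ o = <-irrefl refl o
      fresh (suc (suc (suc (suc (suc (suc (suc y))))))) (s≤s (s≤s (s≤s (s≤s (s≤s (s≤s (s≤s ())))))))
      new : ∀ y → y < 7 → OldS st' (κ y)
      new 0 _ = ≤-refl
      new 1 _ = ≤-refl
      new 2 _ = ≤-refl
      new 3 _ = ≤-refl
      new 4 _ = ≤-refl
      new 5 _ = ≤-refl , ≤-trans (≤-reflexive (iminus r' lt)) (m∸n≤m i r')
      new 6 _ = ≤-refl
      new (suc (suc (suc (suc (suc (suc (suc y))))))) (s≤s (s≤s (s≤s (s≤s (s≤s (s≤s (s≤s ())))))))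
      mono : ∀ k → OldS st k → OldS st' k
      mono = oldMono st st' (n≤1+n M) (n≤1+n r') (∸-monoʳ-≤ i (n≤1+n r')) ≤-refl ≤-refl (n≤1+n r')

    step2 : ∀ r' {Uv} M → r' < i → Uv ⊆O OldS (stamp M r' (i ∸ r') 1 i r') →
            (∀ {U'} → U' ⊆O OldS (stamp (suc M) (suc r') (i ∸ suc r') 1 i (suc r')) → Res U' (goal (suc r')) (Φ1 (suc r'))) →
            Res Uv (goal r') (Φ1 r')
    step2 r' {Uv} M lt sub0 k =
      stepL A (pendL r' r') clause₂ (there (here refl)) κ dec dec-ok θ (goal (suc r')) sub0 fresh new mono
        (mguL A H bs uni mgs) (relL A H bs rls) eqG k tr
      where
      Ir = Name (ik r')
      I' = Name (ik (suc r'))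
      Cs = Name (jk M 1)
      Us = Name (jk M 2)
      Y = Name (pos LD r')
      Ds = Name (tl LD (suc r'))
      Z = Name (pos LU (i ∸ suc r'))
      TD = Name (tl LD r')
      bs : Bind
      bs = (Ir , suc' (var I')) ∷ (Cs , var C0) ∷ (Us , Uarg r') ∷ (TD , cons (var Y) (var Ds)) ∷ []
      θ = look bs
      open UnfoldRenaming r' M lt
      A = atom pqs (var Ir) (var C0) (Uarg r') (var TD)
      H = head (renC (λ x → Name (κ x)) clause₂)
      nd4 : ∀ k → k ≢ ik r' → k ≢ jk M 1 → k ≢ jk M 2 → k ≢ tl LD r' → NotDom (Name k) bs
      nd4 k a b c d = nk a ∷ nk b ∷ nk c ∷ nk d ∷ []
      θI' : θ I' ≡ var I'
      θI' = look-notdom I' bs (nd4 _ (ik≢ r') (λ ()) (λ ()) (λ ()))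
      θC0 : θ C0 ≡ var C0
      θC0 = look-notdom C0 bs (nd4 _ (λ ()) (λ ()) (λ ()) (λ ()))
      θU0 : θ U0 ≡ var U0
      θU0 = look-notdom U0 bs (nd4 _ (λ ()) (λ ()) (λ ()) (λ ()))
      θY : θ Y ≡ var Y
      θY = look-notdom Y bs (nd4 _ (λ ()) (λ ()) (λ ()) (λ ()))
      θDs : θ Ds ≡ var Ds
      θDs = look-notdom Ds bs (nd4 _ (λ ()) (λ ()) (λ ()) (λ e → 1+n≢n (tlinj e)))
        where
        tlinj : ∀ {a b} → tl LD a ≡ tl LD b → a ≡ b
        tlinj refl = refl
      θZ : θ Z ≡ var Z
      θZ = look-notdom Z bs (nd4 _ (λ ()) (λ ()) (λ ()) (λ ()))
      θIr : θ Ir ≡ suc' (var I')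
      θIr = lkh (ik r') _ _
      θCs : θ Cs ≡ var C0
      θCs = trans (lkm {jk M 1} {ik r'} _ _ (λ ())) (lkh (jk M 1) _ _)
      θUs : θ Us ≡ Uarg r'
      θUs = trans (lkm {jk M 2} {ik r'} _ _ (λ ())) (trans (lkm {jk M 2} {jk M 1} _ _ (λ ())) (lkh (jk M 2) _ _))
      θTD : θ TD ≡ cons (var Y) (var Ds)
      θTD = trans (lkm {tl LD r'} {ik r'} _ _ (λ ())) (trans (lkm {tl LD r'} {jk M 1} _ _ (λ ())) (trans (lkm {tl LD r'} {jk M 2} _ _ (λ ())) (lkh (tl LD r') _ _)))
      Ufix : ∀ s n → sub θ (LT LU f0U s n) ≡ LT LU f0U s n
      Ufix s n = sub-fix θ _ (λ x p → fu x (Uvars s n x p))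
        where
        fu : ∀ x → (Σ ℕ λ q → x ≡ Name (pos LU q)) ⊎ (Σ ℕ λ q → x ≡ Name (tl LU q)) → θ x ≡ var x
        fu x (inj₁ (q , refl)) = look-notdom _ bs (nd4 _ (λ ()) (λ ()) (λ ()) (λ ()))
        fu x (inj₂ (q , refl)) = look-notdom _ bs (nd4 _ (λ ()) (λ ()) (λ ()) (λ ()))
      Dext : ∀ s n → s + n ≡ r' → sub θ (LT LD f0D s n) ≡ LT LD f0D s (n + 1)
      Dext s n e = LT-sub θ LD f0D f0D s n 1 (λ q _ _ → look-notdom _ bs (nd4 _ (λ ()) (λ ()) (λ ()) (λ ())))
                     (subst (λ z → θ (Name (tl LD z)) ≡ LT LD f0D z 1) (sym e) θTD)
      uni : Unifier θ A H
      uni = atomEq (trans θIr (cong suc' (sym θI'))) (trans θC0 (sym θCs)) (trans (Ufix _ _) (sym θUs))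
                   (trans θTD (sym (cong₂ cons θY θDs)))
      MP = λ x t → ∀ σ → Unifier σ A H → σ x ≡ sub σ t
      mgs : BP MP bs
      mgs = (λ σ u → arg1 u) ∷ (λ σ u → sym (arg2 u)) ∷ (λ σ u → sym (arg3 u)) ∷ (λ σ u → arg4 u) ∷ []
      RP = λ x t → (x ∈vA A ⊎ x ∈vA H) × (∀ y → y ∈v t → y ∈vA A ⊎ y ∈vA H)
      rls : BP RP bs
      rls = (inj₁ (inj₁ here) , λ { y (inS here) → inj₂ (inj₁ (inS here)) })
          ∷ (inj₂ (inj₂ (inj₁ here)) , λ { y here → inj₁ (inj₂ (inj₁ here)) })
          ∷ (inj₂ (inj₂ (inj₂ (inj₁ here))) , λ y p → inj₁ (inj₂ (inj₂ (inj₁ p))))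
          ∷ (inj₁ (inj₂ (inj₂ (inj₂ here))) , λ y p → inj₂ (inj₂ (inj₂ (inj₂ p))))
          ∷ []
      pendEq : ∀ d → d ≤ r' → map (subA θ) (pendL r' d) ≡ pendL (suc r') d
      pendEq zero _ = refl
      pendEq (suc d) le = cong₂ _∷_ (atomEq e1 θC0 (Ufix _ _) e4) (pendEq d (≤-trans (n≤1+n d) le))
        where
        e1 : sub θ (sucs (r' ∸ d) (var Ir)) ≡ sucs (suc r' ∸ d) (var I')
        e1 = trans (sucs-sub θ (r' ∸ d) (var Ir)) (trans (cong (sucs (r' ∸ d)) (trans θIr (cong suc' refl)))
               (trans (sucs-suc (r' ∸ d) (var I')) (cong (λ z → sucs z (var I')) (sym (+-∸-assoc 1 (≤-trans (n≤1+n d) le))))))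
        e4 : sub θ (LT LD f0D (suc d) (r' ∸ suc d)) ≡ LT LD f0D (suc d) (suc r' ∸ suc d)
        e4 = trans (Dext (suc d) (r' ∸ suc d) (m+[n∸m]≡n le)) (cong (LT LD f0D (suc d)) (trans (+-comm (r' ∸ suc d) 1) (sym (+-∸-assoc 1 le))))
      Uarg-s : cons (var Z) (Uarg r') ≡ Uarg (suc r')
      Uarg-s = cong (λ z → cons (var Z) (LT LU f0U z r')) (sym (iminus r' lt))
      eqG : map (subA θ) (body (renC (λ x → Name (κ x)) clause₂) ++ pendL r' r') ≡ goal (suc r')
      eqG = cong₂ _∷_ (atomEq θI' θCs (trans (cong₂ cons θZ θUs) Uarg-s) θDs)
              (cong₂ _∷_ (atomEq (trans (cong suc' θI') (cong (λ z → sucs z (var I')) (sym (m+n∸n≡m 1 r'))))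
                                 θCs θUs
                                 (trans θDs (cong (LT LD f0D (suc r')) (sym (n∸n≡0 r')))))
                          (pendEq r' ≤-refl))
      tr : ∀ σ → Φ1 (suc r') σ → Φ1 r' (θ ⨾ σ)
      tr σ (a , b , c , d) =
          trans (sym (sub-comp θ σ (sucs r' (var Ir))))
            (trans (cong (sub σ) (trans (sucs-sub θ r' (var Ir)) (trans (cong (sucs r') θIr) (sucs-suc r' (var I'))))) a)
        , trans (cong (sub σ) θC0) b
        , trans (cong (sub σ) θU0) c
        , trans (sym (sub-comp θ σ (LT LD f0D 0 r')))
            (trans (cong (sub σ) (trans (Dext 0 r' refl) (cong (LT LD f0D 0) (+-comm r' 1)))) d)

    module Main (injX : ∀ X j j' → 1 ≤ j → j < j' → j' ≤ i → psn X j ≢ psn X j') where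

      fS-hit : ∀ X m j → 1 ≤ j → j ≤ m → m ≤ i → fS X m (psn X j) ≡ num j
      fS-hit X zero j a b mi with ≤-trans a b
      ... | ()
      fS-hit X (suc m) j a b mi with m≤n⇒m<n∨m≡n b
      ... | inj₂ refl = upd-hit (fS X m) (psn X (suc m)) (num (suc m))
      ... | inj₁ (s≤s lt) = trans (upd-miss (fS X m) (psn X (suc m)) (num (suc m)) (psn X j) (injX X j (suc m) a (s≤s lt) mi))
                                  (fS-hit X m j a lt (≤-trans (n≤1+n m) mi))

      phase2 : ∀ n m → m + n ≡ i → ∀ {Uv} M → Uv ⊆O OldS (stamp M i 0 (eS LC m) (eS LU m) (eS LD m)) →
               Res Uv (rest (S LC m) (S LU m) (S LD m) (dsJ m n)) (Φ2 m)
      phase2 zero m eq {Uv} M sub0 with trans (sym (+-identityʳ m)) eq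
      ... | refl = var , done , sub-id _ , sub-id _ , sub-id _
      phase2 (suc n) m eq {Uv} M sub0 =
        pqWalk (r j) {Uv} {Φ2 m} {Φ2 (suc m)} M i 0 (num j) (S LC m) (S LU m) (S LD m) 1 j (suc (i ∸ j))
          (psn LC j) (psn LU j) (psn LD j) (dsJ (suc m) n) refl refl refl
          (e-mono LC m) (≤-trans jle (e-mono LU m)) (≤-trans dle (e-mono LD m)) z≤n
          (cellOK LC m) (cellOK LU m) (cellOK LD m) (unf LC m) (unf LU m) (unf LD m)
          (unfilled LC m (psn LC j) (λ j' a b → injX LC j' j a (s≤s b) jle))
          (unfilled LU m (psn LU j) (λ j' a b → injX LU j' j a (s≤s b) jle))
          (unfilled LD m (psn LD j) (λ j' a b → injX LD j' j a (s≤s b) jle))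
          (num-ik j) (fitsJ m (suc m) n (≤-reflexive (trans (sym (+-suc m n)) eq))) (Φ2-ext m) sub0
          (λ sub1 → phase2 n (suc m) (trans (sym (+-suc m n)) eq) (suc (r j) + M) sub1)
          (λ θ (ea , eb , ec , ed) σ (a , b , c) →
               trans (sym (sub-comp θ σ (LT LC (fS LC m) 1 (eS LC m ∸ 1)))) (trans (cong (sub σ) (ea 1 (e-mono LC m))) a)
             , trans (sym (sub-comp θ σ (LT LU (fS LU m) i (eS LU m ∸ i)))) (trans (cong (sub σ) (eb i (e-mono LU m))) b)
             , trans (sym (sub-comp θ σ (LT LD (fS LD m) 0 (eS LD m ∸ 0)))) (trans (cong (sub σ) (ec 0 z≤n)) c))
        where
        j = suc m
        jle : j ≤ i
        jle = subst (suc m ≤_) eq (subst (suc m ≤_) (sym (+-suc m n)) (s≤s (m≤m+n m n)))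
        dle : suc (i ∸ j) ≤ i
        dle = subst (_≤ i) (+-∸-assoc 1 jle) (m∸n≤m i m)

      step1 : ∀ {Uv} M → Uv ⊆O OldS (stamp M i (i ∸ i) 1 i i) → Res Uv (goal i) (Φ1 i)
      step1 {Uv} M sub0 =
        stepL A (pendL i i) clause₁ (here refl) κ dec dec-ok θ G' sub0 fresh new mono
          (mguL A H bs uni mgs) (relL A H bs rls) eqG (λ sub1 → phase2 i 0 refl (suc M) sub1) tr
        where
        Ii = Name (ik i)
        TD = Name (tl LD i)
        X : ℕ → Var
        X n = Name (jk M n)
        bs : Bind
        bs = (Ii , zro) ∷ (X 0 , var C0) ∷ (X 1 , Uarg i) ∷ (X 2 , var TD) ∷ []
        θ = look bs
        κ : ℕ → Kind
        κ x = jk M x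
        dec : Kind → ℕ
        dec (jk _ s) = s
        dec _ = 0
        dec-ok : ∀ x → dec (κ x) ≡ x
        dec-ok x = refl
        st = stamp M i (i ∸ i) 1 i i
        st' = stamp (suc M) i 0 1 i i
        fresh : ∀ y → y < 7 → ¬ OldS st (κ y)
        fresh y _ o = <-irrefl refl o
        new : ∀ y → y < 7 → OldS st' (κ y)
        new y _ = ≤-refl
        mono : ∀ k → OldS st k → OldS st' k
        mono = oldMono st st' (n≤1+n M) ≤-refl z≤n ≤-refl ≤-refl ≤-refl
        A = atom pqs (var Ii) (var C0) (Uarg i) (var TD)
        H = head (renC (λ x → Name (κ x)) clause₁)
        nd4 : ∀ k → k ≢ ik i → k ≢ jk M 0 → k ≢ jk M 1 → k ≢ jk M 2 → NotDom (Name k) bs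
        nd4 k a b c d = nk a ∷ nk b ∷ nk c ∷ nk d ∷ []
        θC0 : θ C0 ≡ var C0
        θC0 = look-notdom C0 bs (nd4 _ (λ ()) (λ ()) (λ ()) (λ ()))
        θU0 : θ U0 ≡ var U0
        θU0 = look-notdom U0 bs (nd4 _ (λ ()) (λ ()) (λ ()) (λ ()))
        θTD : θ TD ≡ var TD
        θTD = look-notdom TD bs (nd4 _ (λ ()) (λ ()) (λ ()) (λ ()))
        θIi : θ Ii ≡ zro
        θIi = lkh (ik i) _ _
        θX0 : θ (X 0) ≡ var C0
        θX0 = trans (lkm {jk M 0} {ik i} _ _ (λ ())) (lkh (jk M 0) _ _)
        θX1 : θ (X 1) ≡ Uarg i
        θX1 = trans (lkm {jk M 1} {ik i} _ _ (λ ())) (trans (lkm {jk M 1} {jk M 0} _ _ (λ ())) (lkh (jk M 1) _ _))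
        θX2 : θ (X 2) ≡ var TD
        θX2 = trans (lkm {jk M 2} {ik i} _ _ (λ ())) (trans (lkm {jk M 2} {jk M 0} _ _ (λ ())) (trans (lkm {jk M 2} {jk M 1} _ _ (λ ())) (lkh (jk M 2) _ _)))
        Ufix : ∀ s n → sub θ (LT LU f0U s n) ≡ LT LU f0U s n
        Ufix s n = sub-fix θ _ (λ x p → fu x (Uvars s n x p))
          where
          fu : ∀ x → (Σ ℕ λ q → x ≡ Name (pos LU q)) ⊎ (Σ ℕ λ q → x ≡ Name (tl LU q)) → θ x ≡ var x
          fu x (inj₁ (q , refl)) = look-notdom _ bs (nd4 _ (λ ()) (λ ()) (λ ()) (λ ()))
          fu x (inj₂ (q , refl)) = look-notdom _ bs (nd4 _ (λ ()) (λ ()) (λ ()) (λ ()))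
        Dfix : ∀ s n → sub θ (LT LD f0D s n) ≡ LT LD f0D s n
        Dfix s n = sub-fix θ _ (λ x p → fd x (Dvars s n x p))
          where
          fd : ∀ x → (Σ ℕ λ q → x ≡ Name (pos LD q)) ⊎ (Σ ℕ λ q → x ≡ Name (tl LD q)) → θ x ≡ var x
          fd x (inj₁ (q , refl)) = look-notdom _ bs (nd4 _ (λ ()) (λ ()) (λ ()) (λ ()))
          fd x (inj₂ (q , refl)) = look-notdom _ bs (nd4 _ (λ ()) (λ ()) (λ ()) (λ ()))
        uni : Unifier θ A H
        uni = atomEq θIi (trans θC0 (sym θX0)) (trans (Ufix _ _) (sym θX1)) (trans θTD (sym θX2))
        MP = λ x t → ∀ σ → Unifier σ A H → σ x ≡ sub σ t
        mgs : BP MP bs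
        mgs = (λ σ u → arg1 u) ∷ (λ σ u → sym (arg2 u)) ∷ (λ σ u → sym (arg3 u)) ∷ (λ σ u → sym (arg4 u)) ∷ []
        RP = λ x t → (x ∈vA A ⊎ x ∈vA H) × (∀ y → y ∈v t → y ∈vA A ⊎ y ∈vA H)
        rls : BP RP bs
        rls = (inj₁ (inj₁ here) , λ y ())
            ∷ (inj₂ (inj₂ (inj₁ here)) , λ { y here → inj₁ (inj₂ (inj₁ here)) })
            ∷ (inj₂ (inj₂ (inj₂ (inj₁ here))) , λ y p → inj₁ (inj₂ (inj₂ (inj₁ p))))
            ∷ (inj₂ (inj₂ (inj₂ (inj₂ here))) , λ { y here → inj₁ (inj₂ (inj₂ (inj₂ here))) })
            ∷ []
        S0C = S LC 0
        S0U = S LU 0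
        S0D = S LD 0
        atomConv : ∀ d j → d < i → j ≡ i ∸ d → subA θ (atomP i d) ≡ pqA S0C S0U S0D (num j) 1 j (suc (i ∸ j))
        atomConv d j lt refl = atomEq
          (trans (sucs-sub θ (i ∸ d) (var Ii)) (trans (cong (sucs (i ∸ d)) θIi) (sucs-zro (i ∸ d))))
          θC0
          (trans (Ufix _ _) (cong (LT LU f0U (i ∸ d)) (sym idd)))
          (trans (Dfix _ _) (cong₂ (λ a b → LT LD f0D a b) (cong suc (sym idd)) (cong (λ z → i ∸ suc z) (sym idd))))
          where
          idd : i ∸ (i ∸ d) ≡ d
          idd = m∸[m∸n]≡n (<⇒≤ lt)
        pendConv : ∀ k → k ≤ i → map (subA θ) (pendL i k) ≡ rest S0C S0U S0D (dsJ (i ∸ k) k)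
        pendConv zero _ = refl
        pendConv (suc d) le = cong₂ _∷_ (atomConv d (suc (i ∸ suc d)) le (iminus d le))
                                        (trans (pendConv d (≤-trans (n≤1+n d) le)) (cong (λ z → rest S0C S0U S0D (dsJ z d)) (sym (iminus d le))))
        G' = rest S0C S0U S0D (dsJ 0 i)
        eqG : map (subA θ) (body (renC (λ x → Name (κ x)) clause₁) ++ pendL i i) ≡ G'
        eqG = trans (pendConv i ≤-refl) (cong (λ z → rest S0C S0U S0D (dsJ z i)) (n∸n≡0 i))
        tr : ∀ σ → Φ2 0 σ → Φ1 i (θ ⨾ σ)
        tr σ (a , b , c) =
            trans (sym (sub-comp θ σ (sucs i (var Ii))))
              (trans (cong (sub σ) (trans (sucs-sub θ i (var Ii)) (trans (cong (sucs i) θIi) (sucs-zro i)))) (sub-num σ i))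
          , trans (cong (sub σ) θC0) a
          , trans (cong (sub σ) θU0) (trans (cong (λ z → sub σ (LT LU f0U i z)) (sym (n∸n≡0 i))) b)
          , trans (sym (sub-comp θ σ (LT LD f0D 0 i))) (trans (cong (sub σ) (Dfix 0 i)) c)

      phase1 : ∀ n r' → r' + n ≡ i → ∀ {Uv} M → Uv ⊆O OldS (stamp M r' (i ∸ r') 1 i r') → Res Uv (goal r') (Φ1 r')
      phase1 zero r' eq M sub0 with trans (sym (+-identityʳ r')) eq
      ... | refl = step1 M sub0
      phase1 (suc n) r' eq M sub0 = step2 r' M lt sub0 (λ sub1 → phase1 n (suc r') (trans (sym (+-suc r' n)) eq) (suc M) sub1)
        where
        lt : r' < i
        lt = subst (r' <_) eq (subst (r' <_) (sym (+-suc r' n)) (s≤s (m≤m+n r' n)))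

      pqsO : O NQUEENS (atom pqs (num i) (finalList LC) (finalList LU) (finalList LD))
      pqsO = pqs , I0 , C0 , U0 , D0 , uniq , θ , d , sym (atomEq a b c e4)
        where
        I0 = Name (ik 0)
        D0 = Name (tl LD 0)
        Q = atom pqs (var I0) (var C0) (var U0) (var D0)
        uniq = (nk (λ ()) ∷ nk (λ ()) ∷ nk (λ ()) ∷ []) ∷ (nk (λ ()) ∷ nk (λ ()) ∷ []) ∷ (nk (λ ()) ∷ []) ∷ [] ∷ []
        sub0 : (λ x → x ∈vA Q) ⊆O OldS (stamp 0 0 (i ∸ 0) 1 i 0)
        sub0 x (inj₁ here) = ik 0 , refl , z≤n
        sub0 x (inj₂ (inj₁ here)) = tl LC 1 , refl , ≤-refl
        sub0 x (inj₂ (inj₂ (inj₁ here))) = tl LU i , refl , ≤-refl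
        sub0 x (inj₂ (inj₂ (inj₂ here))) = tl LD 0 , refl , z≤n
        res = phase1 i 0 refl {λ x → x ∈vA Q} 0 sub0
        θ = proj₁ res
        d = proj₁ (proj₂ res)
        a = proj₁ (proj₂ (proj₂ res))
        b = proj₁ (proj₂ (proj₂ (proj₂ res)))
        c = proj₁ (proj₂ (proj₂ (proj₂ (proj₂ res))))
        e4 = proj₂ (proj₂ (proj₂ (proj₂ (proj₂ res))))

module Diagonals where
  open ℤ using (+_; _⊖_)

  up≡ : ∀ k j i → i ≤ k + j → updiag k j i ≡ + (k + j ∸ i)
  up≡ k j i le = trans (cong (ℤ._- + i) (sym (ℤP.pos-+ k j))) (trans (ℤP.[+m]-[+n]≡m⊖n (k + j) i) (ℤP.⊖-≥ le))

  dn≡ : ∀ k j i → j ≤ k + i → downdiag k j i ≡ + (k + i ∸ j)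
  dn≡ k j i le = trans (cong (ℤ._- + j) (sym (ℤP.pos-+ k i))) (trans (ℤP.[+m]-[+n]≡m⊖n (k + i) j) (ℤP.⊖-≥ le))

  up-pos : ∀ k j i → ℤ.0ℤ ℤ.< updiag k j i → i < k + j
  up-pos k j i lt with i ℕ.<? k + j
  ... | yes p = p
  ... | no np = ⊥-elim (bad (subst (ℤ.0ℤ ℤ.<_) e lt))
    where
    le : k + j ≤ i
    le = ≮⇒≥ np
    e : updiag k j i ≡ ℤ.- (+ (i ∸ (k + j)))
    e = trans (cong (ℤ._- + i) (sym (ℤP.pos-+ k j))) (trans (ℤP.[+m]-[+n]≡m⊖n (k + j) i) (ℤP.⊖-≤ le))
    bad : ∀ {n} → ¬ (ℤ.0ℤ ℤ.< ℤ.- (+ n))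
    bad {zero} (ℤ.+<+ ())
    bad {suc n} ()

  up0≡ : ∀ k j k' j' → k + j ≡ k' + j' → updiag k j 0 ≡ updiag k' j' 0
  up0≡ k j k' j' e = cong (λ z → z ℤ.- + 0) (trans (sym (ℤP.pos-+ k j)) (trans (cong +_ e) (ℤP.pos-+ k' j')))

  dn0≡ : ∀ i k j k' j' → j ≤ i → j' ≤ i → (i ∸ j) + k ≡ (i ∸ j') + k' → downdiag k j 0 ≡ downdiag k' j' 0
  dn0≡ i k j k' j' ji j'i e = trans (f k j ji) (trans (cong (_⊖ i) e) (sym (f k' j' j'i)))
    where
    f : ∀ k j → j ≤ i → downdiag k j 0 ≡ ((i ∸ j) + k) ⊖ i
    f k j ji = trans (cong (λ z → z ℤ.- + j) (sym (ℤP.pos-+ k 0)))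
               (trans (cong (λ z → + z ℤ.- + j) (+-identityʳ k))
               (trans (ℤP.[+m]-[+n]≡m⊖n k j)
               (trans (sym (ℤP.+-cancelˡ-⊖ (i ∸ j) k j)) (cong (((i ∸ j) + k) ⊖_) (m∸n+n≡m ji)))))

open Diagonals

-- For pqs(i, cs, us, [w|ds]) the queens are placed
-- as given by cs: queen j, the kpos j-th member of cs, is reached after
-- r j = kpos j - 1 walks.  The naming sends the cell and tail kinds of the
-- three lists to the variable members and tails of cs, us and [w|ds]; the
-- correctness conditions guarantee that this naming is injective and that
-- the final lists of the derivation are exactly cs, us and [w|ds].
module S0pqsCase (i : ℕ) (cs us ds : Term) (w : Var)
  (i>0 : 0 < i)
  (wc : ¬ (w ∈v cs)) (wu : ¬ (w ∈v us)) (wd : ¬ (w ∈v ds))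
  (cor : CorrectUpTo i cs)
  (pc : PairCorrect i i cs us ds)
  (dcu : VarDisjoint cs us) (dcd : VarDisjoint cs ds) (dud : VarDisjoint us ds)
  (sc : ShortGVD cs) (su : ShortGVD us) (sd : ShortGVD ds)
  (gu : GroundMembersIn us i) (gd : GroundMembersIn ds i)
  (upos : UpPositive i cs us) where

  linC : Linear cs
  linC = proj₁ (proj₁ cor)
  olC : OpenList cs
  olC = proj₁ (proj₂ (proj₁ cor))
  distC : Distinct cs
  distC = proj₁ (proj₂ (proj₂ (proj₁ cor)))
  gvC : GroundOrVar cs
  gvC = proj₂ (proj₂ (proj₂ (proj₁ cor)))

  groundC : GroundMembersIn cs i
  groundC = proj₁ (proj₂ cor)
  queenC : ∀ j → 1 ≤ j → j ≤ i → Σ ℕ λ k → Kth k (num j) cs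
  queenC = proj₁ (proj₂ (proj₂ cor))
  diagC : ∀ j₁ j₂ k₁ k₂ → Kth k₁ (num j₁) cs → Kth k₂ (num j₂) cs → j₁ ≢ j₂ →
          updiag k₁ j₁ 0 ≢ updiag k₂ j₂ 0 × downdiag k₁ j₁ 0 ≢ downdiag k₂ j₂ 0
  diagC = proj₂ (proj₂ (proj₂ cor))

  linU : Linear us
  linU = proj₁ (proj₁ su)
  olU : OpenList us
  olU = proj₁ (proj₂ (proj₁ su))
  distU : Distinct us
  distU = proj₁ (proj₂ (proj₂ (proj₁ su)))
  gvU : GroundOrVar us
  gvU = proj₂ (proj₂ (proj₂ (proj₁ su)))

  linD : Linear ds
  linD = proj₁ (proj₁ sd)
  olD : OpenList ds
  olD = proj₁ (proj₂ (proj₁ sd))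
  distD : Distinct ds
  distD = proj₁ (proj₂ (proj₂ (proj₁ sd)))
  gvD : GroundOrVar ds
  gvD = proj₂ (proj₂ (proj₂ (proj₁ sd)))

  kpos : ℕ → ℕ
  kpos j with 1 ≤? j | j ≤? i
  ... | yes a | yes b = proj₁ (queenC j a b)
  ... | _ | _ = 1

  kpos-ok : ∀ j → 1 ≤ j → j ≤ i → Kth (kpos j) (num j) cs
  kpos-ok j a b with 1 ≤? j | j ≤? i
  ... | yes a' | yes b' = proj₂ (queenC j a' b')
  ... | no na | _ = ⊥-elim (na a)
  ... | yes _ | no nb = ⊥-elim (nb b)

  kpos≥1 : ∀ j → 1 ≤ j → j ≤ i → 1 ≤ kpos j
  kpos≥1 j a b = Kth-pos (kpos-ok j a b)

  kpos-uniq : ∀ j p → 1 ≤ j → j ≤ i → Kth p (num j) cs → p ≡ kpos j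
  kpos-uniq j p a b q = distC p (kpos j) (num j) q (kpos-ok j a b)

  -- The number of walks for queen j; pC, pU, pD coincide with psn of Queens.
  r : ℕ → ℕ
  r j = kpos j ∸ 1

  sr : ∀ j → 1 ≤ j → j ≤ i → suc (r j) ≡ kpos j
  sr j a b = trans (sym (+-∸-assoc 1 (kpos≥1 j a b))) refl

  pC : ℕ → ℕ
  pC j = suc (r j)
  pU : ℕ → ℕ
  pU j = j + r j
  pD : ℕ → ℕ
  pD j = suc (i ∸ j) + r j

  pD≡ : ∀ j → 1 ≤ j → j ≤ i → pD j ≡ kpos j + i ∸ j
  pD≡ j a b = trans (sym (+-suc (i ∸ j) (r j))) (trans (cong (λ z → (i ∸ j) + z) (sr j a b)) (trans (+-comm (i ∸ j) (kpos j)) (sym (+-∸-assoc (kpos j) b))))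

  spU≡ : ∀ j → 1 ≤ j → j ≤ i → suc (pU j) ≡ kpos j + j
  spU≡ j a b = trans (sym (+-suc j (r j))) (trans (cong (λ z → j + z) (sr j a b)) (+-comm j (kpos j)))

  -- Distinct queens occupy distinct cells: for the columns since cs has
  -- distinct members, for the diagonals since cs is correct.
  injC : ∀ j j' → 1 ≤ j → j < j' → j' ≤ i → pC j ≢ pC j'
  injC j j' a lt b e = <-irrefl (num-inj (Kth-fun (kpos-ok j a jle) (subst (λ z → Kth z (num j') cs) (sym e2) (kpos-ok j' a' b)))) lt
    where
    jle = ≤-trans (n≤1+n j) (≤-trans lt b)
    a' = ≤-trans (≤-trans a (n≤1+n j)) lt
    e2 : kpos j ≡ kpos j'
    e2 = trans (sym (sr j a jle)) (trans e (sr j' a' b))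

  injU : ∀ j j' → 1 ≤ j → j < j' → j' ≤ i → pU j ≢ pU j'
  injU j j' a lt b e = proj₁ (diagC j j' (kpos j) (kpos j') (kpos-ok j a jle) (kpos-ok j' a' b) (λ ee → <-irrefl ee lt))
                         (up0≡ (kpos j) j (kpos j') j' (trans (sym (spU≡ j a jle)) (trans (cong suc e) (spU≡ j' a' b))))
    where
    jle = ≤-trans (n≤1+n j) (≤-trans lt b)
    a' = ≤-trans (≤-trans a (n≤1+n j)) lt

  injD : ∀ j j' → 1 ≤ j → j < j' → j' ≤ i → pD j ≢ pD j'
  injD j j' a lt b e = proj₂ (diagC j j' (kpos j) (kpos j') (kpos-ok j a jle) (kpos-ok j' a' b) (λ ee → <-irrefl ee lt))
                         (dn0≡ i (kpos j) j (kpos j') j' jle b e')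
    where
    jle = ≤-trans (n≤1+n j) (≤-trans lt b)
    a' = ≤-trans (≤-trans a (n≤1+n j)) lt
    e' : (i ∸ j) + kpos j ≡ (i ∸ j') + kpos j'
    e' = trans (cong (λ z → (i ∸ j) + z) (sym (sr j a jle))) (trans (+-suc (i ∸ j) (r j)) (trans e (trans (sym (+-suc (i ∸ j') (r j'))) (cong (λ z → (i ∸ j') + z) (sr j' a' b)))))

  posU : ∀ j → 1 ≤ j → j ≤ i → i < kpos j + j → Kth (kpos j + j ∸ i) (num j) us
  posU j a b lt = proj₁ (proj₂ (pc j a b)) (kpos j) (kpos j + j ∸ i) (kpos-ok j a b) (m<n⇒0<n∸m lt) (sym (up≡ (kpos j) j i (<⇒≤ lt)))

  posD : ∀ j → 1 ≤ j → j ≤ i → Kth (kpos j + i ∸ j) (num j) ds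
  posD j a b = proj₂ (proj₂ (pc j a b)) (kpos j) (kpos j + i ∸ j) (kpos-ok j a b) ps (sym (dn≡ (kpos j) j i jle))
    where
    jle : j ≤ kpos j + i
    jle = ≤-trans b (m≤n+m i (kpos j))
    ps : 0 < kpos j + i ∸ j
    ps = subst (0 <_) (sym (+-∸-assoc (kpos j) b)) (≤-trans (kpos≥1 j a b) (m≤m+n (kpos j) (i ∸ j)))

  gC : ∀ p s → Kth p s cs → Ground s → Σ ℕ λ j → s ≡ num j × 1 ≤ j × j ≤ i × p ≡ kpos j
  gC p s q g with groundC p s q g
  ... | j , refl , a , b = j , refl , a , b , kpos-uniq j p a b q

  gU : ∀ p s → Kth p s us → Ground s → Σ ℕ λ j → s ≡ num j × 1 ≤ j × j ≤ i × i < kpos j + j × p ≡ kpos j + j ∸ i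
  gU p s q g with gu p s q g
  ... | j , refl , a , b with upos p (num j) q g j refl
  ...   | k' , q' , lt = j , refl , a , b , lt' , distU p _ (num j) q (posU j a b lt')
    where
    lt' : i < kpos j + j
    lt' = subst (λ z → i < z + j) (kpos-uniq j k' a b q') (up-pos k' j i lt)

  gD : ∀ p s → Kth p s ds → Ground s → Σ ℕ λ j → s ≡ num j × 1 ≤ j × j ≤ i × p ≡ kpos j + i ∸ j
  gD p s q g with gd p s q g
  ... | j , refl , a , b = j , refl , a , b , distD p _ (num j) q (posD j a b)

  tgt : Kind → Maybe Var
  tgt (pos LC p) = isVar (nth p cs)
  tgt (tl LC q) with q ≟ suc (len cs)
  ... | yes _ = just (tailv cs)
  ... | no _ = nothing
  tgt (pos LU q) with i ≤? q
  ... | yes _ = isVar (nth (suc q ∸ i) us)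
  ... | no _ = nothing
  tgt (tl LU q) with q ≟ i + len us
  ... | yes _ = just (tailv us)
  ... | no _ = nothing
  tgt (pos LD zero) = just w
  tgt (pos LD (suc p)) = isVar (nth (suc p) ds)
  tgt (tl LD q) with q ≟ suc (len ds)
  ... | yes _ = just (tailv ds)
  ... | no _ = nothing
  tgt (ik _) = nothing
  tgt (jk _ _) = nothing
  tgt (jx _) = nothing

  -- Every kind that tgt names is the canonical kind of a slot of one of the
  -- three lists (or of the extra variable w), and the named variable occupies
  -- that slot.
  data Src : Set where
    inC inU inD : Slot → Src
    atW : Src

  canon : Src → Kind
  canon (inC (mem p)) = pos LC p
  canon (inC end) = tl LC (suc (len cs))
  canon (inU (mem q)) = pos LU q
  canon (inU end) = tl LU (i + len us)
  canon (inD (mem p)) = pos LD p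
  canon (inD end) = tl LD (suc (len ds))
  canon atW = pos LD 0

  -- the u-list members are addressed by q with suc q ∸ i the member index
  Occ : Src → Var → Set
  Occ (inC a) x = AtSlot cs a x
  Occ (inU (mem q)) x = i ≤ q × AtSlot us (mem (suc q ∸ i)) x
  Occ (inU end) x = AtSlot us end x
  Occ (inD a) x = AtSlot ds a x
  Occ atW x = w ≡ x

  Inside : Src → Var → Set
  Inside (inC _) x = x ∈v cs
  Inside (inU _) x = x ∈v us
  Inside (inD _) x = x ∈v ds
  Inside atW x = w ≡ x

  occ-inside : ∀ s x → Occ s x → Inside s x
  occ-inside (inC a) x o = AtSlot-in cs olC a x o
  occ-inside (inU (mem q)) x (_ , o) = AtSlot-in us olU (mem _) x o
  occ-inside (inU end) x o = AtSlot-in us olU end x o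
  occ-inside (inD a) x o = AtSlot-in ds olD a x o
  occ-inside atW x o = o

  classify : ∀ k x → tgt k ≡ just x → Σ Src λ s → canon s ≡ k × Occ s x
  classify (pos LC p) x e = inC (mem p) , refl , varKth p cs x olC e
  classify (tl LC q) x e with q ≟ suc (len cs)
  classify (tl LC q) x e | yes refl = inC end , refl , just-injective e
  classify (tl LC q) x () | no _
  classify (pos LU q) x e with i ≤? q
  classify (pos LU q) x e | yes le = inU (mem q) , refl , le , varKth (suc q ∸ i) us x olU e
  classify (pos LU q) x () | no _
  classify (tl LU q) x e with q ≟ i + len us
  classify (tl LU q) x e | yes refl = inU end , refl , just-injective e
  classify (tl LU q) x () | no _
  classify (pos LD zero) x e = atW , refl , just-injective e
  classify (pos LD (suc p)) x e = inD (mem (suc p)) , refl , varKth (suc p) ds x olD e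
  classify (tl LD q) x e with q ≟ suc (len ds)
  classify (tl LD q) x e | yes refl = inD end , refl , just-injective e
  classify (tl LD q) x () | no _
  classify (ik _) x ()
  classify (jk _ _) x ()
  classify (jx _) x ()

  u-index-inj : ∀ q q' → i ≤ q → i ≤ q' → suc q ∸ i ≡ suc q' ∸ i → q ≡ q'
  u-index-inj q q' a b e = trans (sym (m∸n+n≡m a)) (trans (cong (_+ i) e') (m∸n+n≡m b))
    where
    e' : q ∸ i ≡ q' ∸ i
    e' = suc-injective (trans (sym (+-∸-assoc 1 a)) (trans e (+-∸-assoc 1 b)))

  sameU : ∀ a b x → Occ (inU a) x → Occ (inU b) x → a ≡ b
  sameU (mem q) (mem q') x (le , o) (le' , o') with AtSlot-unique us olU linU distU _ _ x o o'
  ... | e = cong mem (u-index-inj q q' le le' (mem-injective e))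
  sameU (mem q) end x (_ , o) o' with AtSlot-unique us olU linU distU _ _ x o o'
  ... | ()
  sameU end (mem q') x o (_ , o') with AtSlot-unique us olU linU distU _ _ x o o'
  ... | ()
  sameU end end x o o' = refl

  -- a variable occupies at most one slot: the lists are linear, have distinct
  -- members, are pairwise variable disjoint and do not contain w
  same : ∀ s s' x → Occ s x → Occ s' x → s ≡ s'
  same (inC a) (inC b) x o o' = cong inC (AtSlot-unique cs olC linC distC a b x o o')
  same (inU a) (inU b) x o o' = cong inU (sameU a b x o o')
  same (inD a) (inD b) x o o' = cong inD (AtSlot-unique ds olD linD distD a b x o o')
  same atW atW x o o' = refl
  same (inC a) (inU b) x o o' = ⊥-elim (dcu x (occ-inside (inC a) x o) (occ-inside (inU b) x o'))
  same (inC a) (inD b) x o o' = ⊥-elim (dcd x (occ-inside (inC a) x o) (occ-inside (inD b) x o'))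
  same (inC a) atW x o refl = ⊥-elim (wc (occ-inside (inC a) x o))
  same (inU a) (inC b) x o o' = ⊥-elim (dcu x (occ-inside (inC b) x o') (occ-inside (inU a) x o))
  same (inU a) (inD b) x o o' = ⊥-elim (dud x (occ-inside (inU a) x o) (occ-inside (inD b) x o'))
  same (inU a) atW x o refl = ⊥-elim (wu (occ-inside (inU a) x o))
  same (inD a) (inC b) x o o' = ⊥-elim (dcd x (occ-inside (inC b) x o') (occ-inside (inD a) x o))
  same (inD a) (inU b) x o o' = ⊥-elim (dud x (occ-inside (inU b) x o') (occ-inside (inD a) x o))
  same (inD a) atW x o refl = ⊥-elim (wd (occ-inside (inD a) x o))
  same atW (inC b) x refl o' = ⊥-elim (wc (occ-inside (inC b) x o'))
  same atW (inU b) x refl o' = ⊥-elim (wu (occ-inside (inU b) x o'))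
  same atW (inD b) x refl o' = ⊥-elim (wd (occ-inside (inD b) x o'))

  N : ℕ
  N = suc (bnd cs ⊔ bnd us ⊔ bnd ds ⊔ w)

  inside-bnd : ∀ s x → Inside s x → x ≤ bnd cs ⊔ bnd us ⊔ bnd ds ⊔ w
  inside-bnd (inC _) x p = m≤n⇒m≤n⊔o w (m≤n⇒m≤n⊔o (bnd ds) (m≤n⇒m≤n⊔o (bnd us) (<⇒≤ (bnd-ok cs x p))))
  inside-bnd (inU _) x p = m≤n⇒m≤n⊔o w (m≤n⇒m≤n⊔o (bnd ds) (m≤n⇒m≤o⊔n (bnd cs) (<⇒≤ (bnd-ok us x p))))
  inside-bnd (inD _) x p = m≤n⇒m≤n⊔o w (m≤n⇒m≤o⊔n (bnd cs ⊔ bnd us) (<⇒≤ (bnd-ok ds x p)))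
  inside-bnd atW x refl = m≤n⊔m _ w

  tgt-bnd : ∀ k x → tgt k ≡ just x → x < N
  tgt-bnd k x e with classify k x e
  ... | s , _ , o = s≤s (inside-bnd s x (occ-inside s x o))

  tgt-inj : ∀ k k' x → tgt k ≡ just x → tgt k' ≡ just x → k ≡ k'
  tgt-inj k k' x e e' with classify k x e | classify k' x e'
  ... | s , refl , o | s' , refl , o' = cong canon (same s s' x o o')

  open MkName tgt N tgt-bnd tgt-inj public
  open Derivation Name Name-inj
  open Queens i r

  injX : ∀ X j j' → 1 ≤ j → j < j' → j' ≤ i → psn X j ≢ psn X j'
  injX LC = injC
  injX LU = injU
  injX LD = injD

  open Main injX using (fS-hit; pqsO)

  -- The final extents are exactly the lengths of cs, us and [w|ds], since the
  -- lists are short: their last member is a queen or they have no members.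
  eC≡ : eS LC i ≡ suc (len cs)
  eC≡ = ≤-antisym (eS-ub LC i _ (s≤s z≤n) (λ j a b → s≤s (≤-trans (≤-reflexive (sr j a b)) (proj₂ (proj₂ (Kth-nth (kpos-ok j a b)))))))
                  lb
    where
    lb : suc (len cs) ≤ eS LC i
    lb with proj₂ sc
    ... | inj₁ (x , e) = ⊥-elim (noKthVar (subst (Kth (kpos 1) (num 1)) e (kpos-ok 1 ≤-refl i>0)))
    ... | inj₂ (s , lm , g) with gC (len cs) s (LastMem-Kth lm) g
    ...   | j , refl , a , b , e = ≤-trans (s≤s (≤-reflexive (trans e (sym (sr j a b))))) (eS-lb LC i j a b)

  eU≡ : eS LU i ≡ i + len us
  eU≡ = ≤-antisym (eS-ub LU i _ (m≤m+n i (len us)) ub) lb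
    where
    ub : ∀ j → 1 ≤ j → j ≤ i → suc (psn LU j) ≤ i + len us
    ub j a b with i ℕ.<? kpos j + j
    ... | no np = ≤-trans (≤-reflexive (spU≡ j a b)) (≤-trans (≮⇒≥ np) (m≤m+n i (len us)))
    ... | yes lt = ≤-trans (≤-reflexive (trans (spU≡ j a b) (sym (m+[n∸m]≡n (<⇒≤ lt))))) (+-monoʳ-≤ i (proj₂ (proj₂ (Kth-nth (posU j a b lt)))))
    lb : i + len us ≤ eS LU i
    lb with proj₂ su
    ... | inj₁ (x , refl) = subst (_≤ eS LU i) (sym (+-identityʳ i)) (e-mono LU i)
    ... | inj₂ (s , lm , g) with gU (len us) s (LastMem-Kth lm) g
    ...   | j , refl , a , b , lt , e = ≤-trans (≤-reflexive (trans (cong (λ z → i + z) e) (trans (m+[n∸m]≡n (<⇒≤ lt)) (sym (spU≡ j a b))))) (eS-lb LU i j a b)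

  eD≡ : eS LD i ≡ suc (len ds)
  eD≡ = ≤-antisym (eS-ub LD i _ h0 ub) lb
    where
    h0 : i ≤ suc (len ds)
    h0 = ≤-trans (≤-trans (≤-reflexive (sym (m+n∸m≡n 1 i))) (∸-monoˡ-≤ 1 (+-monoˡ-≤ i (kpos≥1 1 ≤-refl i>0))))
                 (≤-trans (proj₂ (proj₂ (Kth-nth (posD 1 ≤-refl i>0)))) (n≤1+n _))
    ub : ∀ j → 1 ≤ j → j ≤ i → suc (psn LD j) ≤ suc (len ds)
    ub j a b = s≤s (≤-trans (≤-reflexive (pD≡ j a b)) (proj₂ (proj₂ (Kth-nth (posD j a b)))))
    lb : suc (len ds) ≤ eS LD i
    lb with proj₂ sd
    ... | inj₁ (x , e) = ⊥-elim (noKthVar (subst (Kth _ (num 1)) e (posD 1 ≤-refl i>0)))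
    ... | inj₂ (s , lm , g) with gD (len ds) s (LastMem-Kth lm) g
    ...   | j , refl , a , b , e = ≤-trans (s≤s (≤-reflexive (trans e (sym (pD≡ j a b))))) (eS-lb LD i j a b)

  tgtTC : tgt (tl LC (suc (len cs))) ≡ just (tailv cs)
  tgtTC with suc (len cs) ≟ suc (len cs)
  ... | yes _ = refl
  ... | no n = ⊥-elim (n refl)

  tgtTU : tgt (tl LU (i + len us)) ≡ just (tailv us)
  tgtTU with i + len us ≟ i + len us
  ... | yes _ = refl
  ... | no n = ⊥-elim (n refl)

  tgtTD : tgt (tl LD (suc (len ds))) ≡ just (tailv ds)
  tgtTD with suc (len ds) ≟ suc (len ds)
  ... | yes _ = refl
  ... | no n = ⊥-elim (n refl)

  tgtU : ∀ q → tgt (pos LU (i + q)) ≡ isVar (nth (suc q) us)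
  tgtU q with i ≤? i + q
  ... | yes _ = cong (λ z → isVar (nth z us)) (trans (cong (_∸ i) (sym (+-suc i q))) (m+n∸m≡n i (suc q)))
  ... | no n = ⊥-elim (n (m≤m+n i q))

  FinC : finalList LC ≡ cs
  FinC = trans (cong (LT LC (fS LC i) 1) (cong (_∸ 1) eC≡)) (LTeq LC (fS LC i) 1 cs olC cell (Name-tgt (tl LC (suc (len cs))) (tailv cs) tgtTC))
    where
    cell : ∀ q → q < len cs → fS LC i (1 + q) ≡ nth (suc q) cs
    cell q lt with gvC (suc q) (nth (suc q) cs) (nth-Kth (suc q) cs olC (s≤s z≤n) lt)
    ... | inj₁ g with gC (suc q) _ (nth-Kth (suc q) cs olC (s≤s z≤n) lt) g
    ...   | j , e , a , b , pe = trans (cong (fS LC i) (trans pe (sym (sr j a b)))) (trans (fS-hit LC i j a b ≤-refl) (sym e))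
    cell q lt | inj₂ (x , e) =
      trans (unfilled LC i (suc q) (λ j a b pe → num≢var (trans (sym (proj₁ (Kth-nth (subst (λ z → Kth z (num j) cs) (trans (sym (sr j a b)) pe) (kpos-ok j a b))))) e)))
            (trans (cong var (Name-tgt (pos LC (suc q)) x (cong isVar e))) (sym e))

  FinU : finalList LU ≡ us
  FinU = trans (cong (LT LU (fS LU i) i) (trans (cong (_∸ i) eU≡) (m+n∸m≡n i (len us)))) (LTeq LU (fS LU i) i us olU cell (Name-tgt (tl LU (i + len us)) (tailv us) tgtTU))
    where
    cell : ∀ q → q < len us → fS LU i (i + q) ≡ nth (suc q) us
    cell q lt with gvU (suc q) (nth (suc q) us) (nth-Kth (suc q) us olU (s≤s z≤n) lt)
    ... | inj₁ g with gU (suc q) _ (nth-Kth (suc q) us olU (s≤s z≤n) lt) g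
    ...   | j , e , a , b , lt' , pe = trans (cong (fS LU i) (sym pj)) (trans (fS-hit LU i j a b ≤-refl) (sym e))
      where
      pj : psn LU j ≡ i + q
      pj = suc-injective (trans (spU≡ j a b) (trans (sym (m+[n∸m]≡n (<⇒≤ lt'))) (trans (cong (λ z → i + z) (sym pe)) (+-suc i q))))
    cell q lt | inj₂ (x , e) =
      trans (unfilled LU i (i + q) bad)
            (trans (cong var (Name-tgt (pos LU (i + q)) x (trans (tgtU q) (cong isVar e)))) (sym e))
      where
      bad : ∀ j → 1 ≤ j → j ≤ i → psn LU j ≢ i + q
      bad j a b pe = num≢var (trans (sym (proj₁ (Kth-nth (subst (λ z → Kth z (num j) us) l≡ (posU j a b lt'))))) e)
        where
        kj : kpos j + j ≡ i + suc q
        kj = trans (sym (spU≡ j a b)) (trans (cong suc pe) (sym (+-suc i q)))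
        lt' : i < kpos j + j
        lt' = subst (i <_) (sym kj) (m<m+n i 0<1+n)
        l≡ : kpos j + j ∸ i ≡ suc q
        l≡ = trans (cong (_∸ i) kj) (m+n∸m≡n i (suc q))

  FinD : finalList LD ≡ cons (var w) ds
  FinD = trans (cong (LT LD (fS LD i) 0) eD≡) (LTeq LD (fS LD i) 0 (cons (var w) ds) (ol-cons olD) cell (Name-tgt (tl LD (suc (len ds))) (tailv ds) tgtTD))
    where
    cell : ∀ q → q < suc (len ds) → fS LD i q ≡ nth (suc q) (cons (var w) ds)
    cell zero _ = unfilled LD i 0 (λ j a b ())
    cell (suc q) (s≤s lt) with gvD (suc q) (nth (suc q) ds) (nth-Kth (suc q) ds olD (s≤s z≤n) lt)
    ... | inj₁ g with gD (suc q) _ (nth-Kth (suc q) ds olD (s≤s z≤n) lt) g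
    ...   | j , e , a , b , pe = trans (cong (fS LD i) (trans pe (sym (pD≡ j a b)))) (trans (fS-hit LD i j a b ≤-refl) (sym e))
    cell (suc q) (s≤s lt) | inj₂ (x , e) =
      trans (unfilled LD i (suc q) (λ j a b pe → num≢var (trans (sym (proj₁ (Kth-nth (subst (λ z → Kth z (num j) ds) (trans (sym (pD≡ j a b)) pe) (posD j a b))))) e)))
            (trans (cong var (Name-tgt (pos LD (suc q)) x (cong isVar e))) (sym e))

  s0pqsO : O NQUEENS (atom pqs (num i) cs us (cons (var w) ds))
  s0pqsO = subst (O NQUEENS) (atomEq refl FinC FinU FinD) pqsO

zipP : LI → ℕ → List Var → List (Kind × Var)
zipP X s [] = []
zipP X s (x ∷ xs) = (pos X s , x) ∷ zipP X (suc s) xs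

zipP-vals : ∀ X s xs → map proj₂ (zipP X s xs) ≡ xs
zipP-vals X s [] = refl
zipP-vals X s (x ∷ xs) = cong (x ∷_) (zipP-vals X (suc s) xs)

zipP-keys : ∀ X s xs k → k ∈ map proj₁ (zipP X s xs) → Σ ℕ λ q → k ≡ pos X q × s ≤ q
zipP-keys X s (x ∷ xs) k (here refl) = s , refl , ≤-refl
zipP-keys X s (x ∷ xs) k (there p) with zipP-keys X (suc s) xs k p
... | q , e , le = q , e , ≤-trans (n≤1+n s) le

allKeys : ∀ X s xs (P : Kind → Set) → (∀ q → s ≤ q → P (pos X q)) → All P (map proj₁ (zipP X s xs))
allKeys X s [] P h = []
allKeys X s (x ∷ xs) P h = h s ≤-refl ∷ allKeys X (suc s) xs P (λ q le → h q (≤-trans (n≤1+n s) le))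

zipP-uniq : ∀ X s xs → Unique (map proj₁ (zipP X s xs))
zipP-uniq X s [] = []
zipP-uniq X s (x ∷ xs) = allKeys X (suc s) xs (pos X s ≢_) (λ q le e → <-irrefl (pinj e) le) ∷ zipP-uniq X (suc s) xs
  where
  pinj : ∀ {a b} → pos X a ≡ pos X b → a ≡ b
  pinj refl = refl

-- The atoms of S_pq: the most general pq atom solved by k walks and one
-- placement of the queen v, naming the walked cells and the final tails by
-- the variables of the target atom.
module SpqCase (v c₀ u₀ d₀ : Var) (cs us ds : List Var)
               (l1 : length cs ≡ length us) (l2 : length us ≡ length ds)
               (uq : Unique (v ∷ c₀ ∷ u₀ ∷ d₀ ∷ cs ++ us ++ ds)) where
  k : ℕ
  k = length cs
  K : ℕ
  K = suc (suc k)
  zs : List (Kind × Var)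
  zs = zipP LC 1 cs ++ zipP LU 1 us ++ zipP LD 1 ds
  asg : List (Kind × Var)
  asg = (ik 0 , v) ∷ (tl LC K , c₀) ∷ (tl LU K , u₀) ∷ (tl LD K , d₀) ∷ zs

  vals : map proj₂ asg ≡ v ∷ c₀ ∷ u₀ ∷ d₀ ∷ cs ++ us ++ ds
  vals = cong (λ z → v ∷ c₀ ∷ u₀ ∷ d₀ ∷ z)
    (trans (map-++ proj₂ (zipP LC 1 cs) _) (cong₂ _++_ (zipP-vals LC 1 cs)
      (trans (map-++ proj₂ (zipP LU 1 us) _) (cong₂ _++_ (zipP-vals LU 1 us) (zipP-vals LD 1 ds)))))

  uqv : Unique (map proj₂ asg)
  uqv = subst Unique (sym vals) uq

  open AssocName asg uqv public

  keysZ : map proj₁ zs ≡ map proj₁ (zipP LC 1 cs) ++ map proj₁ (zipP LU 1 us) ++ map proj₁ (zipP LD 1 ds)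
  keysZ = trans (map-++ proj₁ (zipP LC 1 cs) _) (cong (map proj₁ (zipP LC 1 cs) ++_) (map-++ proj₁ (zipP LU 1 us) _))

  allZ : ∀ (P : Kind → Set) → (∀ X q → P (pos X q)) → All P (map proj₁ zs)
  allZ P h = subst (All P) (sym keysZ) (AllP.++⁺ (allKeys LC 1 cs P (λ q _ → h LC q)) (AllP.++⁺ (allKeys LU 1 us P (λ q _ → h LU q)) (allKeys LD 1 ds P (λ q _ → h LD q))))

  disj : ∀ X Y s s' xs ys → X ≢ Y → ∀ {kk} → ¬ (kk ∈ map proj₁ (zipP X s xs) × kk ∈ map proj₁ (zipP Y s' ys))
  disj X Y s s' xs ys n (p , q) with zipP-keys X s xs _ p | zipP-keys Y s' ys _ q
  ... | a , refl , _ | b , e , _ = n (pi e)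
    where
    pi : ∀ {a b} → pos X a ≡ pos Y b → X ≡ Y
    pi refl = refl

  ukeys : Unique (map proj₁ asg)
  ukeys = ((λ ()) ∷ (λ ()) ∷ (λ ()) ∷ allZ _ (λ X q ())) ∷
          ((λ ()) ∷ (λ ()) ∷ allZ _ (λ X q ())) ∷
          ((λ ()) ∷ allZ _ (λ X q ())) ∷
          allZ _ (λ X q ()) ∷
          subst Unique (sym keysZ) (UP.++⁺ (zipP-uniq LC 1 cs) (UP.++⁺ (zipP-uniq LU 1 us) (zipP-uniq LD 1 ds) (λ (a , b) → disj LU LD 1 1 us ds (λ ()) (a , b)))
             (λ (a , b) → d2 a b))
    where
    d2 : ∀ {kk} → kk ∈ map proj₁ (zipP LC 1 cs) → kk ∈ map proj₁ (zipP LU 1 us) ++ map proj₁ (zipP LD 1 ds) → ⊥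
    d2 a b with ∈-++⁻ (map proj₁ (zipP LU 1 us)) b
    ... | inj₁ b' = disj LC LU 1 1 cs us (λ ()) (a , b')
    ... | inj₂ b' = disj LC LD 1 1 cs ds (λ ()) (a , b')

  NameOK : ∀ kk x → (kk , x) ∈ asg → Name kk ≡ x
  NameOK kk x p = Name-tgt kk x (lookup-all asg kk x ukeys p)

  open Derivation Name Name-inj

  NameAll : All (λ e → Name (proj₁ e) ≡ proj₂ e) asg
  NameAll = All.tabulate (λ {e} p → NameOK (proj₁ e) (proj₂ e) p)

  zsAll : All (λ e → Name (proj₁ e) ≡ proj₂ e) zs
  zsAll with NameAll
  ... | _ ∷ _ ∷ _ ∷ _ ∷ r = r

  allC : All (λ e → Name (proj₁ e) ≡ proj₂ e) (zipP LC 1 cs)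
  allC = AllP.++⁻ˡ (zipP LC 1 cs) zsAll
  allU : All (λ e → Name (proj₁ e) ≡ proj₂ e) (zipP LU 1 us)
  allU = AllP.++⁻ˡ (zipP LU 1 us) (AllP.++⁻ʳ (zipP LC 1 cs) zsAll)
  allD : All (λ e → Name (proj₁ e) ≡ proj₂ e) (zipP LD 1 ds)
  allD = AllP.++⁻ʳ (zipP LU 1 us) (AllP.++⁻ʳ (zipP LC 1 cs) zsAll)

  openEq : ∀ X (g : ℕ → Term) xs s x0 val →
           All (λ e → Name (proj₁ e) ≡ proj₂ e) (zipP X s xs) →
           (∀ q → s ≤ q → q < s + length xs → g q ≡ var (Name (pos X q))) →
           g (s + length xs) ≡ val → Name (tl X (suc (s + length xs))) ≡ x0 →
           LT X g s (suc (length xs)) ≡ openL (map var xs ++ val ∷ []) x0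
  openEq X g [] s x0 val _ hc hv ht rewrite +-identityʳ s = cong₂ cons hv (cong var ht)
  openEq X g (x ∷ xs) s x0 val (nx ∷ na) hc hv ht =
    cong₂ cons (trans (hc s ≤-refl (subst (s <_) (sym (+-suc s (length xs))) (s≤s (m≤m+n s _)))) (cong var nx))
      (openEq X g xs (suc s) x0 val na (λ q a b → hc q (≤-trans (n≤1+n s) a) (subst (q <_) (sym (+-suc s (length xs))) b))
        (trans (cong g (sym (+-suc s (length xs)))) hv) (trans (cong (λ z → Name (tl X (suc z))) (sym (+-suc s (length xs)))) ht))

  V QC QU QD : Var
  V = Name (ik 0)
  QC = Name (tl LC 1)
  QU = Name (tl LU 1)
  QD = Name (tl LD 1)
  Q : Atom
  Q = atom pq (var V) (var QC) (var QU) (var QD)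
  f0 : LI → ℕ → Term
  f0 X q = var (Name (pos X q))
  SS0 : LI → LS
  SS0 X = ls (f0 X) 1
  g : LI → ℕ → Term
  g X = upd (f0 X) (suc k) (var V)
  F : LI → Term
  F X = LT X (g X) 1 ((1 ⊔ suc (suc k)) ∸ 1)

  Φ : Subst → Set
  Φ θ = θ V ≡ var V × θ QC ≡ F LC × θ QU ≡ F LU × θ QD ≡ F LD
  Φ' : Subst → Set
  Φ' σ = σ V ≡ var V × sub σ (F LC) ≡ F LC × sub σ (F LU) ≡ F LU × sub σ (F LD) ≡ F LD

  ikV : IkT (var V)
  ikV x here = 0 , refl

  cok : ∀ X → CellOK X (f0 X)
  cok X q x here = inj₁ refl

  -- k walks along the initially empty lists, then v is placed at position k + 1.
  res : Res (λ x → x ∈vA Q) (Q ∷ []) Φ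
  res = pqWalk k {λ x → x ∈vA Q} {Φ} {Φ'} 0 0 0 (var V) (SS0 LC) (SS0 LU) (SS0 LD) 1 1 1 (suc k) (suc k) (suc k) []
    refl refl refl ≤-refl ≤-refl ≤-refl z≤n (cok LC) (cok LU) (cok LD)
    (λ q _ → refl) (λ q _ → refl) (λ q _ → refl) refl refl refl ikV []
    (λ θ θ' h (a , b , c , d) → trans (sym (h V)) a , trans (sym (h QC)) b , trans (sym (h QU)) c , trans (sym (h QD)) d)
    sub0
    (λ {U'} _ → var , done , refl , sub-id _ , sub-id _ , sub-id _)
    (λ θ (ea , eb , ec , ed) σ (a , b , c , d) →
        trans (cong (sub σ) (ed (var V) ikV)) a
      , trans (cong (sub σ) (ea 1 ≤-refl)) b
      , trans (cong (sub σ) (eb 1 ≤-refl)) c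
      , trans (cong (sub σ) (ec 1 ≤-refl)) d)
    where
    sub0 : (λ x → x ∈vA Q) ⊆O OldS (stamp 0 0 0 1 1 1)
    sub0 x (inj₁ here) = ik 0 , refl , z≤n
    sub0 x (inj₂ (inj₁ here)) = tl LC 1 , refl , ≤-refl
    sub0 x (inj₂ (inj₂ (inj₁ here))) = tl LU 1 , refl , ≤-refl
    sub0 x (inj₂ (inj₂ (inj₂ here))) = tl LD 1 , refl , ≤-refl

  Vv : V ≡ v
  Vv = NameOK (ik 0) v (here refl)

  FX : ∀ X xs x0 → length xs ≡ k → All (λ e → Name (proj₁ e) ≡ proj₂ e) (zipP X 1 xs) → Name (tl X K) ≡ x0 →
       F X ≡ openL (map var xs ++ var v ∷ []) x0
  FX X xs x0 lx al ht =
    trans (cong (λ z → LT X (g X) 1 (suc z)) (sym lx))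
      (openEq X (g X) xs 1 x0 (var v) al (λ q a b → upd-miss (f0 X) (suc k) (var V) q (λ e → <-irrefl (trans e (cong suc (sym lx))) b))
        (trans (cong (g X) (cong suc lx)) (trans (upd-hit (f0 X) (suc k) (var V)) (cong var Vv)))
        (trans (cong (λ z → Name (tl X (suc (suc z)))) lx) ht))

  spqO : O NQUEENS (atom pq (var v) (openL (map var cs ++ var v ∷ []) c₀) (openL (map var us ++ var v ∷ []) u₀) (openL (map var ds ++ var v ∷ []) d₀))
  spqO = pq , V , QC , QU , QD , uniq , proj₁ res , proj₁ (proj₂ res) , sym fin
    where
    uniq : Unique (V ∷ QC ∷ QU ∷ QD ∷ [])
    uniq = ((λ e → ik≢ {LC} {1} (Name-inj e)) ∷ (λ e → ik≢ {LU} {1} (Name-inj e)) ∷ (λ e → ik≢ {LD} {1} (Name-inj e)) ∷ []) ∷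
           ((λ e → t1 (Name-inj e)) ∷ (λ e → t2 (Name-inj e)) ∷ []) ∷ ((λ e → t3 (Name-inj e)) ∷ []) ∷ [] ∷ []
      where
      ik≢ : ∀ {X q} → ik 0 ≢ tl X q
      ik≢ ()
      t1 : tl LC 1 ≢ tl LU 1
      t1 ()
      t2 : tl LC 1 ≢ tl LD 1
      t2 ()
      t3 : tl LU 1 ≢ tl LD 1
      t3 ()
    φ = proj₂ (proj₂ res)
    fin : subA (proj₁ res) Q ≡ atom pq (var v) (openL (map var cs ++ var v ∷ []) c₀) (openL (map var us ++ var v ∷ []) u₀) (openL (map var ds ++ var v ∷ []) d₀)
    fin = atomEq (trans (proj₁ φ) (cong var Vv))
                 (trans (proj₁ (proj₂ φ)) (FX LC cs c₀ refl allC (NameOK (tl LC K) c₀ (there (here refl)))))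
                 (trans (proj₁ (proj₂ (proj₂ φ))) (FX LU us u₀ (sym l1) allU (NameOK (tl LU K) u₀ (there (there (here refl))))))
                 (trans (proj₂ (proj₂ (proj₂ φ))) (FX LD ds d₀ (sym (trans l1 l2)) allD (NameOK (tl LD K) d₀ (there (there (there (here refl)))))))

module Spqs2Case (a b c : Var) (u : Unique (a ∷ b ∷ c ∷ [])) where
  asg : List (Kind × Var)
  asg = (tl LC 1 , a) ∷ (tl LU 1 , b) ∷ (tl LD 1 , c) ∷ []
  open AssocName asg u
  open Derivation Name Name-inj using (Res; _⊆O_; stepL; nk; lkm)

  ukeys : Unique (map proj₁ asg)
  ukeys = ((λ ()) ∷ (λ ()) ∷ []) ∷ ((λ ()) ∷ []) ∷ [] ∷ []

  I0 A B' C' : Var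
  I0 = Name (ik 0)
  A = Name (tl LC 1)
  B' = Name (tl LU 1)
  C' = Name (tl LD 1)
  Q : Atom
  Q = atom pqs (var I0) (var A) (var B') (var C')
  X : ℕ → Var
  X n = Name (jk 0 n)
  bs : Bind
  bs = (I0 , zro) ∷ (X 0 , var A) ∷ (X 1 , var B') ∷ (X 2 , var C') ∷ []
  θ : Subst
  θ = look bs
  κ : ℕ → Kind
  κ x = jk 0 x
  H : Atom
  H = head (renC (λ x → Name (κ x)) clause₁)
  nd4 : ∀ k → k ≢ ik 0 → k ≢ jk 0 0 → k ≢ jk 0 1 → k ≢ jk 0 2 → NotDom (Name k) bs
  nd4 k p q r s = nk p ∷ nk q ∷ nk r ∷ nk s ∷ []
  θA : θ A ≡ var A
  θA = look-notdom A bs (nd4 (tl LC 1) (λ ()) (λ ()) (λ ()) (λ ()))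
  θB : θ B' ≡ var B'
  θB = look-notdom B' bs (nd4 (tl LU 1) (λ ()) (λ ()) (λ ()) (λ ()))
  θC : θ C' ≡ var C'
  θC = look-notdom C' bs (nd4 (tl LD 1) (λ ()) (λ ()) (λ ()) (λ ()))
  θI : θ I0 ≡ zro
  θI = look-hit I0 zro _
  θX0 : θ (X 0) ≡ var A
  θX0 = trans (lkm {jk 0 0} {ik 0} _ _ (λ ())) (look-hit (X 0) _ _)
  θX1 : θ (X 1) ≡ var B'
  θX1 = trans (lkm {jk 0 1} {ik 0} _ _ (λ ())) (trans (lkm {jk 0 1} {jk 0 0} _ _ (λ ())) (look-hit (X 1) _ _))
  θX2 : θ (X 2) ≡ var C'
  θX2 = trans (lkm {jk 0 2} {ik 0} _ _ (λ ())) (trans (lkm {jk 0 2} {jk 0 0} _ _ (λ ())) (trans (lkm {jk 0 2} {jk 0 1} _ _ (λ ())) (look-hit (X 2) _ _)))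
  uni : Unifier θ Q H
  uni = atomEq θI (trans θA (sym θX0)) (trans θB (sym θX1)) (trans θC (sym θX2))
  MP : Var → Term → Set
  MP = λ x t → ∀ σ → Unifier σ Q H → σ x ≡ sub σ t
  mgs : BP MP bs
  mgs = (λ σ u → arg1 u) ∷ (λ σ u → sym (arg2 u)) ∷ (λ σ u → sym (arg3 u)) ∷ (λ σ u → sym (arg4 u)) ∷ []
  RP : Var → Term → Set
  RP = λ x t → (x ∈vA Q ⊎ x ∈vA H) × (∀ y → y ∈v t → y ∈vA Q ⊎ y ∈vA H)
  rls : BP RP bs
  rls = (inj₁ (inj₁ here) , λ y ())
      ∷ (inj₂ (inj₂ (inj₁ here)) , λ { y here → inj₁ (inj₂ (inj₁ here)) })
      ∷ (inj₂ (inj₂ (inj₂ (inj₁ here))) , λ { y here → inj₁ (inj₂ (inj₂ (inj₁ here))) })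
      ∷ (inj₂ (inj₂ (inj₂ (inj₂ here))) , λ { y here → inj₁ (inj₂ (inj₂ (inj₂ here))) })
      ∷ []
  st st' : Stamp
  st = stamp 0 0 0 1 1 1
  st' = stamp 1 0 0 1 1 1
  sub0 : (λ x → x ∈vA Q) ⊆O OldS st
  sub0 x (inj₁ here) = ik 0 , refl , z≤n
  sub0 x (inj₂ (inj₁ here)) = tl LC 1 , refl , ≤-refl
  sub0 x (inj₂ (inj₂ (inj₁ here))) = tl LU 1 , refl , ≤-refl
  sub0 x (inj₂ (inj₂ (inj₂ here))) = tl LD 1 , refl , ≤-refl
  Φ : Subst → Set
  Φ θ' = subA θ' Q ≡ atom pqs zro (var A) (var B') (var C')
  res : Res (λ x → x ∈vA Q) (Q ∷ []) Φ
  res = stepL {Old = OldS st} {Old' = OldS st'} {Φ' = λ σ → ∀ x → σ x ≡ var x}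
    Q [] clause₁ (here refl) κ dec (λ x → refl) θ [] sub0 (λ y _ ()) (λ y _ → ≤-refl) mono
    (mguL Q H bs uni mgs) (relL Q H bs rls) refl (λ _ → var , done , λ x → refl) tr
    where
    dec : Kind → ℕ
    dec (jk _ s) = s
    dec _ = 0
    mono : ∀ k → OldS st k → OldS st' k
    mono (ik n) o = o
    mono (pos LC q) o = o
    mono (pos LU q) o = o
    mono (pos LD q) o = o
    mono (tl LC q) o = o
    mono (tl LU q) o = o
    mono (tl LD q) o = o
    mono (jk m s) ()
    mono (jx _) ()
    tr : ∀ σ → (∀ x → σ x ≡ var x) → Φ (θ ⨾ σ)
    tr σ h = atomEq (trans (cong (sub σ) θI) refl) (trans (cong (sub σ) θA) (h A)) (trans (cong (sub σ) θB) (h B')) (trans (cong (sub σ) θC) (h C'))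

  s2O : O NQUEENS (atom pqs zro (var a) (var b) (var c))
  s2O = pqs , I0 , A , B' , C' , uniq , proj₁ res , proj₁ (proj₂ res) ,
        sym (trans (proj₂ (proj₂ res)) (atomEq refl (cong var (na (tl LC 1) a (here refl))) (cong var (na (tl LU 1) b (there (here refl)))) (cong var (na (tl LD 1) c (there (there (here refl)))))))
    where
    na : ∀ k x → (k , x) ∈ asg → Name k ≡ x
    na k x p = Name-tgt k x (lookup-all asg k x ukeys p)
    uniq : Unique (I0 ∷ A ∷ B' ∷ C' ∷ [])
    uniq = (nk {ik 0} {tl LC 1} (λ ()) ∷ nk {ik 0} {tl LU 1} (λ ()) ∷ nk {ik 0} {tl LD 1} (λ ()) ∷ []) ∷ (nk {tl LC 1} {tl LU 1} (λ ()) ∷ nk {tl LC 1} {tl LD 1} (λ ()) ∷ []) ∷ (nk {tl LU 1} {tl LD 1} (λ ()) ∷ []) ∷ [] ∷ []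

mainTheorem4 : ∀ (B : Atom) → S0 B → O NQUEENS B
mainTheorem4 B (inj₁ (i , cs , us , ds , w , Beq , i>0 , wc , wu , wd , cor , pc , dcu , dcd , dud , sc , su , sd , gu , gd , upos)) =
  subst (O NQUEENS) (sym Beq) (S0pqsCase.s0pqsO i cs us ds w i>0 wc wu wd cor pc dcu dcd dud sc su sd gu gd upos)
mainTheorem4 B (inj₂ (inj₁ (a , b , c , u , Beq))) = subst (O NQUEENS) (sym Beq) (Spqs2Case.s2O a b c u)
mainTheorem4 B (inj₂ (inj₂ (v , c₀ , u₀ , d₀ , cs , us , ds , l1 , l2 , uq , Beq))) =
  subst (O NQUEENS) (sym Beq) (SpqCase.spqO v c₀ u₀ d₀ cs us ds l1 l2 uq)
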